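{- Let $n\ge 1$ be an integer and let $POH(n)$ be the planar octahedron network of dimension $n$. Then its first Zagreb index is $M_1(POH(n))=96n(9n-1)$.
   Context: All graphs are finite, simple, undirected; $\deg(u)$ is the degree of vertex $u$. The first Zagreb index is $M_1(G)=\sum_{uv\in E(G)}(\deg(u)+\deg(v))$. Honeycomb network $HC(n)$: $HC(1)$ is a hexagon (6-cycle); for $n\ge2$, $HC(n)$ is obtained from $HC(n-1)$ by adding a layer of hexagons around its boundary (so $HC(n)$ is the hexagonal patch of the hexagonal lattice with $n$ concentric layers of hexagons, having $6n^2$ vertices, $9n^2-3n$ edges and $6n$ vertices of degree 2). Silicate network $SL(n)$: place a silicon vertex on every vertex of $HC(n)$; subdivide every edge of $HC(n)$ once and call the new vertices oxygen vertices; attach one new pendant oxygen vertex to each of the $6n$ degree-2 silicon vertices; then every silicon vertex has exactly three oxygen neighbours, and join these three oxygen vertices pairwise (forming a triangle with the silicon vertex drawn at its centre). Each silicon vertex together with its three oxygen neighbours is a silicate cell; in the planar drawing each cell consists of three triangular faces, each formed by the silicon vertex and two of its oxygen neighbours. Planar octahedron network $POH(n)$: starting from $SL(n)$, in each silicate cell place a new vertex in each of the three triangular faces and join it to the two oxygen vertices of that face; join the three new vertices of the same cell pairwise; finally delete all silicon vertices. (Each cell thus becomes an octahedron graph.) -}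

module Defs where

open import Data.Bool using (Bool; true; false; _∧_; _∨_; not; if_then_else_)
open import Data.Nat as ℕ using (ℕ; suc; _∸_; _⊔_; _<ᵇ_; _≡ᵇ_)
open import Data.Integer as ℤ using (ℤ; +_; ∣_∣)
open import Data.Integer.DivMod using (_/ℕ_; _%ℕ_)
open import Data.Product using (_×_; _,_; proj₁; proj₂)
open import Data.List using (List; []; _∷_; map; filter; _++_; length; concatMap; upTo)
open import Relation.Nullary using (does)
open import Data.Bool using (T?)
open import Data.Bool.ListAction using (any)
open import Data.Nat.ListAction using (sum)
open import Function using (_∘_)

-- Finite simple graphs, given by a duplicate-free list of vertices and
-- a symmetric, irreflexive Boolean adjacency relation.  The vertex type
-- carries a Boolean equality test.

record Graph : Set₁ where
  field
    V     : Set
    eqV   : V → V → Bool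
    verts : List V
    adj   : V → V → Bool
open Graph public

pairs : {A : Set} → List A → List (A × A)
pairs []       = []
pairs (x ∷ xs) = map (λ y → x , y) xs ++ pairs xs

edges : (G : Graph) → List (V G × V G)
edges G = filter (λ e → T? (adj G (proj₁ e) (proj₂ e))) (pairs (verts G))

deg : (G : Graph) → V G → ℕ
deg G u = length (filter (λ v → T? (adj G u v)) (verts G))

M₁ : Graph → ℕ
M₁ G = sum (map (λ e → deg G (proj₁ e) ℕ.+ deg G (proj₂ e)) (edges G))

-- The hexagonal lattice, realised inside the triangular lattice ℤ².
-- Triangular-lattice point (i , j) (basis e₁, e₂ at 60°); its six
-- neighbours are (i,j) ± (1,0), ± (0,1), ± (1,-1).
-- Points with i - j ≡ 0 (mod 3) are hexagon centres, all other points
-- are the vertices of the hexagonal lattice; two hexagonal-lattice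
-- vertices are joined iff they are triangular-lattice neighbours.

Pt : Set
Pt = ℤ × ℤ

eqPt : Pt → Pt → Bool
eqPt (a , b) (c , d) = does (a ℤ.≟ c) ∧ does (b ℤ.≟ d)

offsets : List Pt
offsets = (+ 1 , + 0) ∷ (ℤ.- + 1 , + 0) ∷ (+ 0 , + 1) ∷ (+ 0 , ℤ.- + 1)
        ∷ (+ 1 , ℤ.- + 1) ∷ (ℤ.- + 1 , + 1) ∷ []

_⊕_ : Pt → Pt → Pt
(a , b) ⊕ (c , d) = (a ℤ.+ c , b ℤ.+ d)

triNbr : Pt → Pt → Bool
triNbr p q = any (λ d → eqPt (p ⊕ d) q) offsets

isCentre : Pt → Bool
isCentre (i , j) = (i ℤ.- j) %ℕ 3 ≡ᵇ 0

-- Hexagon centres form the triangular lattice spanned by u = (1,1),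
-- v = (2,-1) (with v - u = (1,-2) also a neighbour direction).  The
-- centre a·u + b·v is at hexagonal distance max(|a|,|b|,|a+b|) from the
-- central hexagon; HC(n) consists of the hexagons at distance ≤ n - 1
-- (the central hexagon plus n - 1 surrounding layers).
-- For a centre (i , j) = (a + 2b , a - b):  b = (i - j)/3,  a = j + b.
centreIn : ℕ → Pt → Bool
centreIn n (i , j) =
  isCentre (i , j) ∧ (dist <ᵇ n)
  where
  b : ℤ
  b = (i ℤ.- j) /ℕ 3
  a : ℤ
  a = j ℤ.+ b
  dist : ℕ
  dist = ∣ a ∣ ⊔ ∣ b ∣ ⊔ ∣ a ℤ.+ b ∣

-- all points of the box [-3n, 3n]²  (contains every vertex of HC(n))
range : ℕ → List ℤ
range n = map (λ k → + k ℤ.- + (3 ℕ.* n)) (upTo (suc (6 ℕ.* n)))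

box : ℕ → List Pt
box n = concatMap (λ i → map (λ j → i , j) (range n)) (range n)

inHC : ℕ → Pt → Bool
inHC n p = not (isCentre p) ∧ any (λ d → centreIn n (p ⊕ d)) offsets

adjHC : ℕ → Pt → Pt → Bool
adjHC n p q =
  not (isCentre p) ∧ not (isCentre q) ∧ triNbr p q ∧
  any (λ d → centreIn n (p ⊕ d) ∧ triNbr (p ⊕ d) q) offsets

HC : ℕ → Graph
HC n = record
  { V = Pt ; eqV = eqPt ; verts = filter (λ p → T? (inHC n p)) (box n)
  ; adj = adjHC n }

data SLV (A : Set) : Set where
  si : A → SLV A          -- silicon vertex on a vertex of G
  ed : A → A → SLV A      -- oxygen vertex subdividing the edge uv of G
  pe : A → SLV A          -- pendant oxygen vertex at a degree-2 vertex of G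

module _ (G : Graph) where
  private
    A = V G
    _==_ = eqV G

  eqSLV : SLV A → SLV A → Bool
  eqSLV (si x)   (si y)   = x == y
  eqSLV (ed x y) (ed z w) = (x == z) ∧ (y == w)
  eqSLV (pe x)   (pe y)   = x == y
  eqSLV _        _        = false

  isSi : SLV A → Bool
  isSi (si _) = true
  isSi _      = false

  siOx : A → SLV A → Bool
  siOx s (si _)   = false
  siOx s (ed x y) = (s == x) ∨ (s == y)
  siOx s (pe x)   = s == x

  adjSL : SLV A → SLV A → Bool
  adjSL (si _) (si _) = false
  adjSL (si s) o      = siOx s o
  adjSL o      (si s) = siOx s o
  adjSL o      o'     = not (eqSLV o o') ∧ any (λ s → siOx s o ∧ siOx s o') (verts G)

  SLof : Graph
  SLof = record
    { V = SLV A ; eqV = eqSLV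
    ; verts = map si (verts G)
           ++ map (λ e → ed (proj₁ e) (proj₂ e)) (edges G)
           ++ map pe (filter (λ v → T? (deg G v ≡ᵇ 2)) (verts G))
    ; adj = adjSL }

  data POV : Set where
    ox : SLV A → POV                     -- oxygen vertex of SL(G)
    nw : A → SLV A → SLV A → POV         -- new vertex in the face (s, o, o')

  eqPOV : POV → POV → Bool
  eqPOV (ox o)      (ox o')        = eqSLV o o'
  eqPOV (nw s o o') (nw t p p')    = (s == t) ∧ eqSLV o p ∧ eqSLV o' p'
  eqPOV _           _              = false

  oxNbrs : A → List (SLV A)
  oxNbrs s = filter (λ o → T? (adjSL (si s) o)) (verts SLof)

  adjPO : POV → POV → Bool
  adjPO (ox o)      (ox o')        = adjSL o o'
  adjPO (ox o)      (nw _ p p')    = eqSLV o p ∨ eqSLV o p'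
  adjPO (nw _ p p') (ox o)         = eqSLV o p ∨ eqSLV o p'
  adjPO (nw s o o') (nw t p p')    = (s == t) ∧ not (eqSLV o p ∧ eqSLV o' p')

  POHof : Graph
  POHof = record
    { V = POV ; eqV = eqPOV
    ; verts = map ox (filter (λ o → T? (not (isSi o))) (verts SLof))
           ++ concatMap (λ s → map (λ f → nw s (proj₁ f) (proj₂ f)) (pairs (oxNbrs s))) (verts G)
    ; adj = adjPO }

SL : ℕ → Graph
SL n = SLof (HC n)

POH : ℕ → Graph
POH n = POHof (HC n)

-- In POH(G) every face vertex and every pendant oxygen has degree 4 and every oxygen on an edge
-- of G has degree 8, so M₁(POH(G)) = Σ deg² is a sum over the vertices of G of weights 128
-- (degree 2) and 144 (degree 3).  For G = HC(n), the weight of a lattice vertex is a linear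
-- combination, by inclusion–exclusion, of indicators of the hexagons of HC(n) around it, so the
-- total is 768 H - 224 P + 96 T for the numbers H of hexagons, P of adjacent pairs and T of triples
-- of mutually adjacent hexagons.  In suitable coordinates each of these is the number of lattice
-- points in a rectangle minus two corner triangles, which gives H = 3n² - 3n + 1,
-- P = 9n² - 15n + 6 and T = 6(n - 1)².

module Submission where

open import Data.Bool using (Bool; true)
open import Relation.Binary.PropositionalEquality using (_≡_)

module Sums where

  open import Data.Bool using (Bool; true; false; _∧_; _∨_; not; if_then_else_)
  open import Data.Bool.Properties using (T?; T-≡; ∨-zeroʳ)
  open import Data.Bool.ListAction using (any)
  open import Data.Nat using (ℕ; suc; _+_; _*_)
  open import Data.Nat.Properties using (+-identityʳ; *-zeroʳ; *-distribˡ-+)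
  open import Data.Nat.ListAction using (sum)
  open import Data.Nat.ListAction.Properties using (sum-++)
  open import Data.Nat.Tactic.RingSolver using (solve-∀)
  open import Data.List using (List; []; _∷_; map; filter; _++_; length; concatMap; concat)
  open import Data.List.Properties using (map-++; map-∘; map-cong)
  open import Data.List.Membership.Propositional using (_∈_)
  open import Data.List.Membership.Propositional.Properties using (∈-filter⁻)
  open import Data.Product using (_×_; _,_; ∃)
  open import Data.Sum using (_⊎_; inj₁; inj₂)
  open import Data.Empty using (⊥; ⊥-elim)
  open import Function.Bundles using (Equivalence)
  open import Data.List.Relation.Unary.Any using (here; there)
  open import Function using (_∘_)
  open import Relation.Binary.PropositionalEquality

  private
    variable
      A B : Set

  𝟙 : Bool → ℕ
  𝟙 true  = 1
  𝟙 false = 0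

  ∑ : (A → ℕ) → List A → ℕ
  ∑ f xs = sum (map f xs)

  count : (A → Bool) → List A → ℕ
  count p = ∑ (𝟙 ∘ p)

  ∑-++ : (f : A → ℕ) (xs ys : List A) → ∑ f (xs ++ ys) ≡ ∑ f xs + ∑ f ys
  ∑-++ f xs ys = trans (cong sum (map-++ f xs ys)) (sum-++ (map f xs) (map f ys))

  ∑-map : (f : B → ℕ) (g : A → B) (xs : List A) → ∑ f (map g xs) ≡ ∑ (f ∘ g) xs
  ∑-map f g xs = cong sum (sym (map-∘ xs))

  ∑-concatMap : (f : B → ℕ) (g : A → List B) (xs : List A) →
    ∑ f (concatMap g xs) ≡ ∑ (∑ f ∘ g) xs
  ∑-concatMap f g []       = refl
  ∑-concatMap f g (x ∷ xs) =
    trans (∑-++ f (g x) (concat (map g xs))) (cong (∑ f (g x) +_) (∑-concatMap f g xs))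

  ∑-ext : {f g : A → ℕ} (xs : List A) → (∀ x → f x ≡ g x) → ∑ f xs ≡ ∑ g xs
  ∑-ext xs f≗g = cong sum (map-cong f≗g xs)

  ∑-cong : {f g : A → ℕ} (xs : List A) → (∀ x → x ∈ xs → f x ≡ g x) → ∑ f xs ≡ ∑ g xs
  ∑-cong []       _  = refl
  ∑-cong (x ∷ xs) eq = cong₂ _+_ (eq x (here refl)) (∑-cong xs (λ y y∈xs → eq y (there y∈xs)))

  ∑-+ : (f g : A → ℕ) (xs : List A) → ∑ (λ x → f x + g x) xs ≡ ∑ f xs + ∑ g xs
  ∑-+ f g []       = refl
  ∑-+ f g (x ∷ xs) = trans (cong (f x + g x +_) (∑-+ f g xs)) (interchange (f x) (g x) _ _)
    where
    interchange : ∀ a b c d → a + b + (c + d) ≡ a + c + (b + d)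
    interchange = solve-∀

  ∑-*ˡ : (c : ℕ) (f : A → ℕ) (xs : List A) → ∑ (λ x → c * f x) xs ≡ c * ∑ f xs
  ∑-*ˡ c f []       = sym (*-zeroʳ c)
  ∑-*ˡ c f (x ∷ xs) = trans (cong (c * f x +_) (∑-*ˡ c f xs)) (sym (*-distribˡ-+ c (f x) _))

  ∑-const : (c : ℕ) (xs : List A) → ∑ (λ _ → c) xs ≡ length xs * c
  ∑-const c []       = refl
  ∑-const c (x ∷ xs) = cong (c +_) (∑-const c xs)

  ∑-≡0 : (f : A → ℕ) (xs : List A) → (∀ x → x ∈ xs → f x ≡ 0) → ∑ f xs ≡ 0
  ∑-≡0 f xs f≡0 = trans (∑-cong xs f≡0) (trans (∑-const 0 xs) (*-zeroʳ (length xs)))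

  ∑-comm : (f : A → B → ℕ) (xs : List A) (ys : List B) →
    ∑ (λ x → ∑ (f x) ys) xs ≡ ∑ (λ y → ∑ (λ x → f x y) xs) ys
  ∑-comm f []       ys = sym (∑-≡0 _ ys (λ _ _ → refl))
  ∑-comm f (x ∷ xs) ys =
    trans (cong (∑ (f x) ys +_) (∑-comm f xs ys)) (sym (∑-+ (f x) (λ y → ∑ (λ x′ → f x′ y) xs) ys))

  ∑-filter : (f : A → ℕ) (p : A → Bool) (xs : List A) →
    ∑ f (filter (λ x → T? (p x)) xs) ≡ ∑ (λ x → if p x then f x else 0) xs
  ∑-filter f p []       = refl
  ∑-filter f p (x ∷ xs) with p x
  ... | true  = cong (f x +_) (∑-filter f p xs)
  ... | false = ∑-filter f p xs

  ∈-filterᵇ⁻ : {x : A} (p : A → Bool) {xs : List A} → x ∈ filter (λ y → T? (p y)) xs → x ∈ xs × p x ≡ true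
  ∈-filterᵇ⁻ p x∈ with ∈-filter⁻ (λ y → T? (p y)) x∈
  ... | x∈xs , px = x∈xs , Equivalence.to T-≡ px

  length-filter : (p : A → Bool) (xs : List A) → length (filter (λ x → T? (p x)) xs) ≡ count p xs
  length-filter p []       = refl
  length-filter p (x ∷ xs) with p x
  ... | true  = cong suc (length-filter p xs)
  ... | false = length-filter p xs

  if-then-0 : (b : Bool) (n : ℕ) → (if b then n else 0) ≡ 𝟙 b * n
  if-then-0 true  n = sym (+-identityʳ n)
  if-then-0 false n = refl

  if-then-𝟙 : ∀ {a b} → (b ≡ true → a ≡ true) → (if a then 𝟙 b else 0) ≡ 𝟙 b
  if-then-𝟙 {true}          _   = refl
  if-then-𝟙 {false} {false} _   = refl
  if-then-𝟙 {false} {true}  b⇒a with () ← b⇒a refl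

  𝟙-∧ : ∀ a b → 𝟙 (a ∧ b) ≡ 𝟙 a * 𝟙 b
  𝟙-∧ true  b = sym (+-identityʳ (𝟙 b))
  𝟙-∧ false b = refl

  𝟙-∨ : ∀ a b → 𝟙 (a ∨ b) + 𝟙 (a ∧ b) ≡ 𝟙 a + 𝟙 b
  𝟙-∨ true  true  = refl
  𝟙-∨ true  false = refl
  𝟙-∨ false b     = +-identityʳ (𝟙 b)

  ∧-true⁻ : ∀ {a b} → a ∧ b ≡ true → a ≡ true × b ≡ true
  ∧-true⁻ {true} {true} _ = refl , refl

  ∧-true⁺ : ∀ {a b} → a ≡ true → b ≡ true → a ∧ b ≡ true
  ∧-true⁺ refl refl = refl

  ∨-true⁻ : ∀ {a b} → a ∨ b ≡ true → a ≡ true ⊎ b ≡ true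
  ∨-true⁻ {true}  _ = inj₁ refl
  ∨-true⁻ {false} b = inj₂ b

  any-true⁻ : (f : A → Bool) (xs : List A) → any f xs ≡ true → ∃ λ x → x ∈ xs × f x ≡ true
  any-true⁻ f (x ∷ xs) e with f x in fx
  ... | true  = x , here refl , fx
  ... | false = let y , y∈ , fy = any-true⁻ f xs e in y , there y∈ , fy

  any-true⁺ : (f : A → Bool) {xs : List A} {x : A} → x ∈ xs → f x ≡ true → any f xs ≡ true
  any-true⁺ f {x = x} (here refl) fx rewrite fx = refl
  any-true⁺ f {y ∷ _} (there x∈) fx rewrite any-true⁺ f x∈ fx = ∨-zeroʳ (f y)

  bool-ext : ∀ {a b} → (a ≡ true → b ≡ true) → (b ≡ true → a ≡ true) → a ≡ b
  bool-ext {true}  {true}  _ _ = refl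
  bool-ext {true}  {false} a⇒b _ = sym (a⇒b refl)
  bool-ext {false} {true}  _ b⇒a = b⇒a refl
  bool-ext {false} {false} _ _ = refl

  any-ext : {f g : A → Bool} (xs : List A) → (∀ x → f x ≡ g x) → any f xs ≡ any g xs
  any-ext []       _   = refl
  any-ext (x ∷ xs) f≗g = cong₂ _∨_ (f≗g x) (any-ext xs f≗g)

  any-cong : {f g : A → Bool} (xs : List A) → (∀ x → x ∈ xs → f x ≡ g x) → any f xs ≡ any g xs
  any-cong []       _   = refl
  any-cong (x ∷ xs) f≗g = cong₂ _∨_ (f≗g x (here refl)) (any-cong xs (λ y y∈ → f≗g y (there y∈)))

  any-∨ : (f g : A → Bool) (xs : List A) → any (λ x → f x ∨ g x) xs ≡ any f xs ∨ any g xs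
  any-∨ f g []       = refl
  any-∨ f g (x ∷ xs) rewrite any-∨ f g xs = shuffle (f x) (g x) (any f xs) (any g xs)
    where
    shuffle : ∀ a b c d → (a ∨ b) ∨ (c ∨ d) ≡ (a ∨ c) ∨ (b ∨ d)
    shuffle true  _     _ _ = refl
    shuffle false true  c _ = sym (∨-zeroʳ c)
    shuffle false false _ _ = refl

  𝟙-∨-disjoint : ∀ a b → (a ≡ true → b ≡ true → ⊥) → 𝟙 (a ∨ b) ≡ 𝟙 a + 𝟙 b
  𝟙-∨-disjoint true  true  apart = ⊥-elim (apart refl refl)
  𝟙-∨-disjoint true  false _     = refl
  𝟙-∨-disjoint false b     _     = refl

  𝟙-split : ∀ a b → 𝟙 b ≡ 𝟙 (a ∧ b) + 𝟙 (not a ∧ b)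
  𝟙-split true  b = sym (+-identityʳ _)
  𝟙-split false b = refl

  count-∧ : (b : Bool) (q : A → Bool) (xs : List A) → count (λ x → b ∧ q x) xs ≡ 𝟙 b * count q xs
  count-∧ true  q xs = sym (+-identityʳ _)
  count-∧ false q xs = ∑-≡0 _ xs (λ _ _ → refl)

  count-split : (p q : A → Bool) (xs : List A) →
    count q xs ≡ count (λ x → p x ∧ q x) xs + count (λ x → not (p x) ∧ q x) xs
  count-split p q xs = trans (∑-ext xs (λ x → 𝟙-split (p x) (q x))) (∑-+ _ _ xs)

  count-∨ : (p q : A → Bool) (xs : List A) →
    count (λ x → p x ∨ q x) xs + count (λ x → p x ∧ q x) xs ≡ count p xs + count q xs
  count-∨ p q xs = trans (sym (∑-+ _ _ xs)) (trans (∑-ext xs (λ x → 𝟙-∨ (p x) (q x))) (∑-+ _ _ xs))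

module BoolEquality {A : Set} (eq : A → A → Bool)
  (eq-sound : ∀ x y → eq x y ≡ true → x ≡ y) (eq-refl : ∀ x → eq x x ≡ true) where

  open import Data.Bool using (Bool; true; false; _∧_; _∨_; not)
  open import Data.Bool.Properties using (∨-zeroʳ; ∧-zeroʳ)
  open import Data.Bool.ListAction using (any)
  open import Data.Nat using (ℕ; _*_; _≟_)
  open import Data.Nat.Properties using (+-identityʳ; *-identityʳ)
  open import Data.List using (List; []; _∷_)
  open import Data.List.Membership.Propositional using (_∈_; _∉_)
  open import Data.List.Relation.Unary.Any using (here; there)
  open import Data.List.Relation.Unary.All as All using (All)
  open import Data.List.Relation.Unary.AllPairs using ([]; _∷_)
  open import Data.List.Relation.Unary.Unique.Propositional using (Unique)
  open import Data.Product using (_×_; _,_; proj₁; proj₂)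
  open import Data.Empty using (⊥; ⊥-elim)
  open import Relation.Nullary using (yes; no)
  open import Relation.Binary.PropositionalEquality
  open import Defs using (pairs)
  open Sums

  eq-false : ∀ {x y} → x ≢ y → eq x y ≡ false
  eq-false {x} {y} x≢y with eq x y in e
  ... | true  = ⊥-elim (x≢y (eq-sound x y e))
  ... | false = refl

  eq-sym : ∀ x y → eq x y ≡ eq y x
  eq-sym x y with eq y x in e
  ... | true  rewrite eq-sound y x e = eq-refl x
  ... | false = eq-false (λ { refl → ⊥-elim (true≢false (trans (sym (eq-refl x)) e)) })
    where
    true≢false : true ≢ false
    true≢false ()

  ∑-δ-∉ : ∀ a xs → a ∉ xs → (h : A → ℕ) → ∑ (λ y → 𝟙 (eq a y) * h y) xs ≡ 0
  ∑-δ-∉ a xs a∉xs h = ∑-≡0 _ xs (λ y y∈xs → cong (λ b → 𝟙 b * h y) (eq-false (λ { refl → a∉xs y∈xs })))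

  ∑-δ : ∀ a xs → Unique xs → a ∈ xs → (h : A → ℕ) → ∑ (λ y → 𝟙 (eq a y) * h y) xs ≡ h a
  ∑-δ a (x ∷ xs) (x≢xs ∷ _) (here refl) h
    rewrite eq-refl a | ∑-δ-∉ a xs (λ a∈xs → All.lookup x≢xs a∈xs refl) h =
      trans (+-identityʳ _) (+-identityʳ (h a))
  ∑-δ a (x ∷ xs) (x≢xs ∷ u) (there a∈xs) h
    rewrite eq-false {a} {x} (λ { refl → All.lookup x≢xs a∈xs refl }) = ∑-δ a xs u a∈xs h

  count-δ-∧ : ∀ a xs → Unique xs → a ∈ xs → (p : A → Bool) → count (λ y → eq a y ∧ p y) xs ≡ 𝟙 (p a)
  count-δ-∧ a xs u a∈xs p = trans (∑-ext xs (λ y → 𝟙-∧ (eq a y) (p y))) (∑-δ a xs u a∈xs (λ y → 𝟙 (p y)))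

  count-δ : ∀ a xs → Unique xs → a ∈ xs → count (eq a) xs ≡ 1
  count-δ a xs u a∈xs = trans (∑-ext xs (λ y → sym (*-identityʳ (𝟙 (eq a y))))) (∑-δ a xs u a∈xs (λ _ → 1))

  any-δ : ∀ a xs → a ∈ xs → (p : A → Bool) → any (λ y → eq y a ∧ p y) xs ≡ p a
  any-δ a xs a∈xs p = trans (any-ext xs same-∧) (any-const (p a) xs a∈xs)
    where
    same-∧ : ∀ y → (eq y a ∧ p y) ≡ (eq y a ∧ p a)
    same-∧ y with eq y a in e
    ... | true  rewrite eq-sound y a e = refl
    ... | false = refl
    any-const : ∀ b ys → a ∈ ys → any (λ y → eq y a ∧ b) ys ≡ b
    any-const false ys       _ = any-false ys
      where
      any-false : ∀ zs → any (λ z → eq z a ∧ false) zs ≡ false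
      any-false []       = refl
      any-false (z ∷ zs) = trans (cong (_∨ any _ zs) (∧-zeroʳ (eq z a))) (any-false zs)
    any-const true (y ∷ ys) (here refl) rewrite eq-refl a = refl
    any-const true (y ∷ ys) (there a∈ys) rewrite any-const true ys a∈ys = ∨-zeroʳ _

  δ-swap : (h : A → ℕ) → ∀ x y → 𝟙 (eq x y) * h y ≡ 𝟙 (eq y x) * h x
  δ-swap h x y with eq x y in e
  ... | true  rewrite eq-sound x y e | eq-refl y = refl
  ... | false rewrite eq-sym y x | e = refl

  ∑-δ-0 : (h : A → ℕ) → ∀ x ys → h x ≡ 0 → ∑ (λ y → 𝟙 (eq x y) * h y) ys ≡ 0
  ∑-δ-0 h x ys hx≡0 = ∑-≡0 _ ys (λ y _ → δ-term y)
    where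
    δ-term : ∀ y → 𝟙 (eq x y) * h y ≡ 0
    δ-term y with eq x y in e
    ... | true  rewrite sym (eq-sound x y e) = trans (+-identityʳ (h x)) hx≡0
    ... | false = refl

  -- Both sides equal the double sum of 𝟙 (eq x y) * h y over xs × ys.
  ∑-support : (h : A → ℕ) (xs ys : List A) → Unique xs → Unique ys →
    (∀ x → h x ≢ 0 → x ∈ xs → x ∈ ys) → (∀ y → h y ≢ 0 → y ∈ ys → y ∈ xs) → ∑ h xs ≡ ∑ h ys
  ∑-support h xs ys uxs uys xs⊆ys ys⊆xs = begin
    ∑ h xs                                       ≡⟨ ∑-cong xs (λ x x∈xs → sym (expand ys uys (xs⊆ys x) x∈xs)) ⟩
    ∑ (λ x → ∑ (λ y → 𝟙 (eq x y) * h y) ys) xs   ≡⟨ ∑-comm _ xs ys ⟩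
    ∑ (λ y → ∑ (λ x → 𝟙 (eq x y) * h y) xs) ys   ≡⟨ ∑-ext ys (λ y → ∑-ext xs (λ x → δ-swap h x y)) ⟩
    ∑ (λ y → ∑ (λ x → 𝟙 (eq y x) * h x) xs) ys   ≡⟨ ∑-cong ys (λ y y∈ys → expand xs uxs (ys⊆xs y) y∈ys) ⟩
    ∑ h ys                                       ∎
    where
    open ≡-Reasoning
    expand : ∀ zs → Unique zs → ∀ {ws x} → (h x ≢ 0 → x ∈ ws → x ∈ zs) → x ∈ ws →
      ∑ (λ z → 𝟙 (eq x z) * h z) zs ≡ h x
    expand zs uzs {x = x} ws⊆zs x∈ws with h x ≟ 0
    ... | yes hx≡0 = trans (∑-δ-0 h x zs hx≡0) (sym hx≡0)
    ... | no  hx≢0 = ∑-δ x zs uzs (ws⊆zs hx≢0 x∈ws) h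

  module _ {a b c : A} (distinct : Unique (a ∷ b ∷ c ∷ [])) where

    private
      uncons : ∀ {x : A} {xs} → Unique (x ∷ xs) → All (x ≢_) xs × Unique xs
      uncons (x≢xs ∷ u) = x≢xs , u
      a≢b : a ≢ b
      a≢b = All.lookup (proj₁ (uncons distinct)) (here refl)
      a≢c : a ≢ c
      a≢c = All.lookup (proj₁ (uncons distinct)) (there (here refl))
      b≢c : b ≢ c
      b≢c = All.lookup (proj₁ (uncons (proj₂ (uncons distinct)))) (here refl)
      apart : ∀ {x y o} → x ≢ y → eq o x ≡ true → eq o y ≡ true → ⊥
      apart x≢y ox oy = x≢y (trans (sym (eq-sound _ _ ox)) (eq-sound _ _ oy))

    count-pairs-∋ : ∀ o → count (λ f → eq o (proj₁ f) ∨ eq o (proj₂ f)) (pairs (a ∷ b ∷ c ∷ []))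
                          ≡ 2 * count (eq o) (a ∷ b ∷ c ∷ [])
    count-pairs-∋ o with eq o a in oa | eq o b in ob | eq o c in oc
    ... | false | false | false = refl
    ... | true  | false | false = refl
    ... | false | true  | false = refl
    ... | false | false | true  = refl
    ... | true  | true  | _     = ⊥-elim (apart a≢b oa ob)
    ... | true  | false | true  = ⊥-elim (apart a≢c oa oc)
    ... | false | true  | true  = ⊥-elim (apart b≢c ob oc)

    count-pairs-≢ : ∀ {f} → f ∈ pairs (a ∷ b ∷ c ∷ []) →
      count (λ g → not (eq (proj₁ f) (proj₁ g) ∧ eq (proj₂ f) (proj₂ g))) (pairs (a ∷ b ∷ c ∷ [])) ≡ 2
    count-pairs-≢ (here refl)
      rewrite eq-refl a | eq-refl b | eq-false a≢b | eq-false b≢c = refl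
    count-pairs-≢ (there (here refl))
      rewrite eq-refl a | eq-refl c | eq-false a≢b | eq-false (≢-sym b≢c) = refl
    count-pairs-≢ (there (there (here refl)))
      rewrite eq-refl b | eq-refl c | eq-false (≢-sym a≢b) = refl

module Handshake where

  open import Data.Bool using (Bool; false; if_then_else_)

  open import Data.Nat using (ℕ; _+_; _*_)
  open import Data.Nat.Properties using (*-comm; *-identityˡ; *-distribˡ-+; +-assoc)
  open import Data.List using (List; []; _∷_; map; _++_; length)
  open import Data.List.Membership.Propositional using (_∈_; _∉_)
  open import Data.List.Membership.Propositional.Properties using (∈-++⁻; ∈-map⁻)
  open import Data.List.Relation.Unary.Any using (here; there)
  open import Data.List.Relation.Unary.All as All using (All)
  open import Data.List.Relation.Unary.AllPairs using ([]; _∷_)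
  open import Data.List.Relation.Unary.Unique.Propositional using (Unique)
  import Data.List.Relation.Unary.Unique.Propositional.Properties as Unique
  open import Data.Product using (_×_; _,_; proj₁; proj₂)
  open import Data.Sum using (inj₁; inj₂)
  open import Data.Empty using (⊥)
  open import Relation.Binary.PropositionalEquality
  open import Defs using (Graph; V; verts; adj; pairs; edges; deg; M₁)
  open Sums

  private
    variable
      A : Set

  ∈-pairs⁻ : ∀ {x y} (xs : List A) → (x , y) ∈ pairs xs → x ∈ xs × y ∈ xs
  ∈-pairs⁻ (z ∷ zs) xy∈ with ∈-++⁻ (map (z ,_) zs) xy∈
  ... | inj₁ xy∈head with ∈-map⁻ (z ,_) xy∈head
  ...   | _ , y∈zs , refl = here refl , there y∈zs
  ∈-pairs⁻ (z ∷ zs) xy∈ | inj₂ xy∈tail = let x∈ , y∈ = ∈-pairs⁻ zs xy∈tail in there x∈ , there y∈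

  pairs-≢ : ∀ {x y} (xs : List A) → Unique xs → (x , y) ∈ pairs xs → x ≢ y
  pairs-≢ (z ∷ zs) (z≢zs ∷ u) xy∈ with ∈-++⁻ (map (z ,_) zs) xy∈
  ... | inj₁ xy∈head with ∈-map⁻ (z ,_) xy∈head
  ...   | _ , y∈zs , refl = All.lookup z≢zs y∈zs
  pairs-≢ (z ∷ zs) (_ ∷ u) xy∈ | inj₂ xy∈tail = pairs-≢ zs u xy∈tail

  pairs-asym : ∀ {x y} (xs : List A) → Unique xs → (x , y) ∈ pairs xs → (y , x) ∉ pairs xs
  pairs-asym (z ∷ zs) (z≢zs ∷ u) xy∈ yx∈
    with ∈-++⁻ (map (z ,_) zs) xy∈ | ∈-++⁻ (map (z ,_) zs) yx∈
  ... | inj₁ p | inj₁ q with ∈-map⁻ (z ,_) p | ∈-map⁻ (z ,_) q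
  ...   | _ , y∈zs , refl | _ , _ , refl = All.lookup z≢zs y∈zs refl
  pairs-asym (z ∷ zs) (z≢zs ∷ u) xy∈ yx∈ | inj₁ p | inj₂ q with ∈-map⁻ (z ,_) p
  ...   | _ , _ , refl = All.lookup z≢zs (proj₂ (∈-pairs⁻ zs q)) refl
  pairs-asym (z ∷ zs) (z≢zs ∷ u) xy∈ yx∈ | inj₂ p | inj₁ q with ∈-map⁻ (z ,_) q
  ...   | _ , _ , refl = All.lookup z≢zs (proj₂ (∈-pairs⁻ zs p)) refl
  pairs-asym (z ∷ zs) (_ ∷ u) xy∈ yx∈ | inj₂ p | inj₂ q = pairs-asym zs u p q

  Unique-pairs : (xs : List A) → Unique xs → Unique (pairs xs)
  Unique-pairs []       []          = []
  Unique-pairs (x ∷ xs) (x≢xs ∷ u) =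
    Unique.++⁺ (Unique.map⁺ (cong proj₂) u) (Unique-pairs xs u) disjoint
    where
    disjoint : ∀ {p} → p ∈ map (x ,_) xs × p ∈ pairs xs → ⊥
    disjoint (p∈head , p∈tail) with ∈-map⁻ (x ,_) p∈head
    ... | _ , _ , refl = All.lookup x≢xs (proj₁ (∈-pairs⁻ xs p∈tail)) refl

  module _ (a : A → A → Bool) (a-sym : ∀ x y → a x y ≡ a y x) (a-irrefl : ∀ x → a x x ≡ false) where

    ∑-pairs : (g : A → ℕ) (xs : List A) →
      ∑ (λ e → 𝟙 (a (proj₁ e) (proj₂ e)) * (g (proj₁ e) + g (proj₂ e))) (pairs xs) ≡ ∑ (λ v → g v * count (a v) xs) xs
    ∑-pairs g []       = refl
    ∑-pairs g (x ∷ xs) = begin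
      ∑ F (map (x ,_) xs ++ pairs xs)
        ≡⟨ ∑-++ F (map (x ,_) xs) (pairs xs) ⟩
      ∑ F (map (x ,_) xs) + ∑ F (pairs xs)
        ≡⟨ cong₂ _+_ (trans (∑-map F (x ,_) xs) (∑-ext xs (λ y → *-distribˡ-+ (𝟙 (a x y)) (g x) (g y)))) (∑-pairs g xs) ⟩
      ∑ (λ y → 𝟙 (a x y) * g x + 𝟙 (a x y) * g y) xs + ∑ (λ v → g v * count (a v) xs) xs
        ≡⟨ cong (_+ ∑ (λ v → g v * count (a v) xs) xs) (∑-+ _ _ xs) ⟩
      ∑ (λ y → 𝟙 (a x y) * g x) xs + ∑ (λ y → 𝟙 (a x y) * g y) xs + ∑ (λ v → g v * count (a v) xs) xs
        ≡⟨ cong₂ (λ s t → s + t + ∑ (λ v → g v * count (a v) xs) xs) from-x to-x ⟩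
      g x * count (a x) (x ∷ xs) + ∑ (λ v → g v * 𝟙 (a v x)) xs + ∑ (λ v → g v * count (a v) xs) xs
        ≡⟨ +-assoc (g x * count (a x) (x ∷ xs)) _ _ ⟩
      g x * count (a x) (x ∷ xs) + (∑ (λ v → g v * 𝟙 (a v x)) xs + ∑ (λ v → g v * count (a v) xs) xs)
        ≡⟨ cong (g x * count (a x) (x ∷ xs) +_) (sym (trans (∑-ext xs (λ v → *-distribˡ-+ (g v) (𝟙 (a v x)) _)) (∑-+ _ _ xs))) ⟩
      g x * count (a x) (x ∷ xs) + ∑ (λ v → g v * count (a v) (x ∷ xs)) xs
        ∎
      where
      open ≡-Reasoning
      F : A × A → ℕ
      F e = 𝟙 (a (proj₁ e) (proj₂ e)) * (g (proj₁ e) + g (proj₂ e))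
      from-x : ∑ (λ y → 𝟙 (a x y) * g x) xs ≡ g x * count (a x) (x ∷ xs)
      from-x = begin
        ∑ (λ y → 𝟙 (a x y) * g x) xs ≡⟨ ∑-ext xs (λ y → *-comm (𝟙 (a x y)) (g x)) ⟩
        ∑ (λ y → g x * 𝟙 (a x y)) xs ≡⟨ ∑-*ˡ (g x) (λ y → 𝟙 (a x y)) xs ⟩
        g x * count (a x) xs         ≡⟨ cong (λ b → g x * (𝟙 b + count (a x) xs)) (a-irrefl x) ⟨
        g x * count (a x) (x ∷ xs)   ∎
      to-x : ∑ (λ y → 𝟙 (a x y) * g y) xs ≡ ∑ (λ v → g v * 𝟙 (a v x)) xs
      to-x = ∑-ext xs (λ v → trans (*-comm (𝟙 (a x v)) (g v)) (cong (λ b → g v * 𝟙 b) (a-sym x v)))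

  module _ (G : Graph) (adj-sym : ∀ x y → adj G x y ≡ adj G y x) (adj-irrefl : ∀ x → adj G x x ≡ false) where

    ∑-edges : (g : V G → ℕ) →
      ∑ (λ e → g (proj₁ e) + g (proj₂ e)) (edges G) ≡ ∑ (λ v → g v * deg G v) (verts G)
    ∑-edges g = begin
      ∑ (λ e → g (proj₁ e) + g (proj₂ e)) (edges G)
        ≡⟨ ∑-filter _ (λ e → adj G (proj₁ e) (proj₂ e)) (pairs (verts G)) ⟩
      ∑ (λ e → if adj G (proj₁ e) (proj₂ e) then g (proj₁ e) + g (proj₂ e) else 0) (pairs (verts G))
        ≡⟨ ∑-ext (pairs (verts G)) (λ e → if-then-0 (adj G (proj₁ e) (proj₂ e)) _) ⟩
      ∑ (λ e → 𝟙 (adj G (proj₁ e) (proj₂ e)) * (g (proj₁ e) + g (proj₂ e))) (pairs (verts G))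
        ≡⟨ ∑-pairs (adj G) adj-sym adj-irrefl g (verts G) ⟩
      ∑ (λ v → g v * count (adj G v) (verts G)) (verts G)
        ≡⟨ ∑-ext (verts G) (λ v → cong (g v *_) (length-filter (adj G v) (verts G))) ⟨
      ∑ (λ v → g v * deg G v) (verts G)
        ∎
      where open ≡-Reasoning

    M₁≡∑deg² : M₁ G ≡ ∑ (λ v → deg G v * deg G v) (verts G)
    M₁≡∑deg² = ∑-edges (deg G)

    ∑deg≡2*edges : ∑ (deg G) (verts G) ≡ 2 * length (edges G)
    ∑deg≡2*edges = begin
      ∑ (deg G) (verts G)                   ≡⟨ ∑-ext (verts G) (λ v → sym (*-identityˡ (deg G v))) ⟩
      ∑ (λ v → 1 * deg G v) (verts G)       ≡⟨ ∑-edges (λ _ → 1) ⟨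
      ∑ (λ _ → 2) (edges G)                 ≡⟨ ∑-const 2 (edges G) ⟩
      length (edges G) * 2                  ≡⟨ *-comm (length (edges G)) 2 ⟩
      2 * length (edges G)                  ∎
      where open ≡-Reasoning

module Octahedral where

  open import Data.Bool using (Bool; true; false; _∧_; _∨_; not; if_then_else_; T)
  open import Data.Bool.Properties using (T?; ∧-comm; ∨-zeroʳ; ∧-distribʳ-∨)
  open import Data.Bool.ListAction using (any)
  open import Data.Nat using (ℕ; _+_; _*_; _≡ᵇ_)
  open import Data.Nat.Properties using (*-comm; +-comm; +-cancelʳ-≡)
  open import Data.Nat.Tactic.RingSolver using (solve-∀)
  open import Data.List using (List; []; _∷_; map; filter; _++_; length; concatMap)
  open import Data.List.Properties using (filter-++; filter-≐; filter-all; filter-none)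
  open import Data.List.Relation.Unary.All as All using (All)
  open import Data.List.Membership.Propositional using (_∈_)
  open import Data.List.Membership.Propositional.Properties using (∈-++⁻; ∈-++⁺ˡ; ∈-++⁺ʳ; ∈-map⁻; ∈-map⁺)
  open import Data.List.Relation.Unary.AllPairs using ([]; _∷_)
  open import Data.List.Relation.Unary.Unique.Propositional using (Unique)
  import Data.List.Relation.Unary.Unique.Propositional.Properties as Unique
  open import Data.Product using (_×_; _,_; proj₁; proj₂; ∃)
  open import Data.Sum using (_⊎_; inj₁; inj₂)
  open import Data.Empty using (⊥; ⊥-elim)
  open import Function using (_∘_)
  open import Relation.Nullary using (¬_)
  open import Relation.Unary using (_≐_)
  open import Relation.Binary.PropositionalEquality
  open import Defs
  open Sums
  open Handshake

  record IsSimple (G : Graph) : Set where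
    field
      eq-sound     : ∀ x y → eqV G x y ≡ true → x ≡ y
      eq-refl      : ∀ x → eqV G x x ≡ true
      verts-unique : Unique (verts G)
      adj-sym      : ∀ x y → adj G x y ≡ adj G y x
      adj-irrefl   : ∀ x → adj G x x ≡ false

  module _ (G : Graph) (simple : IsSimple G)
    (deg-2-or-3 : ∀ v → v ∈ verts G → deg G v ≡ 2 ⊎ deg G v ≡ 3) where

    open IsSimple simple
    private
      A = V G
      Vs = verts G
      Es = edges G
      _==_ = eqV G
      eqO = eqSLV G

    open BoolEquality (eqV G) eq-sound eq-refl

    eqO-sound : ∀ o o′ → eqO o o′ ≡ true → o ≡ o′
    eqO-sound (si x)   (si y)   e = cong si (eq-sound x y e)
    eqO-sound (ed x y) (ed z w) e = let x≡z , y≡w = ∧-true⁻ e in cong₂ ed (eq-sound x z x≡z) (eq-sound y w y≡w)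
    eqO-sound (pe x)   (pe y)   e = cong pe (eq-sound x y e)
    eqO-sound (si _)   (ed _ _) ()
    eqO-sound (si _)   (pe _)   ()
    eqO-sound (ed _ _) (si _)   ()
    eqO-sound (ed _ _) (pe _)   ()
    eqO-sound (pe _)   (si _)   ()
    eqO-sound (pe _)   (ed _ _) ()

    eqO-refl : ∀ o → eqO o o ≡ true
    eqO-refl (si x)   = eq-refl x
    eqO-refl (ed x y) rewrite eq-refl x | eq-refl y = refl
    eqO-refl (pe x)   = eq-refl x

    module EqO = BoolEquality eqO eqO-sound eqO-refl

    edgeOxygen : A × A → SLV A
    edgeOxygen (x , y) = ed x y

    pendantSites : List A
    pendantSites = filter (λ v → T? (deg G v ≡ᵇ 2)) Vs

    oxygens : List (SLV A)
    oxygens = map edgeOxygen Es ++ map pe pendantSites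

    cell : A → List (SLV A)
    cell s = filter (λ o → T? (siOx G s o)) oxygens

    ∈-edges⁻ : ∀ {x y} → (x , y) ∈ Es → x ∈ Vs × y ∈ Vs × adj G x y ≡ true
    ∈-edges⁻ xy∈ = let xy∈pairs , axy = ∈-filterᵇ⁻ (λ e → adj G (proj₁ e) (proj₂ e)) xy∈
                       x∈ , y∈ = ∈-pairs⁻ Vs xy∈pairs
                   in x∈ , y∈ , axy

    edge-≢ : ∀ {x y} → (x , y) ∈ Es → x ≢ y
    edge-≢ {x} xy∈ refl with () ← trans (sym (proj₂ (proj₂ (∈-edges⁻ xy∈)))) (adj-irrefl x)

    Unique-edges : Unique Es
    Unique-edges = Unique.filter⁺ _ (Unique-pairs Vs verts-unique)

    Unique-oxygens : Unique oxygens
    Unique-oxygens = Unique.++⁺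
      (Unique.map⁺ (λ { {_ , _} {_ , _} refl → refl }) Unique-edges)
      (Unique.map⁺ (λ { refl → refl }) (Unique.filter⁺ _ verts-unique))
      (λ { (o∈E , o∈P) → apart (∈-map⁻ edgeOxygen o∈E) (∈-map⁻ pe o∈P) })
      where
      apart : ∀ {o} → ∃ (λ e → e ∈ Es × o ≡ edgeOxygen e) → ∃ (λ v → v ∈ pendantSites × o ≡ pe v) → ⊥
      apart (_ , _ , refl) (_ , _ , ())

    ∈-oxygens⁻ : ∀ {o} → o ∈ oxygens →
      (∃ λ e → e ∈ Es × o ≡ edgeOxygen e) ⊎ (∃ λ v → v ∈ pendantSites × o ≡ pe v)
    ∈-oxygens⁻ o∈ with ∈-++⁻ (map edgeOxygen Es) o∈
    ... | inj₁ o∈E = inj₁ (∈-map⁻ edgeOxygen o∈E)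
    ... | inj₂ o∈P = inj₂ (∈-map⁻ pe o∈P)

    silicon-free : (p : SLV A → Bool) → (∀ v → p (si v) ≡ false) →
      filter (λ o → T? (p o)) (verts (SLof G)) ≡ filter (λ o → T? (p o)) oxygens
    silicon-free p p-si = trans (filter-++ (λ o → T? (p o)) (map si Vs) oxygens)
      (cong (_++ filter (λ o → T? (p o)) oxygens) (filter-none (λ o → T? (p o)) (All.tabulate rejected)))
      where
      rejected : ∀ {o} → o ∈ map si Vs → ¬ T (p o)
      rejected o∈ with ∈-map⁻ si o∈
      ... | v , _ , refl = subst T (p-si v)

    nonSilicon≡oxygens : filter (λ o → T? (not (isSi G o))) (verts (SLof G)) ≡ oxygens
    nonSilicon≡oxygens = trans (silicon-free (not ∘ isSi G) (λ _ → refl))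
      (filter-all (λ o → T? (not (isSi G o))) (All.tabulate accepted))
      where
      accepted : ∀ {o} → o ∈ oxygens → T (not (isSi G o))
      accepted o∈ with ∈-oxygens⁻ o∈
      ... | inj₁ (_ , _ , refl) = _
      ... | inj₂ (_ , _ , refl) = _

    oxNbrs≡cell : ∀ s → oxNbrs G s ≡ cell s
    oxNbrs≡cell s = trans (filter-≐ (λ o → T? (adjSL G (si s) o)) (λ o → T? (siOx G s o)) same (verts (SLof G)))
      (silicon-free (siOx G s) (λ _ → refl))
      where
      adj≡siOx : ∀ o → adjSL G (si s) o ≡ siOx G s o
      adj≡siOx (si _)   = refl
      adj≡siOx (ed _ _) = refl
      adj≡siOx (pe _)   = refl
      same : (λ o → T (adjSL G (si s) o)) ≐ (λ o → T (siOx G s o))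
      same = (λ {o} → subst T (adj≡siOx o)) , (λ {o} → subst T (sym (adj≡siOx o)))

    count-incident : ∀ s → s ∈ Vs → count (λ e → siOx G s (edgeOxygen e)) Es ≡ deg G s
    count-incident s s∈ = begin
      count (λ e → (s == proj₁ e) ∨ (s == proj₂ e)) Es      ≡⟨ ∑-cong Es (λ e e∈ → 𝟙-∨-disjoint _ _ (apart e∈)) ⟩
      ∑ (λ e → 𝟙 (s == proj₁ e) + 𝟙 (s == proj₂ e)) Es     ≡⟨ ∑-edges G adj-sym adj-irrefl (λ v → 𝟙 (s == v)) ⟩
      ∑ (λ v → 𝟙 (s == v) * deg G v) Vs                    ≡⟨ ∑-δ s Vs verts-unique s∈ (deg G) ⟩
      deg G s                                               ∎
      where
      open ≡-Reasoning
      apart : ∀ {e} → e ∈ Es → s == proj₁ e ≡ true → s == proj₂ e ≡ true → ⊥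
      apart e∈ s≡x s≡y = edge-≢ e∈ (trans (sym (eq-sound _ _ s≡x)) (eq-sound _ _ s≡y))

    count-pendant : ∀ s → s ∈ Vs → count (λ v → s == v) pendantSites ≡ 𝟙 (deg G s ≡ᵇ 2)
    count-pendant s s∈ = begin
      count (λ v → s == v) pendantSites                          ≡⟨ ∑-filter _ (λ v → deg G v ≡ᵇ 2) Vs ⟩
      ∑ (λ v → if deg G v ≡ᵇ 2 then 𝟙 (s == v) else 0) Vs        ≡⟨ ∑-ext Vs (λ v → trans (if-then-0 (deg G v ≡ᵇ 2) _) (*-comm _ (𝟙 (s == v)))) ⟩
      ∑ (λ v → 𝟙 (s == v) * 𝟙 (deg G v ≡ᵇ 2)) Vs                 ≡⟨ ∑-δ s Vs verts-unique s∈ (λ v → 𝟙 (deg G v ≡ᵇ 2)) ⟩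
      𝟙 (deg G s ≡ᵇ 2)                                            ∎
      where open ≡-Reasoning

    count-siOx : ∀ s → s ∈ Vs → count (siOx G s) oxygens ≡ 3
    count-siOx s s∈ = begin
      count (siOx G s) oxygens                                             ≡⟨ ∑-++ _ (map edgeOxygen Es) (map pe pendantSites) ⟩
      count (siOx G s) (map edgeOxygen Es) + count (siOx G s) (map pe pendantSites)
        ≡⟨ cong₂ _+_ (trans (∑-map _ edgeOxygen Es) (count-incident s s∈)) (trans (∑-map _ pe pendantSites) (count-pendant s s∈)) ⟩
      deg G s + 𝟙 (deg G s ≡ᵇ 2)                                           ≡⟨ two-or-three (deg-2-or-3 s s∈) ⟩
      3                                                                    ∎
      where
      open ≡-Reasoning
      two-or-three : ∀ {d} → d ≡ 2 ⊎ d ≡ 3 → d + 𝟙 (d ≡ᵇ 2) ≡ 3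
      two-or-three (inj₁ refl) = refl
      two-or-three (inj₂ refl) = refl

    face : A → SLV A × SLV A → POV G
    face t f = nw t (proj₁ f) (proj₂ f)

    ∑-POH : (h : POV G → ℕ) →
      ∑ h (verts (POHof G)) ≡ ∑ (h ∘ ox) oxygens + ∑ (λ t → ∑ (h ∘ face t) (pairs (cell t))) Vs
    ∑-POH h = begin
      ∑ h (map ox nonSilicon ++ concatMap faces Vs)
        ≡⟨ ∑-++ h (map ox nonSilicon) (concatMap faces Vs) ⟩
      ∑ h (map ox nonSilicon) + ∑ h (concatMap faces Vs)
        ≡⟨ cong₂ _+_ (trans (∑-map h ox nonSilicon) (cong (∑ (h ∘ ox)) nonSilicon≡oxygens))
                     (trans (∑-concatMap h faces Vs) (∑-ext Vs faces-of)) ⟩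
      ∑ (h ∘ ox) oxygens + ∑ (λ t → ∑ (h ∘ face t) (pairs (cell t))) Vs
        ∎
      where
      open ≡-Reasoning
      nonSilicon = filter (λ o → T? (not (isSi G o))) (verts (SLof G))
      faces : A → List (POV G)
      faces s = map (λ f → nw s (proj₁ f) (proj₂ f)) (pairs (oxNbrs G s))
      faces-of : ∀ t → ∑ h (faces t) ≡ ∑ (h ∘ face t) (pairs (cell t))
      faces-of t = trans (∑-map h (face t) (pairs (oxNbrs G t))) (cong (λ os → ∑ (h ∘ face t) (pairs os)) (oxNbrs≡cell t))

    deg-POH : ∀ u → deg (POHof G) u ≡
      count (λ o → adjPO G u (ox o)) oxygens + ∑ (λ t → count (λ f → adjPO G u (face t f)) (pairs (cell t))) Vs
    deg-POH u = trans (length-filter (adjPO G u) (verts (POHof G))) (∑-POH (λ v → 𝟙 (adjPO G u v)))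

    record Triangle (os : List (SLV A)) : Set where
      field
        {a b c}  : SLV A
        shape    : os ≡ a ∷ b ∷ c ∷ []
        distinct : Unique (a ∷ b ∷ c ∷ [])

    cell-triangle : ∀ s → s ∈ Vs → Triangle (cell s)
    cell-triangle s s∈ = triangle (cell s) refl (trans (length-filter (siOx G s) oxygens) (count-siOx s s∈)) (Unique.filter⁺ _ Unique-oxygens)
      where
      triangle : ∀ os → cell s ≡ os → length os ≡ 3 → Unique os → Triangle (cell s)
      triangle (_ ∷ _ ∷ _ ∷ []) shape refl distinct = record { shape = shape ; distinct = distinct }

    ∈-cell⁻ : ∀ {s o} → o ∈ cell s → o ∈ oxygens × siOx G s o ≡ true
    ∈-cell⁻ {s} = ∈-filterᵇ⁻ (siOx G s)

    deg-face : ∀ s → s ∈ Vs → ∀ {f} → f ∈ pairs (cell s) → deg (POHof G) (face s f) ≡ 4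
    deg-face s s∈ {p , p′} f∈ = trans (deg-POH (face s (p , p′))) (cong₂ _+_ oxygen-nbrs face-nbrs)
      where
      p≢p′ : p ≢ p′
      p≢p′ = pairs-≢ (cell s) (Unique.filter⁺ _ Unique-oxygens) f∈
      p∈ : p ∈ oxygens
      p∈ = proj₁ (∈-cell⁻ (proj₁ (∈-pairs⁻ (cell s) f∈)))
      p′∈ : p′ ∈ oxygens
      p′∈ = proj₁ (∈-cell⁻ (proj₂ (∈-pairs⁻ (cell s) f∈)))
      one-of : ∀ o → 𝟙 (eqO o p ∨ eqO o p′) ≡ 𝟙 (eqO p o) + 𝟙 (eqO p′ o)
      one-of o rewrite EqO.eq-sym o p | EqO.eq-sym o p′ =
        𝟙-∨-disjoint _ _ (λ po p′o → p≢p′ (trans (eqO-sound p o po) (sym (eqO-sound p′ o p′o))))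
      oxygen-nbrs : count (λ o → eqO o p ∨ eqO o p′) oxygens ≡ 2
      oxygen-nbrs = trans (∑-ext oxygens one-of) (trans (∑-+ _ _ oxygens)
        (cong₂ _+_ (EqO.count-δ p oxygens Unique-oxygens p∈) (EqO.count-δ p′ oxygens Unique-oxygens p′∈)))
      face-nbrs : ∑ (λ t → count (λ g → (s == t) ∧ not (eqO p (proj₁ g) ∧ eqO p′ (proj₂ g))) (pairs (cell t))) Vs ≡ 2
      face-nbrs = begin
        ∑ (λ t → count (λ g → (s == t) ∧ not (eqO p (proj₁ g) ∧ eqO p′ (proj₂ g))) (pairs (cell t))) Vs
          ≡⟨ ∑-ext Vs (λ t → count-∧ (s == t) _ (pairs (cell t))) ⟩
        ∑ (λ t → 𝟙 (s == t) * count (λ g → not (eqO p (proj₁ g) ∧ eqO p′ (proj₂ g))) (pairs (cell t))) Vs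
          ≡⟨ ∑-δ s Vs verts-unique s∈ _ ⟩
        count (λ g → not (eqO p (proj₁ g) ∧ eqO p′ (proj₂ g))) (pairs (cell s))
          ≡⟨ other-faces (cell-triangle s s∈) f∈ ⟩
        2 ∎
        where
        open ≡-Reasoning
        other-faces : ∀ {os} → Triangle os → (p , p′) ∈ pairs os →
          count (λ g → not (eqO p (proj₁ g) ∧ eqO p′ (proj₂ g))) (pairs os) ≡ 2
        other-faces record { shape = refl ; distinct = distinct } = EqO.count-pairs-≢ distinct

    count-cell : ∀ {o} → o ∈ oxygens → ∀ t → count (eqO o) (cell t) ≡ 𝟙 (siOx G t o)
    count-cell {o} o∈ t = begin
      count (eqO o) (cell t)                                   ≡⟨ ∑-filter _ (siOx G t) oxygens ⟩
      ∑ (λ o′ → if siOx G t o′ then 𝟙 (eqO o o′) else 0) oxygens ≡⟨ ∑-ext oxygens (λ o′ → trans (if-then-0 (siOx G t o′) _) (*-comm _ (𝟙 (eqO o o′)))) ⟩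
      ∑ (λ o′ → 𝟙 (eqO o o′) * 𝟙 (siOx G t o′)) oxygens       ≡⟨ EqO.∑-δ o oxygens Unique-oxygens o∈ _ ⟩
      𝟙 (siOx G t o)                                            ∎
      where open ≡-Reasoning

    -- Each oxygen of a cell lies on exactly two of its three faces.
    face-nbrs-of-oxygen : ∀ {o} → o ∈ oxygens →
      ∑ (λ t → count (λ f → eqO o (proj₁ f) ∨ eqO o (proj₂ f)) (pairs (cell t))) Vs ≡ 2 * count (λ t → siOx G t o) Vs
    face-nbrs-of-oxygen {o} o∈ =
      trans (∑-cong Vs (λ t t∈ → trans (on-two-faces (cell-triangle t t∈)) (cong (2 *_) (count-cell o∈ t))))
            (∑-*ˡ 2 (λ t → 𝟙 (siOx G t o)) Vs)
      where
      on-two-faces : ∀ {os} → Triangle os → count (λ f → eqO o (proj₁ f) ∨ eqO o (proj₂ f)) (pairs os) ≡ 2 * count (eqO o) os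
      on-two-faces record { shape = refl ; distinct = distinct } = EqO.count-pairs-∋ distinct o

    adjSL-oxygens : ∀ {o o′} → o ∈ oxygens → o′ ∈ oxygens →
      adjSL G o o′ ≡ not (eqO o o′) ∧ any (λ s → siOx G s o ∧ siOx G s o′) Vs
    adjSL-oxygens o∈ o′∈ with ∈-oxygens⁻ o∈ | ∈-oxygens⁻ o′∈
    ... | inj₁ (_ , _ , refl) | inj₁ (_ , _ , refl) = refl
    ... | inj₁ (_ , _ , refl) | inj₂ (_ , _ , refl) = refl
    ... | inj₂ (_ , _ , refl) | inj₁ (_ , _ , refl) = refl
    ... | inj₂ (_ , _ , refl) | inj₂ (_ , _ , refl) = refl

    count-others : ∀ {o} → o ∈ oxygens → (q : SLV A → Bool) → q o ≡ true →
      count (λ o′ → not (eqO o o′) ∧ q o′) oxygens + 1 ≡ count q oxygens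
    count-others {o} o∈ q qo = begin
      count (λ o′ → not (eqO o o′) ∧ q o′) oxygens + 1          ≡⟨ +-comm _ 1 ⟩
      1 + count (λ o′ → not (eqO o o′) ∧ q o′) oxygens          ≡⟨ cong (_+ count (λ o′ → not (eqO o o′) ∧ q o′) oxygens) (trans (cong 𝟙 (sym qo)) (sym (EqO.count-δ-∧ o oxygens Unique-oxygens o∈ q))) ⟩
      count (λ o′ → eqO o o′ ∧ q o′) oxygens + count (λ o′ → not (eqO o o′) ∧ q o′) oxygens ≡⟨ count-split (eqO o) q oxygens ⟨
      count q oxygens                                            ∎
      where open ≡-Reasoning

    deg-oxygen : ∀ {o} → o ∈ oxygens → (q : SLV A → Bool) → (∀ o′ → any (λ s → siOx G s o ∧ siOx G s o′) Vs ≡ q o′) →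
      deg (POHof G) (ox o) ≡ count (λ o′ → not (eqO o o′) ∧ q o′) oxygens + 2 * count (λ t → siOx G t o) Vs
    deg-oxygen {o} o∈ q shared = trans (deg-POH (ox o)) (cong₂ _+_ oxygen-nbrs (face-nbrs-of-oxygen o∈))
      where
      oxygen-nbrs : count (λ o′ → adjSL G o o′) oxygens ≡ count (λ o′ → not (eqO o o′) ∧ q o′) oxygens
      oxygen-nbrs = ∑-cong oxygens (λ o′ o′∈ → cong 𝟙 (trans (adjSL-oxygens o∈ o′∈) (cong (not (eqO o o′) ∧_) (shared o′))))

    shared-oxygen : ∀ {x y} → (x , y) ∈ Es → ∀ {o′} → o′ ∈ oxygens → (siOx G x o′ ∧ siOx G y o′) ≡ eqO (ed x y) o′
    shared-oxygen {x} {y} xy∈ {o′} o′∈ = bool-ext (only-edge (∈-oxygens⁻ o′∈) ∘ ∧-true⁻) (on-edge {o′})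
      where
      x≢y = edge-≢ xy∈
      on-edge : ∀ {o″} → eqO (ed x y) o″ ≡ true → (siOx G x o″ ∧ siOx G y o″) ≡ true
      on-edge {o″} e with refl ← eqO-sound (ed x y) o″ e rewrite eq-refl x | eq-refl y = ∨-zeroʳ (y == x)
      both : ∀ {v} → x == v ≡ true → y == v ≡ true → ⊥
      both xv yv = x≢y (trans (eq-sound _ _ xv) (sym (eq-sound _ _ yv)))
      only-edge : _ → siOx G x o′ ≡ true × siOx G y o′ ≡ true → eqO (ed x y) o′ ≡ true
      only-edge (inj₂ (_ , _ , refl)) (xv , yv) = ⊥-elim (both xv yv)
      only-edge (inj₁ ((z , w) , zw∈ , refl)) (xzw , yzw) with ∨-true⁻ {x == z} xzw | ∨-true⁻ {y == z} yzw
      ... | inj₁ xz | inj₁ yz = ⊥-elim (both xz yz)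
      ... | inj₂ xw | inj₂ yw = ⊥-elim (both xw yw)
      ... | inj₁ xz | inj₂ yw rewrite xz | yw = refl
      ... | inj₂ xw | inj₁ yz rewrite eq-sound _ _ xw | eq-sound _ _ yz =
        ⊥-elim (pairs-asym Vs verts-unique (proj₁ (∈-filterᵇ⁻ _ xy∈)) (proj₁ (∈-filterᵇ⁻ _ zw∈)))

    deg-edgeOxygen : ∀ {x y} → (x , y) ∈ Es → deg (POHof G) (ox (ed x y)) ≡ 8
    deg-edgeOxygen {x} {y} xy∈ = trans (deg-oxygen o∈ Q shared) (cong₂ _+_ others (cong (2 *_) two-cells))
      where
      o = ed x y
      o∈ : o ∈ oxygens
      o∈ = ∈-++⁺ˡ (∈-map⁺ edgeOxygen xy∈)
      x∈ = proj₁ (∈-edges⁻ xy∈)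
      y∈ = proj₁ (proj₂ (∈-edges⁻ xy∈))
      x≢y = edge-≢ xy∈
      Q : SLV A → Bool
      Q o′ = siOx G x o′ ∨ siOx G y o′
      shared : ∀ o′ → any (λ s → siOx G s o ∧ siOx G s o′) Vs ≡ Q o′
      shared o′ = begin
        any (λ s → ((s == x) ∨ (s == y)) ∧ siOx G s o′) Vs
          ≡⟨ any-ext Vs (λ s → ∧-distribʳ-∨ (siOx G s o′) (s == x) (s == y)) ⟩
        any (λ s → (s == x) ∧ siOx G s o′ ∨ (s == y) ∧ siOx G s o′) Vs
          ≡⟨ any-∨ _ _ Vs ⟩
        any (λ s → (s == x) ∧ siOx G s o′) Vs ∨ any (λ s → (s == y) ∧ siOx G s o′) Vs
          ≡⟨ cong₂ _∨_ (any-δ x Vs x∈ (λ s → siOx G s o′)) (any-δ y Vs y∈ (λ s → siOx G s o′)) ⟩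
        Q o′ ∎
        where open ≡-Reasoning
      two-cells : count (λ t → (t == x) ∨ (t == y)) Vs ≡ 2
      two-cells = begin
        count (λ t → (t == x) ∨ (t == y)) Vs  ≡⟨ ∑-ext Vs (λ t → cong₂ (λ a b → 𝟙 (a ∨ b)) (eq-sym t x) (eq-sym t y)) ⟩
        count (λ t → (x == t) ∨ (y == t)) Vs  ≡⟨ ∑-ext Vs (λ t → 𝟙-∨-disjoint _ _ (λ xt yt → x≢y (trans (eq-sound _ _ xt) (sym (eq-sound _ _ yt))))) ⟩
        ∑ (λ t → 𝟙 (x == t) + 𝟙 (y == t)) Vs ≡⟨ ∑-+ _ _ Vs ⟩
        count (x ==_) Vs + count (y ==_) Vs   ≡⟨ cong₂ _+_ (count-δ x Vs verts-unique x∈) (count-δ y Vs verts-unique y∈) ⟩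
        2                                     ∎
        where open ≡-Reasoning
      count-Q : count Q oxygens + 1 ≡ 6
      count-Q = begin
        count Q oxygens + 1                                          ≡⟨ cong (count Q oxygens +_) (sym (EqO.count-δ o oxygens Unique-oxygens o∈)) ⟩
        count Q oxygens + count (eqO o) oxygens                      ≡⟨ cong (count Q oxygens +_) (∑-cong oxygens (λ o′ o′∈ → cong 𝟙 (shared-oxygen xy∈ o′∈))) ⟨
        count Q oxygens + count (λ o′ → siOx G x o′ ∧ siOx G y o′) oxygens ≡⟨ count-∨ (siOx G x) (siOx G y) oxygens ⟩
        count (siOx G x) oxygens + count (siOx G y) oxygens          ≡⟨ cong₂ _+_ (count-siOx x x∈) (count-siOx y y∈) ⟩
        6                                                            ∎
        where open ≡-Reasoning
      others : count (λ o′ → not (eqO o o′) ∧ Q o′) oxygens ≡ 4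
      others = +-cancelʳ-≡ 1 _ 4 (+-cancelʳ-≡ 1 _ 5 (trans (cong (_+ 1) (count-others o∈ Q Q-o)) count-Q))
        where
        Q-o : Q o ≡ true
        Q-o rewrite eq-refl x = refl

    deg-pendant : ∀ {x} → x ∈ pendantSites → deg (POHof G) (ox (pe x)) ≡ 4
    deg-pendant {x} x∈P = trans (deg-oxygen o∈ (siOx G x) shared) (cong₂ _+_ others (cong (2 *_) one-cell))
      where
      o = pe x
      o∈ : o ∈ oxygens
      o∈ = ∈-++⁺ʳ (map edgeOxygen Es) (∈-map⁺ pe x∈P)
      x∈ = proj₁ (∈-filterᵇ⁻ _ x∈P)
      shared : ∀ o′ → any (λ s → siOx G s o ∧ siOx G s o′) Vs ≡ siOx G x o′
      shared o′ = any-δ x Vs x∈ (λ s → siOx G s o′)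
      one-cell : count (λ t → t == x) Vs ≡ 1
      one-cell = trans (∑-ext Vs (λ t → cong 𝟙 (eq-sym t x))) (count-δ x Vs verts-unique x∈)
      others : count (λ o′ → not (eqO o o′) ∧ siOx G x o′) oxygens ≡ 2
      others = +-cancelʳ-≡ 1 _ 2 (trans (count-others o∈ (siOx G x) (eq-refl x)) (count-siOx x x∈))

    same-cell-sym : ∀ o o′ → (not (eqO o o′) ∧ any (λ s → siOx G s o ∧ siOx G s o′) Vs)
                           ≡ (not (eqO o′ o) ∧ any (λ s → siOx G s o′ ∧ siOx G s o) Vs)
    same-cell-sym o o′ = cong₂ (λ a b → not a ∧ b) (EqO.eq-sym o o′) (any-ext Vs (λ s → ∧-comm (siOx G s o) _))

    adjSL-sym : ∀ o o′ → adjSL G o o′ ≡ adjSL G o′ o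
    adjSL-sym (si _)     (si _)      = refl
    adjSL-sym (si _)     (ed _ _)    = refl
    adjSL-sym (si _)     (pe _)      = refl
    adjSL-sym (ed _ _)   (si _)      = refl
    adjSL-sym (pe _)     (si _)      = refl
    adjSL-sym o@(ed _ _) o′@(ed _ _) = same-cell-sym o o′
    adjSL-sym o@(ed _ _) o′@(pe _)   = same-cell-sym o o′
    adjSL-sym o@(pe _)   o′@(ed _ _) = same-cell-sym o o′
    adjSL-sym o@(pe _)   o′@(pe _)   = same-cell-sym o o′

    adjPO-sym : ∀ u v → adjPO G u v ≡ adjPO G v u
    adjPO-sym (ox o)      (ox o′)      = adjSL-sym o o′
    adjPO-sym (ox _)      (nw _ _ _)   = refl
    adjPO-sym (nw _ _ _)  (ox _)       = refl
    adjPO-sym (nw s o o′) (nw t p p′)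
      rewrite eq-sym s t | EqO.eq-sym o p | EqO.eq-sym o′ p′ = refl

    adjPO-irrefl : ∀ u → adjPO G u u ≡ false
    adjPO-irrefl (ox (si _))        = refl
    adjPO-irrefl (ox o@(ed _ _))    rewrite eqO-refl o = refl
    adjPO-irrefl (ox o@(pe _))      rewrite eqO-refl o = refl
    adjPO-irrefl (nw s o o′)        rewrite eq-refl s | eqO-refl o | eqO-refl o′ = refl

    private
      deg² : POV G → ℕ
      deg² u = deg (POHof G) u * deg (POHof G) u

      ∑-oxygens : ∑ (deg² ∘ ox) oxygens ≡ length Es * 64 + length pendantSites * 16
      ∑-oxygens = trans (∑-++ _ (map edgeOxygen Es) (map pe pendantSites)) (cong₂ _+_
        (trans (∑-map _ edgeOxygen Es) (trans (∑-cong Es (λ _ e∈ → cong (λ d → d * d) (deg-edgeOxygen e∈))) (∑-const 64 Es)))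
        (trans (∑-map _ pe pendantSites) (trans (∑-cong pendantSites (λ _ v∈ → cong (λ d → d * d) (deg-pendant v∈))) (∑-const 16 pendantSites))))

      ∑-faces : ∑ (λ t → ∑ (deg² ∘ face t) (pairs (cell t))) Vs ≡ length Vs * 48
      ∑-faces = trans (∑-cong Vs (λ t t∈ → three-faces t t∈ (cell-triangle t t∈))) (∑-const 48 Vs)
        where
        three-faces : ∀ t → t ∈ Vs → Triangle (cell t) → ∑ (deg² ∘ face t) (pairs (cell t)) ≡ 48
        three-faces t t∈ triangle = begin
          ∑ (deg² ∘ face t) (pairs (cell t))   ≡⟨ ∑-cong (pairs (cell t)) (λ _ f∈ → cong (λ d → d * d) (deg-face t t∈ f∈)) ⟩
          ∑ (λ _ → 16) (pairs (cell t))        ≡⟨ ∑-const 16 (pairs (cell t)) ⟩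
          length (pairs (cell t)) * 16         ≡⟨ cong (λ os → length (pairs os) * 16) (Triangle.shape triangle) ⟩
          48                                   ∎
          where open ≡-Reasoning

    -- A vertex of G owns its three face vertices (degree 4), half of each incident edge oxygen
    -- (degree 8) and, if it has degree 2, its pendant oxygen (degree 4): 48 + 32 d + 16 [d = 2].
    M₁-POHof : M₁ (POHof G) ≡ ∑ (λ v → if deg G v ≡ᵇ 2 then 128 else 144) Vs
    M₁-POHof = begin
      M₁ (POHof G)
        ≡⟨ M₁≡∑deg² (POHof G) adjPO-sym adjPO-irrefl ⟩
      ∑ deg² (verts (POHof G))
        ≡⟨ ∑-POH deg² ⟩
      ∑ (deg² ∘ ox) oxygens + ∑ (λ t → ∑ (deg² ∘ face t) (pairs (cell t))) Vs
        ≡⟨ cong₂ _+_ ∑-oxygens ∑-faces ⟩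
      length Es * 64 + length pendantSites * 16 + length Vs * 48
        ≡⟨ regroup (length Es) (length pendantSites) (length Vs) ⟩
      32 * (2 * length Es) + (16 * length pendantSites + length Vs * 48)
        ≡⟨ cong₂ (λ d p → 32 * d + (16 * p + length Vs * 48)) (sym (∑deg≡2*edges G adj-sym adj-irrefl)) (length-filter _ Vs) ⟩
      32 * ∑ (deg G) Vs + (16 * count (λ v → deg G v ≡ᵇ 2) Vs + length Vs * 48)
        ≡⟨ cong₂ _+_ (∑-*ˡ 32 (deg G) Vs) (cong₂ _+_ (∑-*ˡ 16 _ Vs) (∑-const 48 Vs)) ⟨
      ∑ (λ v → 32 * deg G v) Vs + (∑ (λ v → 16 * 𝟙 (deg G v ≡ᵇ 2)) Vs + ∑ (λ _ → 48) Vs)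
        ≡⟨ trans (∑-+ _ _ Vs) (cong (∑ (λ v → 32 * deg G v) Vs +_) (∑-+ _ _ Vs)) ⟨
      ∑ (λ v → 32 * deg G v + (16 * 𝟙 (deg G v ≡ᵇ 2) + 48)) Vs
        ≡⟨ ∑-cong Vs (λ v v∈ → weight (deg-2-or-3 v v∈)) ⟨
      ∑ (λ v → if deg G v ≡ᵇ 2 then 128 else 144) Vs
        ∎
      where
      open ≡-Reasoning
      regroup : ∀ e p v → e * 64 + p * 16 + v * 48 ≡ 32 * (2 * e) + (16 * p + v * 48)
      regroup = solve-∀
      weight : ∀ {d} → d ≡ 2 ⊎ d ≡ 3 → (if d ≡ᵇ 2 then 128 else 144) ≡ 32 * d + (16 * 𝟙 (d ≡ᵇ 2) + 48)
      weight (inj₁ refl) = refl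
      weight (inj₂ refl) = refl

module HexCoordinates where

  open import Data.Bool using (Bool)
  open import Data.Nat as ℕ using (ℕ; zero; suc; _<_; z≤n; s≤s; _⊔_; _<ᵇ_; _≡ᵇ_)
  import Data.Nat.Properties as ℕ
  import Data.Nat.DivMod as ℕ
  open import Data.Integer as ℤ using (ℤ; +_; -[1+_]; _+_; _*_; _-_; -_; ∣_∣)
  import Data.Integer.Properties as ℤ
  open import Data.Integer.DivMod using (_/ℕ_; _%ℕ_; a≡a%ℕn+[a/ℕn]*n; n%ℕd<d)
  open import Data.Integer.Tactic.RingSolver using (solve-∀)
  open import Data.Product using (_×_; _,_; proj₁; proj₂; ∃)
  open import Relation.Binary.PropositionalEquality
  open import Defs using (Pt; isCentre; centreIn)

  -- pt a b 0 is the centre a (1, 1) + b (2, -1) of hexagon (a, b), and pt a b r = pt a b 0 + (r, 0);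
  -- every vertex of the hexagonal lattice is pt a b 1 or pt a b 2 for exactly one (a, b).
  pt : ℤ → ℤ → ℕ → Pt
  pt a b r = (+ r + (a + b * + 2) , a - b)

  inHex : ℕ → ℤ → ℤ → Bool
  inHex n a b = (∣ a ∣ ⊔ ∣ b ∣ ⊔ ∣ a + b ∣) <ᵇ n

  private
    [r+3k]/3≡k : ∀ k r → r < 3 → (r ℕ.+ k ℕ.* 3) ℕ./ 3 ≡ k
    [r+3k]/3≡k zero    r r<3 = trans (cong (ℕ._/ 3) (ℕ.+-identityʳ r)) (ℕ.m<n⇒m/n≡0 r<3)
    [r+3k]/3≡k (suc k) r r<3 =
      trans (ℕ.m/n≡1+[m∸n]/n {r ℕ.+ (3 ℕ.+ k ℕ.* 3)} {3} (ℕ.≤-trans (ℕ.m≤m+n 3 (k ℕ.* 3)) (ℕ.m≤n+m _ r)))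
            (cong suc (trans (cong (ℕ._/ 3) (drop-3 r k)) ([r+3k]/3≡k k r r<3)))
      where
      drop-3 : ∀ r k → r ℕ.+ (3 ℕ.+ k ℕ.* 3) ℕ.∸ 3 ≡ r ℕ.+ k ℕ.* 3
      drop-3 r k rewrite ℕ.+-comm r (3 ℕ.+ k ℕ.* 3) = ℕ.+-comm (k ℕ.* 3) r

    [r+3k]%3≡r : ∀ k r → r < 3 → (r ℕ.+ k ℕ.* 3) ℕ.% 3 ≡ r
    [r+3k]%3≡r k r r<3 = trans (ℕ.[m+kn]%n≡m%n r k 3) (ℕ.m<n⇒m%n≡m r<3)

  -- For negative b the integer division of r + 3b goes through the natural number (3 - r) + 3(-b - 1).
  divMod-3 : ∀ r → r < 3 → ∀ b → (+ r + b * + 3) %ℕ 3 ≡ r × (+ r + b * + 3) /ℕ 3 ≡ b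
  divMod-3 0 r<3 (+ k) rewrite sym (ℤ.pos-* k 3) = [r+3k]%3≡r k 0 r<3 , cong +_ ([r+3k]/3≡k k 0 r<3)
  divMod-3 1 r<3 (+ k) rewrite sym (ℤ.pos-* k 3) = [r+3k]%3≡r k 1 r<3 , cong +_ ([r+3k]/3≡k k 1 r<3)
  divMod-3 2 r<3 (+ k) rewrite sym (ℤ.pos-* k 3) = [r+3k]%3≡r k 2 r<3 , cong +_ ([r+3k]/3≡k k 2 r<3)
  divMod-3 0 _ -[1+ k ] rewrite [r+3k]%3≡r (suc k) 0 (s≤s z≤n) | [r+3k]/3≡k (suc k) 0 (s≤s z≤n) = refl , refl
  divMod-3 1 _ -[1+ k ] rewrite [r+3k]%3≡r k 2 ℕ.≤-refl | [r+3k]/3≡k k 2 ℕ.≤-refl = refl , refl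
  divMod-3 2 _ -[1+ k ] rewrite [r+3k]%3≡r k 1 (s≤s (s≤s z≤n)) | [r+3k]/3≡k k 1 (s≤s (s≤s z≤n)) = refl , refl
  divMod-3 (suc (suc (suc _))) (s≤s (s≤s (s≤s ()))) _

  i-j+j≡i : ∀ i j → i - j + j ≡ i
  i-j+j≡i = solve-∀

  pt-difference : ∀ a b r → proj₁ (pt a b r) - proj₂ (pt a b r) ≡ + r + b * + 3
  pt-difference a b r = difference (+ r) a b
    where
    difference : ∀ r a b → r + (a + b * + 2) - (a - b) ≡ r + b * + 3
    difference = solve-∀

  isCentre-pt : ∀ a b r → r < 3 → isCentre (pt a b r) ≡ (r ≡ᵇ 0)
  isCentre-pt a b 0 r<3 rewrite pt-difference a b 0 | proj₁ (divMod-3 0 r<3 b) = refl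
  isCentre-pt a b 1 r<3 rewrite pt-difference a b 1 | proj₁ (divMod-3 1 r<3 b) = refl
  isCentre-pt a b 2 r<3 rewrite pt-difference a b 2 | proj₁ (divMod-3 2 r<3 b) = refl
  isCentre-pt a b (suc (suc (suc _))) (s≤s (s≤s (s≤s ())))

  centreIn-pt : ∀ n a b → centreIn n (pt a b 0) ≡ inHex n a b
  centreIn-pt n a b
    rewrite pt-difference a b 0 | proj₁ (divMod-3 0 (s≤s z≤n) b) | proj₂ (divMod-3 0 (s≤s z≤n) b) | i-j+j≡i a b = refl

  pt-decomposition : ∀ p → ∃ λ a → ∃ λ b → ∃ λ r → r < 3 × p ≡ pt a b r
  pt-decomposition (i , j) = j + b , b , r , n%ℕd<d (i - j) 3 , cong₂ _,_ first (second j b)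
    where
    r = (i - j) %ℕ 3
    b = (i - j) /ℕ 3
    first : i ≡ + r + ((j + b) + b * + 2)
    first = trans (split i j) (trans (cong (_+ j) (a≡a%ℕn+[a/ℕn]*n (i - j) 3)) (regroup (+ r) b j))
      where
      split : ∀ i j → i ≡ (i - j) + j
      split = solve-∀
      regroup : ∀ r b j → (r + b * + 3) + j ≡ r + ((j + b) + b * + 2)
      regroup = solve-∀
    second : ∀ j b → j ≡ (j + b) - b
    second = solve-∀

  pt-injective : ∀ {a b r a′ b′ r′} → r < 3 → r′ < 3 → pt a b r ≡ pt a′ b′ r′ → a ≡ a′ × b ≡ b′ × r ≡ r′
  pt-injective {a} {b} {r} {a′} {b′} {r′} r<3 r′<3 eq = a≡a′ , b≡b′ , r≡r′
    where
    same-difference : + r + b * + 3 ≡ + r′ + b′ * + 3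
    same-difference = trans (sym (pt-difference a b r))
      (trans (cong₂ _-_ (cong proj₁ eq) (cong proj₂ eq)) (pt-difference a′ b′ r′))
    r≡r′ : r ≡ r′
    r≡r′ = trans (sym (proj₁ (divMod-3 r r<3 b))) (trans (cong (_%ℕ 3) same-difference) (proj₁ (divMod-3 r′ r′<3 b′)))
    b≡b′ : b ≡ b′
    b≡b′ = trans (sym (proj₂ (divMod-3 r r<3 b))) (trans (cong (_/ℕ 3) same-difference) (proj₂ (divMod-3 r′ r′<3 b′)))
    a≡a′ : a ≡ a′
    a≡a′ = trans (sym (i-j+j≡i a b)) (trans (cong₂ _+_ (cong proj₂ eq) b≡b′) (i-j+j≡i a′ b′))

module HexAdjacency where

  open import Data.Bool using (true; false; _∧_; not)
  open import Data.Bool.ListAction using (any)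

  open import Data.Integer as ℤ using (ℤ; +_; _+_; -_)
  import Data.Integer.Properties as ℤ
  open import Data.Integer.Tactic.RingSolver using (solve-∀)

  open import Data.List.Membership.Propositional using (_∈_)
  open import Data.List.Relation.Unary.Any using (here; there)
  open import Data.Product using (_×_; _,_; proj₁; proj₂; ∃)
  open import Data.Empty using (⊥-elim)
  open import Relation.Nullary using (yes; no)
  open import Relation.Binary.PropositionalEquality
  open import Defs using (Pt; eqPt; _⊕_; offsets; triNbr; isCentre; centreIn; inHC; adjHC)
  open Sums

  eqPt-sound : ∀ p q → eqPt p q ≡ true → p ≡ q
  eqPt-sound (a , b) (c , d) e with a ℤ.≟ c | b ℤ.≟ d
  ... | yes refl | yes refl = refl
  ... | yes _    | no _     with () ← e
  ... | no _     | _        with () ← e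

  eqPt-refl : ∀ p → eqPt p p ≡ true
  eqPt-refl (a , b) with a ℤ.≟ a | b ℤ.≟ b
  ... | yes _ | yes _ = refl
  ... | no a≢a | _     = ⊥-elim (a≢a refl)
  ... | yes _ | no b≢b = ⊥-elim (b≢b refl)

  ⊕-assoc : ∀ u x y → (u ⊕ x) ⊕ y ≡ u ⊕ (x ⊕ y)
  ⊕-assoc (a , b) (c , d) (e , f) = cong₂ _,_ (ℤ.+-assoc a c e) (ℤ.+-assoc b d f)

  ⊕-identityʳ : ∀ p → p ⊕ (+ 0 , + 0) ≡ p
  ⊕-identityʳ (a , b) = cong₂ _,_ (ℤ.+-identityʳ a) (ℤ.+-identityʳ b)

  ⊕-cancelˡ : ∀ u {x y} → u ⊕ x ≡ u ⊕ y → x ≡ y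
  ⊕-cancelˡ (a , b) {c , d} {e , f} eq = cong₂ _,_ (+-cancelˡ a (cong proj₁ eq)) (+-cancelˡ b (cong proj₂ eq))
    where
    -a+[a+c]≡c : ∀ a c → - a + (a + c) ≡ c
    -a+[a+c]≡c = solve-∀
    +-cancelˡ : ∀ a {c e} → a + c ≡ a + e → c ≡ e
    +-cancelˡ a {c} {e} a+c≡a+e = trans (sym (-a+[a+c]≡c a c)) (trans (cong (λ x → - a + x) a+c≡a+e) (-a+[a+c]≡c a e))

  eqPt-cancelˡ : ∀ u x y → eqPt (u ⊕ x) (u ⊕ y) ≡ eqPt x y
  eqPt-cancelˡ u x y = bool-ext
    (λ e → subst (λ z → eqPt x z ≡ true) (⊕-cancelˡ u (eqPt-sound _ _ e)) (eqPt-refl x))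
    (λ e → subst (λ z → eqPt (u ⊕ x) (u ⊕ z) ≡ true) (eqPt-sound _ _ e) (eqPt-refl (u ⊕ x)))

  triNbr-cancelˡ : ∀ u x z → triNbr (u ⊕ x) (u ⊕ z) ≡ triNbr x z
  triNbr-cancelˡ u x z = any-ext offsets (λ d → trans (cong (λ w → eqPt w (u ⊕ z)) (⊕-assoc u x d)) (eqPt-cancelˡ u (x ⊕ d) z))

  triNbr-⊕ : ∀ u z → triNbr u (u ⊕ z) ≡ any (λ d → eqPt d z) offsets
  triNbr-⊕ u z = any-ext offsets (λ d → eqPt-cancelˡ u d z)

  triNbr⁻ : ∀ p q → triNbr p q ≡ true → ∃ λ d → d ∈ offsets × q ≡ p ⊕ d
  triNbr⁻ p q e = let d , d∈ , pd≡q = any-true⁻ (λ d → eqPt (p ⊕ d) q) offsets e in d , d∈ , sym (eqPt-sound _ _ pd≡q)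

  triNbr⁺ : ∀ p {d} → d ∈ offsets → triNbr p (p ⊕ d) ≡ true
  triNbr⁺ p {d} d∈ = any-true⁺ (λ d′ → eqPt (p ⊕ d′) (p ⊕ d)) d∈ (eqPt-refl (p ⊕ d))

  offsets-elim : ∀ {P : Pt → Set} → P (+ 1 , + 0) → P (- + 1 , + 0) → P (+ 0 , + 1) → P (+ 0 , - + 1) →
    P (+ 1 , - + 1) → P (- + 1 , + 1) → ∀ {d} → d ∈ offsets → P d
  offsets-elim p₁ p₂ p₃ p₄ p₅ p₆ (here refl)                                         = p₁
  offsets-elim p₁ p₂ p₃ p₄ p₅ p₆ (there (here refl))                                 = p₂
  offsets-elim p₁ p₂ p₃ p₄ p₅ p₆ (there (there (here refl)))                         = p₃
  offsets-elim p₁ p₂ p₃ p₄ p₅ p₆ (there (there (there (here refl))))                 = p₄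
  offsets-elim p₁ p₂ p₃ p₄ p₅ p₆ (there (there (there (there (here refl)))))         = p₅
  offsets-elim p₁ p₂ p₃ p₄ p₅ p₆ (there (there (there (there (there (here refl)))))) = p₆

  offsets-opposite : ∀ {d} → d ∈ offsets → ∃ λ d′ → d′ ∈ offsets × d ⊕ d′ ≡ (+ 0 , + 0)
  offsets-opposite = offsets-elim {λ d → ∃ λ d′ → d′ ∈ offsets × d ⊕ d′ ≡ (+ 0 , + 0)}
    (_ , there (here refl) , refl)
    (_ , here refl , refl)
    (_ , there (there (there (here refl))) , refl)
    (_ , there (there (here refl)) , refl)
    (_ , there (there (there (there (there (here refl))))) , refl)
    (_ , there (there (there (there (here refl)))) , refl)

  triNbr-sym : ∀ p q → triNbr p q ≡ true → triNbr q p ≡ true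
  triNbr-sym p q e with triNbr⁻ p q e
  ... | d , d∈ , refl with offsets-opposite d∈
  ...   | d′ , d′∈ , d⊕d′≡0 = subst (λ w → triNbr (p ⊕ d) w ≡ true)
          (trans (⊕-assoc p d d′) (trans (cong (p ⊕_) d⊕d′≡0) (⊕-identityʳ p))) (triNbr⁺ (p ⊕ d) d′∈)

  triNbr-irrefl : ∀ p → triNbr p p ≡ false
  triNbr-irrefl p = any-ext offsets (λ d → trans (cong (eqPt (p ⊕ d)) (sym (⊕-identityʳ p))) (eqPt-cancelˡ p d (+ 0 , + 0)))

  adjHC-⊕ : ∀ n u d → adjHC n u (u ⊕ d) ≡
    not (isCentre u) ∧ not (isCentre (u ⊕ d)) ∧ any (λ e → eqPt e d) offsets ∧
    any (λ d′ → centreIn n (u ⊕ d′) ∧ triNbr d′ d) offsets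
  adjHC-⊕ n u d = cong₂ (λ X Y → not (isCentre u) ∧ not (isCentre (u ⊕ d)) ∧ X ∧ Y) (triNbr-⊕ u d)
    (any-ext offsets (λ d′ → cong (centreIn n (u ⊕ d′) ∧_) (triNbr-cancelˡ u d′ d)))

  not-true⁻ : ∀ {a} → not a ≡ true → a ≡ false
  not-true⁻ {false} _ = refl

  not-false⁻ : ∀ {a} → a ≡ false → not a ≡ true
  not-false⁻ refl = refl

  adjHC⁻ : ∀ n p q → adjHC n p q ≡ true →
    isCentre p ≡ false × isCentre q ≡ false × triNbr p q ≡ true ×
    ∃ λ d → d ∈ offsets × centreIn n (p ⊕ d) ≡ true × triNbr (p ⊕ d) q ≡ true
  adjHC⁻ n p q e =
    let p-vertex , r₁ = ∧-true⁻ e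
        q-vertex , r₂ = ∧-true⁻ r₁
        p~q , r₃ = ∧-true⁻ r₂
        d , d∈ , h = any-true⁻ (λ d → centreIn n (p ⊕ d) ∧ triNbr (p ⊕ d) q) offsets r₃
        centre , c~q = ∧-true⁻ h
    in not-true⁻ p-vertex , not-true⁻ q-vertex , p~q , d , d∈ , centre , c~q

  adjHC⇒inHC : ∀ n p q → adjHC n p q ≡ true → inHC n q ≡ true
  adjHC⇒inHC n p q e with adjHC⁻ n p q e
  ... | _ , q-vertex , _ , d , _ , centre , c~q with triNbr⁻ q (p ⊕ d) (triNbr-sym (p ⊕ d) q c~q)
  ...   | d′ , d′∈ , c≡q⊕d′ = ∧-true⁺ (not-false⁻ q-vertex)
          (any-true⁺ (λ e → centreIn n (q ⊕ e)) d′∈ (subst (λ w → centreIn n w ≡ true) c≡q⊕d′ centre))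

  adjHC-sym : ∀ n p q → adjHC n p q ≡ adjHC n q p
  adjHC-sym n p q = bool-ext (flip p q) (flip q p)
    where
    flip : ∀ p q → adjHC n p q ≡ true → adjHC n q p ≡ true
    flip p q e with adjHC⁻ n p q e
    ... | p-vertex , q-vertex , p~q , d , d∈ , centre , c~q with triNbr⁻ q (p ⊕ d) (triNbr-sym (p ⊕ d) q c~q)
    ...   | d′ , d′∈ , c≡q⊕d′ =
      ∧-true⁺ (not-false⁻ q-vertex) (∧-true⁺ (not-false⁻ p-vertex) (∧-true⁺ (triNbr-sym p q p~q)
        (any-true⁺ (λ d → centreIn n (q ⊕ d) ∧ triNbr (q ⊕ d) p) d′∈
          (subst (λ w → (centreIn n w ∧ triNbr w p) ≡ true) c≡q⊕d′
            (∧-true⁺ centre (triNbr-sym p (p ⊕ d) (triNbr⁺ p d∈)))))))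

  adjHC-irrefl : ∀ n p → adjHC n p p ≡ false
  adjHC-irrefl n p with isCentre p
  ... | true  = refl
  ... | false rewrite triNbr-irrefl p = refl

module HexLocal where

  open import Data.Bool using (Bool; true; false; _∧_; _∨_; not; if_then_else_)
  open import Data.Bool.ListAction using (any)
  open import Data.Nat as ℕ using (ℕ; _<_; z≤n; s≤s)
  open import Data.Integer as ℤ using (ℤ; +_; _+_; _*_; _-_; -_)
  import Data.Integer.Properties as ℤ
  open import Data.Integer.Tactic.RingSolver using (solve-∀)

  open import Data.List.Membership.Propositional using (_∈_)
  open import Data.Product using (_,_)
  open import Relation.Binary.PropositionalEquality
  open import Defs using (Pt; eqPt; _⊕_; offsets; triNbr; isCentre; centreIn; inHC; adjHC)
  open Sums
  open HexCoordinates
  open HexAdjacency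

  pt-⊕ : ∀ a b r {x y} p q r′ {a′ b′} → a + p ≡ a′ → b + q ≡ b′ →
    + r + x ≡ + r′ + (p + q * + 2) → y ≡ p - q → pt a b r ⊕ (x , y) ≡ pt a′ b′ r′
  pt-⊕ a b r {x} p q r′ refl refl first refl = cong₂ _,_
    (trans (reorder (+ r) a b x) (trans (cong (λ s → a + b * + 2 + s) first) (regroup (+ r′) a b p q)))
    (shift a b p q)
    where
    reorder : ∀ r a b x → r + (a + b * + 2) + x ≡ a + b * + 2 + (r + x)
    reorder = solve-∀
    regroup : ∀ r′ a b p q → a + b * + 2 + (r′ + (p + q * + 2)) ≡ r′ + ((a + p) + (b + q) * + 2)
    regroup = solve-∀
    shift : ∀ a b p q → a - b + (p - q) ≡ (a + p) - (b + q)
    shift = solve-∀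

  byOffset : Pt → Bool → Bool → Bool → Bool → Bool → Bool → Bool
  byOffset d v₁ v₂ v₃ v₄ v₅ v₆ =
    choose (eqPt d (+ 1 , + 0)) v₁ (choose (eqPt d (- + 1 , + 0)) v₂ (choose (eqPt d (+ 0 , + 1)) v₃
      (choose (eqPt d (+ 0 , - + 1)) v₄ (choose (eqPt d (+ 1 , - + 1)) v₅ v₆))))
    where
    choose : Bool → Bool → Bool → Bool
    choose c v w = if c then v else w

  -- The degree of a lattice vertex u, given which translates u ⊕ d are hexagon centres and which
  -- are centres of hexagons of HC(n).
  localDegree : (Pt → Bool) → (Pt → Bool) → ℕ
  localDegree centre hexIn =
    count (λ d → not (centre d) ∧ any (λ e → eqPt e d) offsets ∧ any (λ d′ → hexIn d′ ∧ triNbr d′ d) offsets) offsets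

  -- A lattice vertex with surrounding hexagons x, y, z has one edge between each two of them,
  -- present iff one of the two hexagons belongs to HC(n).
  hexDegree : Bool → Bool → Bool → ℕ
  hexDegree x y z = 𝟙 (y ∨ z) ℕ.+ 𝟙 (x ∨ z) ℕ.+ 𝟙 (x ∨ y)

  module _ (n : ℕ) (u : Pt) (u-vertex : isCentre u ≡ false) {centre hexIn : Pt → Bool}
    (centre-nbr : ∀ {d} → d ∈ offsets → isCentre (u ⊕ d) ≡ centre d)
    (hexIn-nbr : ∀ {d} → d ∈ offsets → centreIn n (u ⊕ d) ≡ hexIn d) where

    count-adjHC-local : count (λ d → adjHC n u (u ⊕ d)) offsets ≡ localDegree centre hexIn
    count-adjHC-local = ∑-cong offsets (λ d d∈ → cong 𝟙 (trans (adjHC-⊕ n u d) (rewrite-flags d∈)))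
      where
      rewrite-flags : ∀ {d} → d ∈ offsets →
        (not (isCentre u) ∧ not (isCentre (u ⊕ d)) ∧ any (λ e → eqPt e d) offsets ∧ any (λ d′ → centreIn n (u ⊕ d′) ∧ triNbr d′ d) offsets)
        ≡ (not (centre d) ∧ any (λ e → eqPt e d) offsets ∧ any (λ d′ → hexIn d′ ∧ triNbr d′ d) offsets)
      rewrite-flags {d} d∈ rewrite u-vertex | centre-nbr d∈ =
        cong (λ h → not (centre d) ∧ any (λ e → eqPt e d) offsets ∧ h)
          (any-cong offsets (λ d′ d′∈ → cong (_∧ triNbr d′ d) (hexIn-nbr d′∈)))

    inHC-local : inHC n u ≡ any hexIn offsets
    inHC-local rewrite u-vertex = any-cong offsets (λ d d∈ → hexIn-nbr d∈)

  private
    0<3 : 0 < 3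
    0<3 = s≤s z≤n
    1<3 : 1 < 3
    1<3 = s≤s (s≤s z≤n)
    2<3 : 2 < 3
    2<3 = s≤s (s≤s (s≤s z≤n))

    isCentre-centre : ∀ {p} a b → p ≡ pt a b 0 → isCentre p ≡ true
    isCentre-centre a b refl = isCentre-pt a b 0 0<3

    isCentre-vertex : ∀ {p} a b {r} → ℕ.suc r < 3 → p ≡ pt a b (ℕ.suc r) → isCentre p ≡ false
    isCentre-vertex a b {r} r<3 refl = isCentre-pt a b (ℕ.suc r) r<3

    centreIn-vertex : ∀ n {p} a b {r} → ℕ.suc r < 3 → p ≡ pt a b (ℕ.suc r) → centreIn n p ≡ false
    centreIn-vertex n a b {r} r<3 refl rewrite isCentre-pt a b (ℕ.suc r) r<3 = refl

    centreIn-centre : ∀ n {p} a b → p ≡ pt a b 0 → centreIn n p ≡ inHex n a b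
    centreIn-centre n a b refl = centreIn-pt n a b

  module Residue₁ (n : ℕ) (a b : ℤ) where
    private
      u = pt a b 1
      x = inHex n a b
      y = inHex n (a + + 1) b
      z = inHex n a (b + + 1)
      nbr₁ : u ⊕ (+ 1 , + 0) ≡ pt a b 2
      nbr₁ = pt-⊕ a b 1 (+ 0) (+ 0) 2 (ℤ.+-identityʳ a) (ℤ.+-identityʳ b) refl refl
      nbr₂ : u ⊕ (- + 1 , + 0) ≡ pt a b 0
      nbr₂ = pt-⊕ a b 1 (+ 0) (+ 0) 0 (ℤ.+-identityʳ a) (ℤ.+-identityʳ b) refl refl
      nbr₃ : u ⊕ (+ 0 , + 1) ≡ pt (a + + 1) b 0
      nbr₃ = pt-⊕ a b 1 (+ 1) (+ 0) 0 refl (ℤ.+-identityʳ b) refl refl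
      nbr₄ : u ⊕ (+ 0 , - + 1) ≡ pt (a - + 1) b 2
      nbr₄ = pt-⊕ a b 1 (- + 1) (+ 0) 2 refl (ℤ.+-identityʳ b) refl refl
      nbr₅ : u ⊕ (+ 1 , - + 1) ≡ pt a (b + + 1) 0
      nbr₅ = pt-⊕ a b 1 (+ 0) (+ 1) 0 (ℤ.+-identityʳ a) refl refl refl
      nbr₆ : u ⊕ (- + 1 , + 1) ≡ pt a (b - + 1) 2
      nbr₆ = pt-⊕ a b 1 (+ 0) (- + 1) 2 (ℤ.+-identityʳ a) refl refl refl
      centre : Pt → Bool
      centre d = byOffset d false true true false true false
      hexIn : Pt → Bool
      hexIn d = byOffset d false x y false z false
      centre-nbr : ∀ {d} → d ∈ offsets → isCentre (u ⊕ d) ≡ centre d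
      centre-nbr = offsets-elim {λ d → isCentre (u ⊕ d) ≡ centre d}
        (isCentre-vertex a b 2<3 nbr₁) (isCentre-centre a b nbr₂) (isCentre-centre (a + + 1) b nbr₃)
        (isCentre-vertex (a - + 1) b 2<3 nbr₄) (isCentre-centre a (b + + 1) nbr₅) (isCentre-vertex a (b - + 1) 2<3 nbr₆)
      hexIn-nbr : ∀ {d} → d ∈ offsets → centreIn n (u ⊕ d) ≡ hexIn d
      hexIn-nbr = offsets-elim {λ d → centreIn n (u ⊕ d) ≡ hexIn d}
        (centreIn-vertex n a b 2<3 nbr₁) (centreIn-centre n a b nbr₂) (centreIn-centre n (a + + 1) b nbr₃)
        (centreIn-vertex n (a - + 1) b 2<3 nbr₄) (centreIn-centre n a (b + + 1) nbr₅) (centreIn-vertex n a (b - + 1) 2<3 nbr₆)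
      table : ∀ x y z → localDegree centre (λ d → byOffset d false x y false z false) ≡ hexDegree x y z
      table true  true  true  = refl
      table true  true  false = refl
      table true  false true  = refl
      table true  false false = refl
      table false true  true  = refl
      table false true  false = refl
      table false false true  = refl
      table false false false = refl
      any-table : ∀ x y z → any (λ d → byOffset d false x y false z false) offsets ≡ x ∨ y ∨ z
      any-table true  _     _     = refl
      any-table false true  _     = refl
      any-table false false true  = refl
      any-table false false false = refl
      u-vertex : isCentre u ≡ false
      u-vertex = isCentre-pt a b 1 1<3

    count-adjHC-pt₁ : count (λ d → adjHC n (pt a b 1) (pt a b 1 ⊕ d)) offsets
                      ≡ hexDegree (inHex n a b) (inHex n (a + + 1) b) (inHex n a (b + + 1))
    count-adjHC-pt₁ = trans (count-adjHC-local n u u-vertex centre-nbr hexIn-nbr) (table x y z)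

    inHC-pt₁ : inHC n (pt a b 1) ≡ inHex n a b ∨ inHex n (a + + 1) b ∨ inHex n a (b + + 1)
    inHC-pt₁ = trans (inHC-local n u u-vertex centre-nbr hexIn-nbr) (any-table x y z)

  module Residue₂ (n : ℕ) (a b : ℤ) where
    private
      u = pt a b 2
      x = inHex n (a + + 1) (b + + 1)
      y = inHex n a (b + + 1)
      z = inHex n (a + + 1) b
      nbr₁ : u ⊕ (+ 1 , + 0) ≡ pt (a + + 1) (b + + 1) 0
      nbr₁ = pt-⊕ a b 2 (+ 1) (+ 1) 0 refl refl refl refl
      nbr₂ : u ⊕ (- + 1 , + 0) ≡ pt a b 1
      nbr₂ = pt-⊕ a b 2 (+ 0) (+ 0) 1 (ℤ.+-identityʳ a) (ℤ.+-identityʳ b) refl refl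
      nbr₃ : u ⊕ (+ 0 , + 1) ≡ pt (a + + 1) b 1
      nbr₃ = pt-⊕ a b 2 (+ 1) (+ 0) 1 refl (ℤ.+-identityʳ b) refl refl
      nbr₄ : u ⊕ (+ 0 , - + 1) ≡ pt a (b + + 1) 0
      nbr₄ = pt-⊕ a b 2 (+ 0) (+ 1) 0 (ℤ.+-identityʳ a) refl refl refl
      nbr₅ : u ⊕ (+ 1 , - + 1) ≡ pt a (b + + 1) 1
      nbr₅ = pt-⊕ a b 2 (+ 0) (+ 1) 1 (ℤ.+-identityʳ a) refl refl refl
      nbr₆ : u ⊕ (- + 1 , + 1) ≡ pt (a + + 1) b 0
      nbr₆ = pt-⊕ a b 2 (+ 1) (+ 0) 0 refl (ℤ.+-identityʳ b) refl refl
      centre : Pt → Bool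
      centre d = byOffset d true false false true false true
      hexIn : Pt → Bool
      hexIn d = byOffset d x false false y false z
      centre-nbr : ∀ {d} → d ∈ offsets → isCentre (u ⊕ d) ≡ centre d
      centre-nbr = offsets-elim {λ d → isCentre (u ⊕ d) ≡ centre d}
        (isCentre-centre (a + + 1) (b + + 1) nbr₁) (isCentre-vertex a b 1<3 nbr₂) (isCentre-vertex (a + + 1) b 1<3 nbr₃)
        (isCentre-centre a (b + + 1) nbr₄) (isCentre-vertex a (b + + 1) 1<3 nbr₅) (isCentre-centre (a + + 1) b nbr₆)
      hexIn-nbr : ∀ {d} → d ∈ offsets → centreIn n (u ⊕ d) ≡ hexIn d
      hexIn-nbr = offsets-elim {λ d → centreIn n (u ⊕ d) ≡ hexIn d}
        (centreIn-centre n (a + + 1) (b + + 1) nbr₁) (centreIn-vertex n a b 1<3 nbr₂) (centreIn-vertex n (a + + 1) b 1<3 nbr₃)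
        (centreIn-centre n a (b + + 1) nbr₄) (centreIn-vertex n a (b + + 1) 1<3 nbr₅) (centreIn-centre n (a + + 1) b nbr₆)
      table : ∀ x y z → localDegree centre (λ d → byOffset d x false false y false z) ≡ hexDegree x y z
      table true  true  true  = refl
      table true  true  false = refl
      table true  false true  = refl
      table true  false false = refl
      table false true  true  = refl
      table false true  false = refl
      table false false true  = refl
      table false false false = refl
      any-table : ∀ x y z → any (λ d → byOffset d x false false y false z) offsets ≡ x ∨ y ∨ z
      any-table true  _     _     = refl
      any-table false true  _     = refl
      any-table false false true  = refl
      any-table false false false = refl
      u-vertex : isCentre u ≡ false
      u-vertex = isCentre-pt a b 2 2<3

    count-adjHC-pt₂ : count (λ d → adjHC n (pt a b 2) (pt a b 2 ⊕ d)) offsets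
                      ≡ hexDegree (inHex n (a + + 1) (b + + 1)) (inHex n a (b + + 1)) (inHex n (a + + 1) b)
    count-adjHC-pt₂ = trans (count-adjHC-local n u u-vertex centre-nbr hexIn-nbr) (table x y z)

    inHC-pt₂ : inHC n (pt a b 2) ≡ inHex n (a + + 1) (b + + 1) ∨ inHex n a (b + + 1) ∨ inHex n (a + + 1) b
    inHC-pt₂ = trans (inHC-local n u u-vertex centre-nbr hexIn-nbr) (any-table x y z)

  inHC-pt₀ : ∀ n a b → inHC n (pt a b 0) ≡ false
  inHC-pt₀ n a b rewrite isCentre-pt a b 0 0<3 = refl

module HexSupport where

  open import Data.Bool using (Bool; true; false; _∨_; if_then_else_; T)
  open import Data.Bool.Properties using (T?)

  open import Data.Nat as ℕ using (ℕ; suc; _≤_; _<_; z≤n; s≤s; _⊔_; _≡ᵇ_)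
  import Data.Nat.Properties as ℕ
  import Data.Nat.Tactic.RingSolver as ℕ-Solver
  open import Data.Integer as ℤ using (ℤ; +_; -[1+_]; _+_; _*_; _-_; -_; ∣_∣)
  import Data.Integer.Properties as ℤ
  open import Data.Integer.Tactic.RingSolver using (solve-∀)
  open import Data.List using (List; []; _∷_; map; filter; concatMap; upTo)
  open import Data.List.Membership.Propositional using (_∈_; find)
  open import Data.List.Membership.Propositional.Properties using (∈-map⁺; ∈-map⁻; ∈-upTo⁺; ∈-concatMap⁺; ∈-concatMap⁻)
  open import Data.List.Relation.Unary.Any as Any using (here; there)
  open import Data.List.Relation.Unary.All as All using (All)
  open import Data.List.Relation.Unary.AllPairs using ([]; _∷_)
  open import Data.List.Relation.Unary.Unique.Propositional using (Unique)
  import Data.List.Relation.Unary.Unique.Propositional.Properties as Unique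
  open import Data.Product using (_×_; _,_; proj₁; proj₂; ∃)
  open import Data.Sum using (_⊎_; inj₁; inj₂)
  open import Data.Empty using (⊥; ⊥-elim)
  open import Function using (_∘_)
  open import Relation.Binary.PropositionalEquality
  open import Defs
  open Sums
  open HexCoordinates
  open HexAdjacency
  open HexLocal
  open Octahedral using (IsSimple)

  private
    variable
      A B : Set

  Unique-concatMap : (f : A → List B) {xs : List A} → Unique xs → (∀ {x} → x ∈ xs → Unique (f x)) →
    (∀ {x y z} → x ∈ xs → y ∈ xs → z ∈ f x → z ∈ f y → x ≡ y) → Unique (concatMap f xs)
  Unique-concatMap f {[]}     []          _       _     = []
  Unique-concatMap f {x ∷ xs} (x≢xs ∷ u) unique-f apart =
    Unique.++⁺ (unique-f (here refl)) (Unique-concatMap f u (unique-f ∘ there) (λ p q → apart (there p) (there q)))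
      (λ { (z∈fx , z∈rest) → disjoint z∈fx (∈-concatMap⁻ f z∈rest) })
    where
    disjoint : ∀ {z} → z ∈ f x → Any.Any (λ y → z ∈ f y) xs → ⊥
    disjoint z∈fx z∈f[xs] with find z∈f[xs]
    ... | y , y∈xs , z∈fy = All.lookup x≢xs y∈xs (apart (here refl) (there y∈xs) z∈fx z∈fy)

  shiftedRange : ℕ → ℕ → List ℤ
  shiftedRange N M = map (λ k → + k - + N) (upTo M)

  Unique-shiftedRange : ∀ N M → Unique (shiftedRange N M)
  Unique-shiftedRange N M = Unique.map⁺ (λ {i} {j} eq → ℤ.+-injective (trans (sym (i-j+j≡i (+ i) (+ N))) (trans (cong (_+ + N) eq) (i-j+j≡i (+ j) (+ N))))) (Unique.upTo⁺ M)

  ∈-shiftedRange : ∀ {z N M} → ∣ z ∣ ≤ N → N ℕ.+ N < M → z ∈ shiftedRange N M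
  ∈-shiftedRange {+ k} {N} k≤N 2N<M =
    subst (_∈ shiftedRange N _) (trans (cong (_- + N) (ℤ.pos-+ k N)) (i+j-j≡i (+ k) (+ N)))
      (∈-map⁺ (λ k → + k - + N) (∈-upTo⁺ (ℕ.≤-<-trans (ℕ.+-monoˡ-≤ N k≤N) 2N<M)))
    where
    i+j-j≡i : ∀ i j → i + j - j ≡ i
    i+j-j≡i = solve-∀
  ∈-shiftedRange { -[1+ k ]} {N} {M} k<N 2N<M with ℕ.m≤n⇒∃[o]m+o≡n k<N
  ... | t , refl =
    subst (_∈ shiftedRange (suc k ℕ.+ t) M) (trans (cong (λ m → + t - m) (trans (ℤ.pos-+ (suc k) t) (cong (_+ + t) (ℤ.pos-+ 1 k)))) (t-[1+k+t]≡-[1+k] (+ t) (+ k)))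
      (∈-map⁺ (λ i → + i - + (suc k ℕ.+ t)) (∈-upTo⁺ (ℕ.≤-<-trans (ℕ.≤-trans (ℕ.m≤n+m t (suc k)) (ℕ.m≤m+n _ _)) 2N<M)))
    where
    t-[1+k+t]≡-[1+k] : ∀ t k → t - (+ 1 + k + t) ≡ - (+ 1 + k)
    t-[1+k+t]≡-[1+k] = solve-∀

  hexRange : ℕ → List ℤ
  hexRange n = shiftedRange n (suc (n ℕ.+ n))

  Unique-box : ∀ n → Unique (box n)
  Unique-box n = Unique-concatMap (λ i → map (i ,_) (range n)) (Unique-shiftedRange (3 ℕ.* n) (suc (6 ℕ.* n)))
    (λ _ → Unique.map⁺ (cong proj₂) (Unique-shiftedRange (3 ℕ.* n) (suc (6 ℕ.* n))))
    (λ _ _ z∈ z∈′ → trans (sym (first z∈)) (first z∈′))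
    where
    first : ∀ {i z} → z ∈ map (i ,_) (range n) → proj₁ z ≡ i
    first z∈ with ∈-map⁻ _ z∈
    ... | _ , _ , refl = refl

  ∈-box : ∀ {n i j} → ∣ i ∣ ≤ 3 ℕ.* n → ∣ j ∣ ≤ 3 ℕ.* n → (i , j) ∈ box n
  ∈-box {n} {i} {j} i≤ j≤ = ∈-concatMap⁺ (λ i → map (i ,_) (range n)) (Any.map (λ { refl → ∈-map⁺ (_ ,_) (∈-range j≤) }) (∈-range i≤))
    where
    ∈-range : ∀ {z} → ∣ z ∣ ≤ 3 ℕ.* n → z ∈ range n
    ∈-range z≤ = ∈-shiftedRange z≤ (s≤s (ℕ.≤-reflexive (six n)))
      where
      six : ∀ n → 3 ℕ.* n ℕ.+ 3 ℕ.* n ≡ 6 ℕ.* n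
      six = ℕ-Solver.solve-∀

  inHex-bounds : ∀ n a b → inHex n a b ≡ true → ∣ a ∣ < n × ∣ b ∣ < n × ∣ a + b ∣ < n
  inHex-bounds n a b e =
    ℕ.m⊔n<o⇒m<o (∣ a ∣) (∣ b ∣) a⊔b<n , ℕ.m⊔n<o⇒n<o (∣ a ∣) (∣ b ∣) a⊔b<n , ℕ.m⊔n<o⇒n<o (∣ a ∣ ⊔ ∣ b ∣) (∣ a + b ∣) all<n
    where
    all<n = ℕ.<ᵇ⇒< _ n (subst T (sym e) _)
    a⊔b<n = ℕ.m⊔n<o⇒m<o (∣ a ∣ ⊔ ∣ b ∣) (∣ a + b ∣) all<n

  centreIn-true⁻ : ∀ n p → centreIn n p ≡ true → ∃ λ a → ∃ λ b → p ≡ pt a b 0 × inHex n a b ≡ true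
  centreIn-true⁻ n p e with pt-decomposition p
  ... | a , b , 0 , _ , refl = a , b , refl , trans (sym (centreIn-pt n a b)) e
  ... | a , b , suc r , r<3 , refl rewrite isCentre-pt a b (suc r) r<3 with () ← e

  nextToHexagon : ∀ n v → inHC n v ≡ true →
    ∃ λ a → ∃ λ b → ∃ λ e → e ∈ offsets × inHex n a b ≡ true × v ≡ pt a b 0 ⊕ e
  nextToHexagon n v v∈HC with any-true⁻ (λ d → centreIn n (v ⊕ d)) offsets (proj₂ (∧-true⁻ v∈HC))
  ... | d , d∈ , centre with centreIn-true⁻ n (v ⊕ d) centre | offsets-opposite d∈
  ...   | a , b , v⊕d≡c , inHex-ab | e , e∈ , d⊕e≡0 = a , b , e , e∈ , inHex-ab ,
          trans (sym (trans (⊕-assoc v d e) (trans (cong (v ⊕_) d⊕e≡0) (⊕-identityʳ v)))) (cong (_⊕ e) v⊕d≡c)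

  offset-bounds : ∀ {d} → d ∈ offsets → ∣ proj₁ d ∣ ≤ 1 × ∣ proj₂ d ∣ ≤ 1
  offset-bounds = offsets-elim {λ d → ∣ proj₁ d ∣ ≤ 1 × ∣ proj₂ d ∣ ≤ 1}
    (ℕ.≤-refl , z≤n) (ℕ.≤-refl , z≤n) (z≤n , ℕ.≤-refl) (z≤n , ℕ.≤-refl) (ℕ.≤-refl , ℕ.≤-refl) (ℕ.≤-refl , ℕ.≤-refl)

  private
    ∣s+t+x∣≤ : ∀ s t x → ∣ s + t + x ∣ ≤ ∣ s ∣ ℕ.+ ∣ t ∣ ℕ.+ ∣ x ∣
    ∣s+t+x∣≤ s t x = ℕ.≤-trans (ℤ.∣i+j∣≤∣i∣+∣j∣ (s + t) x) (ℕ.+-monoˡ-≤ ∣ x ∣ (ℤ.∣i+j∣≤∣i∣+∣j∣ s t))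

    sum-bound : ∀ {n p q r} → p < n → q < n → r ≤ 1 → p ℕ.+ q ℕ.+ r ≤ 3 ℕ.* n
    sum-bound {n} {p} {q} {r} p<n q<n r≤1 = ℕ.≤-trans (ℕ.+-monoʳ-≤ (p ℕ.+ q) r≤1)
      (ℕ.≤-trans (ℕ.≤-reflexive (ℕ.+-comm (p ℕ.+ q) 1)) (ℕ.≤-trans (ℕ.+-mono-≤ p<n (ℕ.<⇒≤ q<n)) (ℕ.≤-trans (ℕ.m≤m+n (n ℕ.+ n) n) (ℕ.≤-reflexive (thrice n)))))
      where
      thrice : ∀ n → n ℕ.+ n ℕ.+ n ≡ 3 ℕ.* n
      thrice = ℕ-Solver.solve-∀

  centre-⊕-in-box : ∀ {n} a b x y → inHex n a b ≡ true → ∣ x ∣ ≤ 1 → ∣ y ∣ ≤ 1 → pt a b 0 ⊕ (x , y) ∈ box n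
  centre-⊕-in-box {n} a b x y inHex-ab x≤1 y≤1 = ∈-box {n} i≤ j≤
    where
    a<n = proj₁ (inHex-bounds n a b inHex-ab)
    b<n = proj₁ (proj₂ (inHex-bounds n a b inHex-ab))
    a+b<n = proj₂ (proj₂ (inHex-bounds n a b inHex-ab))
    first : + 0 + (a + b * + 2) + x ≡ a + b + b + x
    first = regroup a b x
      where
      regroup : ∀ a b x → + 0 + (a + b * + 2) + x ≡ a + b + b + x
      regroup = solve-∀
    i≤ : ∣ + 0 + (a + b * + 2) + x ∣ ≤ 3 ℕ.* n
    i≤ rewrite first = ℕ.≤-trans (∣s+t+x∣≤ (a + b) b x) (sum-bound a+b<n b<n x≤1)
    j≤ : ∣ a - b + y ∣ ≤ 3 ℕ.* n
    j≤ = ℕ.≤-trans (∣s+t+x∣≤ a (- b) y) (sum-bound a<n (subst (_< n) (sym (ℤ.∣-i∣≡∣i∣ b)) b<n) y≤1)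

  HC-in-box : ∀ n v → inHC n v ≡ true → v ∈ box n
  HC-in-box n v v∈HC =
    let a , b , e , e∈ , inHex-ab , v≡ = nextToHexagon n v v∈HC
    in subst (_∈ box n) (sym v≡) (centre-⊕-in-box {n} a b (proj₁ e) (proj₂ e) inHex-ab (proj₁ (offset-bounds e∈)) (proj₂ (offset-bounds e∈)))

  cellVertices : ℤ → ℤ → List Pt
  cellVertices a b = pt a b 1 ∷ pt a b 2 ∷ []

  cells : ℕ → List Pt
  cells n = concatMap (λ a → concatMap (cellVertices a) (hexRange n)) (hexRange n)

  ∈-cells : ∀ n a b {v} → ∣ a ∣ ≤ n → ∣ b ∣ ≤ n → v ∈ cellVertices a b → v ∈ cells n
  ∈-cells n a b a≤n b≤n v∈ =
    ∈-concatMap⁺ (λ a → concatMap (cellVertices a) (hexRange n))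
      (Any.map (λ { refl → ∈-concatMap⁺ (cellVertices a) (Any.map (λ { refl → v∈ }) (∈-shiftedRange {b} {n} b≤n ℕ.≤-refl)) })
        (∈-shiftedRange {a} {n} a≤n ℕ.≤-refl))

  private
    centre-⊕ : ∀ a b {e} → e ∈ offsets →
      ∃ λ p → ∃ λ q → ∣ p ∣ ≤ 1 × ∣ q ∣ ≤ 1 × pt a b 0 ⊕ e ∈ cellVertices (a + p) (b + q)
    centre-⊕ a b = offsets-elim {λ e → ∃ λ p → ∃ λ q → ∣ p ∣ ≤ 1 × ∣ q ∣ ≤ 1 × pt a b 0 ⊕ e ∈ cellVertices (a + p) (b + q)}
      (+ 0   , + 0   , z≤n , z≤n , here (pt-⊕ a b 0 (+ 0) (+ 0) 1 refl refl refl refl))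
      (- + 1 , - + 1 , ℕ.≤-refl , ℕ.≤-refl , there (here (pt-⊕ a b 0 (- + 1) (- + 1) 2 refl refl refl refl)))
      (+ 0   , - + 1 , z≤n , ℕ.≤-refl , there (here (pt-⊕ a b 0 (+ 0) (- + 1) 2 refl refl refl refl)))
      (- + 1 , + 0   , ℕ.≤-refl , z≤n , here (pt-⊕ a b 0 (- + 1) (+ 0) 1 refl refl refl refl))
      (- + 1 , + 0   , ℕ.≤-refl , z≤n , there (here (pt-⊕ a b 0 (- + 1) (+ 0) 2 refl refl refl refl)))
      (+ 0   , - + 1 , z≤n , ℕ.≤-refl , here (pt-⊕ a b 0 (+ 0) (- + 1) 1 refl refl refl refl))

  HC-in-cells : ∀ n v → inHC n v ≡ true → v ∈ cells n
  HC-in-cells n v v∈HC =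
    let a , b , e , e∈ , inHex-ab , v≡ = nextToHexagon n v v∈HC
        p , q , p≤1 , q≤1 , c∈ = centre-⊕ a b e∈
        a<n , b<n , _ = inHex-bounds n a b inHex-ab
    in subst (_∈ cells n) (sym v≡) (∈-cells n (a + p) (b + q) (near a p a<n p≤1) (near b q b<n q≤1) c∈)
    where
    near : ∀ s t → ∣ s ∣ < n → ∣ t ∣ ≤ 1 → ∣ s + t ∣ ≤ n
    near s t s<n t≤1 = ℕ.≤-trans (ℤ.∣i+j∣≤∣i∣+∣j∣ s t) (ℕ.≤-trans (ℕ.+-monoʳ-≤ ∣ s ∣ t≤1) (ℕ.≤-trans (ℕ.≤-reflexive (ℕ.+-comm ∣ s ∣ 1)) s<n))

  Unique-cells : ∀ n → Unique (cells n)
  Unique-cells n = Unique-concatMap row (Unique-shiftedRange n (suc (n ℕ.+ n)))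
    (λ {a} _ → Unique-concatMap (cellVertices a) (Unique-shiftedRange n (suc (n ℕ.+ n))) (λ {b} _ → Unique-cellVertices a b)
      (λ {b} {b′} _ _ v∈ v∈′ → proj₂ (same-cell a b a b′ v∈ v∈′)))
    (λ {a} {a′} _ _ v∈ v∈′ → same-row a a′ v∈ v∈′)
    where
    row : ℤ → List Pt
    row a = concatMap (cellVertices a) (hexRange n)
    Unique-cellVertices : ∀ a b → Unique (cellVertices a b)
    Unique-cellVertices a b =
      ((1≢2 ∘ proj₂ ∘ proj₂ ∘ pt-injective {a} {b} {1} {a} {b} {2} (s≤s (s≤s z≤n)) (s≤s (s≤s (s≤s z≤n)))) All.∷ All.[]) ∷ All.[] ∷ []
      where
      1≢2 : 1 ≢ 2
      1≢2 ()
    residue : ∀ a b {v} → v ∈ cellVertices a b → ∃ λ r → r < 3 × v ≡ pt a b r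
    residue a b (here refl)         = 1 , s≤s (s≤s z≤n) , refl
    residue a b (there (here refl)) = 2 , s≤s (s≤s (s≤s z≤n)) , refl
    same-cell : ∀ a b a′ b′ {v} → v ∈ cellVertices a b → v ∈ cellVertices a′ b′ → a ≡ a′ × b ≡ b′
    same-cell a b a′ b′ v∈ v∈′ with residue a b v∈ | residue a′ b′ v∈′
    ... | r , r<3 , refl | r′ , r′<3 , eq = let a≡a′ , b≡b′ , _ = pt-injective {a} {b} {r} {a′} {b′} {r′} r<3 r′<3 eq in a≡a′ , b≡b′
    same-row : ∀ a a′ {v} → v ∈ row a → v ∈ row a′ → a ≡ a′
    same-row a a′ v∈ v∈′ with find (∈-concatMap⁻ (cellVertices a) {hexRange n} v∈) | find (∈-concatMap⁻ (cellVertices a′) {hexRange n} v∈′)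
    ... | b , _ , v∈c | b′ , _ , v∈c′ = proj₁ (same-cell a b a′ b′ v∈c v∈c′)

  module EqPt = BoolEquality eqPt eqPt-sound eqPt-refl

  Unique-offsets : Unique offsets
  Unique-offsets = ((λ ()) All.∷ (λ ()) All.∷ (λ ()) All.∷ (λ ()) All.∷ (λ ()) All.∷ All.[])
                 ∷ ((λ ()) All.∷ (λ ()) All.∷ (λ ()) All.∷ (λ ()) All.∷ All.[])
                 ∷ ((λ ()) All.∷ (λ ()) All.∷ (λ ()) All.∷ All.[])
                 ∷ ((λ ()) All.∷ (λ ()) All.∷ All.[])
                 ∷ ((λ ()) All.∷ All.[])
                 ∷ All.[] ∷ []

  deg-HC : ∀ n u → deg (HC n) u ≡ count (λ d → adjHC n u (u ⊕ d)) offsets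
  deg-HC n u = begin
    deg (HC n) u                                               ≡⟨ length-filter (adjHC n u) (verts (HC n)) ⟩
    count (adjHC n u) (filter (λ p → T? (inHC n p)) (box n))    ≡⟨ ∑-filter _ (inHC n) (box n) ⟩
    ∑ (λ v → if inHC n v then 𝟙 (adjHC n u v) else 0) (box n)    ≡⟨ ∑-ext (box n) only-HC ⟩
    count (adjHC n u) (box n)
      ≡⟨ EqPt.∑-support (λ v → 𝟙 (adjHC n u v)) (box n) (map (u ⊕_) offsets) (Unique-box n) (Unique.map⁺ (⊕-cancelˡ u) Unique-offsets) to-nbrs to-box ⟩
    count (adjHC n u) (map (u ⊕_) offsets)                     ≡⟨ ∑-map (λ v → 𝟙 (adjHC n u v)) (u ⊕_) offsets ⟩
    count (λ d → adjHC n u (u ⊕ d)) offsets                    ∎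
    where
    open ≡-Reasoning
    only-HC : ∀ v → (if inHC n v then 𝟙 (adjHC n u v) else 0) ≡ 𝟙 (adjHC n u v)
    only-HC v = if-then-𝟙 (adjHC⇒inHC n u v)
    adjacent : ∀ v → 𝟙 (adjHC n u v) ≢ 0 → adjHC n u v ≡ true
    adjacent v nz with adjHC n u v
    ... | true  = refl
    ... | false = ⊥-elim (nz refl)
    to-nbrs : ∀ v → 𝟙 (adjHC n u v) ≢ 0 → v ∈ box n → v ∈ map (u ⊕_) offsets
    to-nbrs v nz _ =
      let _ , _ , u~v , _ = adjHC⁻ n u v (adjacent v nz)
          d , d∈ , v≡ = triNbr⁻ u v u~v
      in subst (_∈ map (u ⊕_) offsets) (sym v≡) (∈-map⁺ (u ⊕_) d∈)
    to-box : ∀ v → 𝟙 (adjHC n u v) ≢ 0 → v ∈ map (u ⊕_) offsets → v ∈ box n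
    to-box v nz _ = HC-in-box n v (adjHC⇒inHC n u v (adjacent v nz))

  HC-isSimple : ∀ n → IsSimple (HC n)
  HC-isSimple n = record
    { eq-sound     = eqPt-sound
    ; eq-refl      = eqPt-refl
    ; verts-unique = Unique.filter⁺ (λ p → T? (inHC n p)) (Unique-box n)
    ; adj-sym      = adjHC-sym n
    ; adj-irrefl   = adjHC-irrefl n
    }

  ∈-verts-HC⁻ : ∀ n {v} → v ∈ verts (HC n) → inHC n v ≡ true
  ∈-verts-HC⁻ n v∈ = proj₂ (∈-filterᵇ⁻ (inHC n) {box n} v∈)

  hexDegree-2-or-3 : ∀ x y z → x ∨ y ∨ z ≡ true → hexDegree x y z ≡ 2 ⊎ hexDegree x y z ≡ 3
  hexDegree-2-or-3 true  true  true  _ = inj₂ refl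
  hexDegree-2-or-3 true  true  false _ = inj₂ refl
  hexDegree-2-or-3 true  false true  _ = inj₂ refl
  hexDegree-2-or-3 true  false false _ = inj₁ refl
  hexDegree-2-or-3 false true  true  _ = inj₂ refl
  hexDegree-2-or-3 false true  false _ = inj₁ refl
  hexDegree-2-or-3 false false true  _ = inj₁ refl

  private
    deg-via : ∀ n {v} → v ∈ verts (HC n) → ∀ u x y z → inHC n u ≡ x ∨ y ∨ z →
      count (λ d → adjHC n u (u ⊕ d)) offsets ≡ hexDegree x y z → v ≡ u → deg (HC n) v ≡ 2 ⊎ deg (HC n) v ≡ 3
    deg-via n v∈ u x y z inHC-u deg-u refl = subst (λ d → d ≡ 2 ⊎ d ≡ 3) (sym (trans (deg-HC n u) deg-u))
      (hexDegree-2-or-3 x y z (trans (sym inHC-u) (∈-verts-HC⁻ n v∈)))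

  deg-HC-2-or-3 : ∀ n v → v ∈ verts (HC n) → deg (HC n) v ≡ 2 ⊎ deg (HC n) v ≡ 3
  deg-HC-2-or-3 n v v∈ with pt-decomposition v
  ... | a , b , 0 , _ , v≡ with () ← trans (sym (∈-verts-HC⁻ n v∈)) (trans (cong (inHC n) v≡) (inHC-pt₀ n a b))
  ... | a , b , 1 , _ , v≡ = deg-via n v∈ (pt a b 1) (inHex n a b) (inHex n (a + + 1) b) (inHex n a (b + + 1))
                               (Residue₁.inHC-pt₁ n a b) (Residue₁.count-adjHC-pt₁ n a b) v≡
  ... | a , b , 2 , _ , v≡ = deg-via n v∈ (pt a b 2) (inHex n (a + + 1) (b + + 1)) (inHex n a (b + + 1)) (inHex n (a + + 1) b)
                               (Residue₂.inHC-pt₂ n a b) (Residue₂.count-adjHC-pt₂ n a b) v≡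
  ... | _ , _ , suc (suc (suc _)) , s≤s (s≤s (s≤s ())) , _

  weight : ℕ → ℕ
  weight d = if d ≡ᵇ 2 then 128 else 144

  vertexWeight : Bool → Bool → Bool → ℕ
  vertexWeight x y z = if x ∨ y ∨ z then weight (hexDegree x y z) else 0

  cellWeight : ℕ → ℤ → ℤ → ℕ
  cellWeight n a b = vertexWeight (inHex n a b) (inHex n (a + + 1) b) (inHex n a (b + + 1))
             ℕ.+ vertexWeight (inHex n (a + + 1) (b + + 1)) (inHex n a (b + + 1)) (inHex n (a + + 1) b)

  ∑-HC : ∀ n → ∑ (weight ∘ deg (HC n)) (verts (HC n)) ≡ ∑ (λ a → ∑ (cellWeight n a) (hexRange n)) (hexRange n)
  ∑-HC n = begin
    ∑ (weight ∘ deg (HC n)) (verts (HC n))             ≡⟨ ∑-filter _ (inHC n) (box n) ⟩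
    ∑ W (box n)                                         ≡⟨ EqPt.∑-support W (box n) (cells n) (Unique-box n) (Unique-cells n) to-cells to-box ⟩
    ∑ W (cells n)                                       ≡⟨ ∑-concatMap W (λ a → concatMap (cellVertices a) (hexRange n)) (hexRange n) ⟩
    ∑ (λ a → ∑ W (concatMap (cellVertices a) (hexRange n))) (hexRange n)
      ≡⟨ ∑-ext (hexRange n) (λ a → trans (∑-concatMap W (cellVertices a) (hexRange n)) (∑-ext (hexRange n) (cell a))) ⟩
    ∑ (λ a → ∑ (cellWeight n a) (hexRange n)) (hexRange n) ∎
    where
    open ≡-Reasoning
    W : Pt → ℕ
    W v = if inHC n v then weight (deg (HC n) v) else 0
    inHC-of : ∀ v → W v ≢ 0 → inHC n v ≡ true
    inHC-of v nz with inHC n v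
    ... | true  = refl
    ... | false = ⊥-elim (nz refl)
    to-cells : ∀ v → W v ≢ 0 → v ∈ box n → v ∈ cells n
    to-cells v nz _ = HC-in-cells n v (inHC-of v nz)
    to-box : ∀ v → W v ≢ 0 → v ∈ cells n → v ∈ box n
    to-box v nz _ = HC-in-box n v (inHC-of v nz)
    cell : ∀ a b → ∑ W (cellVertices a b) ≡ cellWeight n a b
    cell a b = trans (cong (W (pt a b 1) ℕ.+_) (ℕ.+-identityʳ _)) (cong₂ ℕ._+_
      (cong₂ (λ c d → if c then weight d else 0) (Residue₁.inHC-pt₁ n a b) (trans (deg-HC n (pt a b 1)) (Residue₁.count-adjHC-pt₁ n a b)))
      (cong₂ (λ c d → if c then weight d else 0) (Residue₂.inHC-pt₂ n a b) (trans (deg-HC n (pt a b 2)) (Residue₂.count-adjHC-pt₂ n a b))))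

module LatticeCounts where

  open import Data.Bool using (Bool; true; false; _∧_)
  open import Data.Bool.Properties using (T-≡; ∧-zeroʳ)
  open import Data.Nat
  open import Data.Nat.Properties
  open import Data.Nat.Tactic.RingSolver using (solve-∀)
  open import Data.List using (applyUpTo)
  open import Data.Product using (_,_)
  open import Data.Empty using (⊥-elim)
  open import Function using (_∘_)
  open import Function.Bundles using (Equivalence)
  open import Relation.Nullary using (¬_; yes; no)
  open import Relation.Binary.PropositionalEquality
  open Sums using (𝟙; ∑; 𝟙-∧)

  sumBelow : (ℕ → ℕ) → ℕ → ℕ
  sumBelow f zero = 0
  sumBelow f (suc N) = sumBelow f N + f N

  sumBelow-sucˡ : ∀ h N → sumBelow h (suc N) ≡ h 0 + sumBelow (h ∘ suc) N
  sumBelow-sucˡ h zero = sym (+-identityʳ (h 0))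
  sumBelow-sucˡ h (suc N) = trans (cong (_+ h (suc N)) (sumBelow-sucˡ h N)) (+-assoc (h 0) _ _)

  ∑-applyUpTo : ∀ (f : ℕ → ℕ) g N → ∑ f (applyUpTo g N) ≡ sumBelow (f ∘ g) N
  ∑-applyUpTo f g zero = refl
  ∑-applyUpTo f g (suc N) = trans (cong (f (g 0) +_) (∑-applyUpTo f (g ∘ suc) N)) (sym (sumBelow-sucˡ (f ∘ g) N))

  sumBelow-cong : ∀ {f g} N → (∀ k → k < N → f k ≡ g k) → sumBelow f N ≡ sumBelow g N
  sumBelow-cong zero h = refl
  sumBelow-cong (suc N) h = cong₂ _+_ (sumBelow-cong N (λ k k<N → h k (m<n⇒m<1+n k<N))) (h N ≤-refl)

  sumBelow-+ : ∀ f g N → sumBelow (λ k → f k + g k) N ≡ sumBelow f N + sumBelow g N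
  sumBelow-+ f g zero = refl
  sumBelow-+ f g (suc N) rewrite sumBelow-+ f g N = l (sumBelow f N) (sumBelow g N) (f N) (g N)
    where l : ∀ a b c d → a + b + (c + d) ≡ a + c + (b + d)
          l = solve-∀

  sumBelow-*ˡ : ∀ c f N → sumBelow (λ k → c * f k) N ≡ c * sumBelow f N
  sumBelow-*ˡ c f zero = sym (*-zeroʳ c)
  sumBelow-*ˡ c f (suc N) rewrite sumBelow-*ˡ c f N = sym (*-distribˡ-+ c _ (f N))

  sumBelow-const : ∀ c N → sumBelow (λ _ → c) N ≡ N * c
  sumBelow-const c zero = refl
  sumBelow-const c (suc N) rewrite sumBelow-const c N = +-comm (N * c) c

  sumBelow-rotate : ∀ h N → sumBelow (h ∘ suc) N + h 0 ≡ sumBelow h N + h N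
  sumBelow-rotate h N = trans (+-comm _ (h 0)) (sym (sumBelow-sucˡ h N))

  sumBelow-shift : ∀ h N → h 0 ≡ 0 → h N ≡ 0 → sumBelow (h ∘ suc) N ≡ sumBelow h N
  sumBelow-shift h N e0 eN = trans (sym (+-identityʳ _)) (trans (cong (sumBelow (h ∘ suc) N +_) (sym e0)) (trans (sumBelow-rotate h N) (trans (cong (sumBelow h N +_) eN) (+-identityʳ _))))

  sumBelow-reverse : ∀ f A → sumBelow f A ≡ sumBelow (λ k → f (A ∸ suc k)) A
  sumBelow-reverse f zero = refl
  sumBelow-reverse f (suc A) = trans (cong (_+ f A) (sumBelow-reverse f A)) (trans (+-comm _ (f A)) (sym (sumBelow-sucˡ (λ k → f (A ∸ k)) A)))

  sumTo : (ℕ → ℕ) → ℕ → ℕ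
  sumTo f A = sumBelow (f ∘ suc) A

  <ᵇ-true : ∀ {m n} → m < n → (m <ᵇ n) ≡ true
  <ᵇ-true m<n = Equivalence.to T-≡ (<⇒<ᵇ m<n)

  <ᵇ-false : ∀ {m n} → ¬ (m < n) → (m <ᵇ n) ≡ false
  <ᵇ-false {m} {n} m≮n with m <ᵇ n in e
  ... | false = refl
  ... | true  = ⊥-elim (m≮n (<ᵇ⇒< m n (Equivalence.from T-≡ e)))

  ≤ᵇ-true : ∀ {m n} → m ≤ n → (m ≤ᵇ n) ≡ true
  ≤ᵇ-true m≤n = Equivalence.to T-≡ (≤⇒≤ᵇ m≤n)

  ≤ᵇ-false : ∀ {m n} → ¬ (m ≤ n) → (m ≤ᵇ n) ≡ false
  ≤ᵇ-false {m} {n} m≰n with m ≤ᵇ n in e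
  ... | false = refl
  ... | true  = ⊥-elim (m≰n (≤ᵇ⇒≤ m n (Equivalence.from T-≡ e)))

  sumBelow-restrict : ∀ h A N → sumBelow (λ k → 𝟙 (k <ᵇ A) * h k) N ≡ sumBelow h (N ⊓ A)
  sumBelow-restrict h A zero = refl
  sumBelow-restrict h A (suc N) with N <? A
  ... | yes N<A rewrite sumBelow-restrict h A N | m≤n⇒m⊓n≡m (<⇒≤ N<A) | m≤n⇒m⊓n≡m N<A | <ᵇ-true N<A = cong (sumBelow h N +_) (+-identityʳ (h N))
  ... | no N≮A rewrite sumBelow-restrict h A N | m≥n⇒m⊓n≡n (≮⇒≥ N≮A) | m≥n⇒m⊓n≡n (m≤n⇒m≤1+n (≮⇒≥ N≮A)) | <ᵇ-false N≮A = +-identityʳ _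

  sumBelow-window : ∀ g A N → A < N → sumBelow (λ k → 𝟙 ((1 ≤ᵇ k) ∧ (k ≤ᵇ A)) * g k) N ≡ sumTo g A
  sumBelow-window g A (suc N) A<N = trans (sumBelow-sucˡ _ N) (trans (sumBelow-restrict (g ∘ suc) A N) (cong (sumBelow (g ∘ suc)) (m≥n⇒m⊓n≡n (s≤s⁻¹ A<N))))

  𝟙<+pred∸ : ∀ x c → 𝟙 (x <ᵇ c) + pred (c ∸ x) ≡ c ∸ x
  𝟙<+pred∸ zero zero = refl
  𝟙<+pred∸ zero (suc c) = refl
  𝟙<+pred∸ (suc x) zero = refl
  𝟙<+pred∸ (suc x) (suc c) = 𝟙<+pred∸ x c

  row-below : ∀ B k c → sumTo (λ l → 𝟙 (k + l <ᵇ c)) B + (c ∸ suc k ∸ B) ≡ c ∸ suc k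
  row-below zero k c = refl
  row-below (suc B) k c =
    trans (+-assoc (sumTo (λ l → 𝟙 (k + l <ᵇ c)) B) _ _)
      (trans (cong (sumTo (λ l → 𝟙 (k + l <ᵇ c)) B +_) Q) (row-below B k c))
    where
    Q : 𝟙 (k + suc B <ᵇ c) + (c ∸ suc k ∸ suc B) ≡ c ∸ suc k ∸ B
    Q rewrite +-suc k B | sym (pred[m∸n]≡m∸[1+n] (c ∸ suc k) B) | ∸-+-assoc c (suc k) B = 𝟙<+pred∸ (suc (k + B)) c

  triangle-step : ∀ y S → 2 * (S + pred y) + pred (pred y) * pred y ≡ 2 * S + pred y * y
  triangle-step zero S = cong (_+ 0) (cong (2 *_) (+-identityʳ S))
  triangle-step (suc zero) S = cong (_+ 0) (cong (2 *_) (+-identityʳ S))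
  triangle-step (suc (suc w)) S = l S w
    where l : ∀ S w → 2 * (S + suc w) + w * suc w ≡ 2 * S + suc w * suc (suc w)
          l = solve-∀

  triangle-sum : ∀ A c → 2 * sumTo (λ k → c ∸ suc k) A + (c ∸ suc (suc A)) * (c ∸ suc A) ≡ (c ∸ 2) * (c ∸ 1)
  triangle-sum zero c = refl
  triangle-sum (suc A) c =
    trans (cong₂ _+_ (cong (2 *_) (cong (sumTo (λ k → c ∸ suc k) A +_) (sym e1))) (cong₂ _*_ (sym e2) (sym e1)))
      (trans (triangle-step (c ∸ suc A) (sumTo (λ k → c ∸ suc k) A)) (trans (cong (λ q → 2 * sumTo (λ k → c ∸ suc k) A + q * (c ∸ suc A)) e1) (triangle-sum A c)))
    where
    e1 : pred (c ∸ suc A) ≡ c ∸ suc (suc A)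
    e1 = pred[m∸n]≡m∸[1+n] c (suc A)
    e2 : pred (pred (c ∸ suc A)) ≡ c ∸ suc (suc (suc A))
    e2 = trans (cong pred e1) (pred[m∸n]≡m∸[1+n] c (suc (suc A)))

  lowerCorner : ℕ → ℕ → ℕ → ℕ
  lowerCorner A B c = sumTo (λ k → sumTo (λ l → 𝟙 (k + l <ᵇ c)) B) A

  2*lowerCorner : ∀ A B c → c ∸ 2 ≤ A → c ∸ 2 ≤ B → 2 * lowerCorner A B c ≡ (c ∸ 2) * (c ∸ 1)
  2*lowerCorner A B c hA hB =
    trans (cong (2 *_) (sumBelow-cong A (λ k _ → trans (sym (+-identityʳ _)) (trans (cong (sumTo (λ l → 𝟙 (suc k + l <ᵇ c)) B +_) (sym (z k))) (row-below B (suc k) c)))))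
    (trans (sym (+-identityʳ _)) (trans (cong (2 * sumTo (λ k → c ∸ suc k) A +_) (sym z2)) (triangle-sum A c)))
    where
    z : ∀ k → c ∸ suc (suc k) ∸ B ≡ 0
    z k = m≤n⇒m∸n≡0 (≤-trans (∸-monoʳ-≤ c (s≤s (s≤s z≤n))) hB)
    z2 : (c ∸ suc (suc A)) * (c ∸ suc A) ≡ 0
    z2 rewrite sym (∸-+-assoc c 2 A) | m≤n⇒m∸n≡0 hA = refl

  <ᵇ-∸ : ∀ m n o → (m <ᵇ n ∸ o) ≡ (m + o <ᵇ n)
  <ᵇ-∸ m n zero rewrite +-identityʳ m = refl
  <ᵇ-∸ m zero (suc o) = refl
  <ᵇ-∸ m (suc n) (suc o) rewrite +-suc m o = <ᵇ-∸ m n o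

  <ᵇ-cancelˡ : ∀ x d y → (x + d <ᵇ x + y) ≡ (d <ᵇ y)
  <ᵇ-cancelˡ zero d y = refl
  <ᵇ-cancelˡ (suc x) d y = <ᵇ-cancelˡ x d y

  upper-regroup : ∀ k l p q → suc k + p + (suc l + q) + 2 ≡ suc k + suc l + (suc p + suc q)
  upper-regroup = solve-∀

  upperCorner : ℕ → ℕ → ℕ → ℕ
  upperCorner A B D = sumTo (λ k → sumTo (λ l → 𝟙 (D <ᵇ k + l)) B) A

  upperCorner≡lowerCorner : ∀ A B D → upperCorner A B D ≡ lowerCorner A B (A + B + 2 ∸ D)
  upperCorner≡lowerCorner A B D =
    trans (sumBelow-reverse (λ k → sumTo (λ l → 𝟙 (D <ᵇ suc k + l)) B) A)
    (sumBelow-cong A (λ k k<A → trans (sumBelow-reverse (λ l → 𝟙 (D <ᵇ suc (A ∸ suc k) + suc l)) B)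
       (sumBelow-cong B (λ l l<B → cong 𝟙 (pw k l k<A l<B)))))
    where
    pw : ∀ k l → k < A → l < B → (D <ᵇ suc (A ∸ suc k) + suc (B ∸ suc l)) ≡ (suc k + suc l <ᵇ A + B + 2 ∸ D)
    pw k l k<A l<B with m≤n⇒∃[o]m+o≡n k<A | m≤n⇒∃[o]m+o≡n l<B
    ... | (p , refl) | (q , refl) =
      trans (cong₂ (λ a b → D <ᵇ suc a + suc b) (m+n∸m≡n (suc k) p) (m+n∸m≡n (suc l) q))
      (trans (sym (<ᵇ-cancelˡ (suc k + suc l) D (suc p + suc q)))
      (trans (cong (λ z → suc k + suc l + D <ᵇ z) (sym (upper-regroup k l p q)))
        (sym (<ᵇ-∸ (suc k + suc l) (suc k + p + (suc l + q) + 2) D))))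

  inBand : ℕ → ℕ → ℕ → Bool
  inBand C D s = (C ≤ᵇ s) ∧ (s ≤ᵇ D)

  band-trichotomy : ∀ C D → C ≤ suc D → ∀ s → 𝟙 (inBand C D s) + 𝟙 (s <ᵇ C) + 𝟙 (D <ᵇ s) ≡ 1
  band-trichotomy C D CD s with s <? C | D <? s
  ... | yes s<C | yes D<s = ⊥-elim (<⇒≱ D<s (s≤s⁻¹ (≤-trans s<C CD)))
  ... | yes s<C | no D≮s rewrite ≤ᵇ-false {C} {s} (<⇒≱ s<C) | <ᵇ-true s<C | <ᵇ-false D≮s = refl
  ... | no s≮C | yes D<s rewrite <ᵇ-false s≮C | <ᵇ-true D<s | ≤ᵇ-false {s} {D} (<⇒≱ D<s) | ∧-zeroʳ (C ≤ᵇ s) = refl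
  ... | no s≮C | no D≮s rewrite <ᵇ-false s≮C | <ᵇ-false D≮s | ≤ᵇ-true (≮⇒≥ s≮C) | ≤ᵇ-true (≮⇒≥ D≮s) = refl

  bandCount : ℕ → ℕ → ℕ → ℕ → ℕ
  bandCount A B C D = sumTo (λ k → sumTo (λ l → 𝟙 (inBand C D (k + l))) B) A

  sumTo-+₃ : ∀ (f g h : ℕ → ℕ) A → sumTo f A + sumTo g A + sumTo h A ≡ sumTo (λ k → f k + g k + h k) A
  sumTo-+₃ f g h A = sym (trans (sumBelow-+ (λ k → f (suc k) + g (suc k)) (h ∘ suc) A) (cong (_+ sumTo h A) (sumBelow-+ (f ∘ suc) (g ∘ suc) A)))

  bandCount+corners : ∀ A B C D → C ≤ suc D → bandCount A B C D + lowerCorner A B C + upperCorner A B D ≡ A * B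
  bandCount+corners A B C D CD =
    trans (sumTo-+₃ (λ k → sumTo (λ l → 𝟙 (inBand C D (k + l))) B) (λ k → sumTo (λ l → 𝟙 (k + l <ᵇ C)) B) (λ k → sumTo (λ l → 𝟙 (D <ᵇ k + l)) B) A)
    (trans (sumBelow-cong A (λ k _ → trans (sumTo-+₃ (λ l → 𝟙 (inBand C D (suc k + l))) (λ l → 𝟙 (suc k + l <ᵇ C)) (λ l → 𝟙 (D <ᵇ suc k + l)) B) (trans (sumBelow-cong B (λ l _ → band-trichotomy C D CD (suc k + suc l))) (trans (sumBelow-const 1 B) (*-identityʳ B)))))
    (sumBelow-const B A))

  2*bandCount : ∀ A B C D → C ≤ suc D → C ∸ 2 ≤ A → C ∸ 2 ≤ B → (A + B + 2 ∸ D) ∸ 2 ≤ A → (A + B + 2 ∸ D) ∸ 2 ≤ B →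
    2 * bandCount A B C D + (C ∸ 2) * (C ∸ 1) + ((A + B + 2 ∸ D) ∸ 2) * ((A + B + 2 ∸ D) ∸ 1) ≡ 2 * (A * B)
  2*bandCount A B C D CD h1 h2 h3 h4 =
    trans (cong₂ (λ x y → 2 * bandCount A B C D + x + y) (sym (2*lowerCorner A B C h1 h2)) (trans (sym (2*lowerCorner A B (A + B + 2 ∸ D) h3 h4)) (cong (2 *_) (sym (upperCorner≡lowerCorner A B D)))))
      (trans (l (bandCount A B C D) (lowerCorner A B C) (upperCorner A B D)) (cong (2 *_) (bandCount+corners A B C D CD)))
    where l : ∀ a b c → 2 * a + 2 * b + 2 * c ≡ 2 * (a + b + c)
          l = solve-∀

  inBox : ℕ → ℕ → ℕ → ℕ → ℕ → ℕ → Bool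
  inBox A B C D k l = ((1 ≤ᵇ k) ∧ (k ≤ᵇ A)) ∧ (((1 ≤ᵇ l) ∧ (l ≤ᵇ B)) ∧ inBand C D (k + l))

  sum-inBox : ∀ N A B C D (P : ℕ → ℕ → Bool) → A < N → B < N → (∀ k l → P k l ≡ inBox A B C D k l) →
    sumBelow (λ k → sumBelow (λ l → 𝟙 (P k l)) N) N ≡ bandCount A B C D
  sum-inBox N A B C D P AN BN hP =
    trans (sumBelow-cong N (λ k _ → trans (sumBelow-cong N (λ l _ → trans (cong 𝟙 (hP k l)) (trans (𝟙-∧ ((1 ≤ᵇ k) ∧ (k ≤ᵇ A)) (((1 ≤ᵇ l) ∧ (l ≤ᵇ B)) ∧ inBand C D (k + l))) (cong (𝟙 ((1 ≤ᵇ k) ∧ (k ≤ᵇ A)) *_) (𝟙-∧ ((1 ≤ᵇ l) ∧ (l ≤ᵇ B)) (inBand C D (k + l)))))))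
       (trans (sumBelow-*ˡ (𝟙 ((1 ≤ᵇ k) ∧ (k ≤ᵇ A))) (λ l → 𝟙 ((1 ≤ᵇ l) ∧ (l ≤ᵇ B)) * 𝟙 (inBand C D (k + l))) N) (cong (𝟙 ((1 ≤ᵇ k) ∧ (k ≤ᵇ A)) *_) (sumBelow-window (λ l → 𝟙 (inBand C D (k + l))) B N BN)))))
    (sumBelow-window (λ k → sumTo (λ l → 𝟙 (inBand C D (k + l))) B) A N AN)

  -- The band C ≤ k + l ≤ D of the rectangle [1, A] × [1, B] is what remains after cutting off the
  -- corner triangles k + l < C and k + l > D, of sizes (C - 2)(C - 1)/2 and (c - 2)(c - 1)/2.
  count-inBox : ∀ N A B C D c (P : ℕ → ℕ → Bool) → A < N → B < N → (∀ k l → P k l ≡ inBox A B C D k l) →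
    A + B + 2 ≡ D + c → C ≤ suc D → C ∸ 2 ≤ A → C ∸ 2 ≤ B → c ∸ 2 ≤ A → c ∸ 2 ≤ B →
    2 * sumBelow (λ k → sumBelow (λ l → 𝟙 (P k l)) N) N + (C ∸ 2) * (C ∸ 1) + (c ∸ 2) * (c ∸ 1) ≡ 2 * (A * B)
  count-inBox N A B C D c P A<N B<N P≡inBox A+B+2≡D+c C≤D+1 C≤A C≤B c≤A c≤B =
    trans (cong (λ s → 2 * s + (C ∸ 2) * (C ∸ 1) + (c ∸ 2) * (c ∸ 1)) (sum-inBox N A B C D P A<N B<N P≡inBox))
      (subst (λ c′ → 2 * bandCount A B C D + (C ∸ 2) * (C ∸ 1) + (c′ ∸ 2) * (c′ ∸ 1) ≡ 2 * (A * B)) c≡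
        (2*bandCount A B C D C≤D+1 C≤A C≤B (subst (λ q → q ∸ 2 ≤ A) (sym c≡) c≤A) (subst (λ q → q ∸ 2 ≤ B) (sym c≡) c≤B)))
    where
    c≡ : A + B + 2 ∸ D ≡ c
    c≡ = trans (cong (_∸ D) A+B+2≡D+c) (m+n∸m≡n D c)

module HexagonRegion where

  open import Data.Bool using (Bool; true; _∧_)
  open import Data.Bool.Properties using (T-≡)
  open import Data.Nat as ℕ
  open import Data.Nat.Properties
  import Data.Nat.Tactic.RingSolver as ℕ-Solver
  open import Data.Integer as ℤ using (ℤ; +_)
  import Data.Integer.Properties as ℤP
  open import Data.Integer.Tactic.RingSolver using (solve-∀)
  open import Data.Product using (_×_; _,_)
  open import Data.Sum using (inj₁; inj₂)
  open import Function.Bundles using (Equivalence)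
  open import Relation.Binary.PropositionalEquality
  open Sums using (∧-true⁻; ∧-true⁺)
  open HexCoordinates using (inHex)
  open HexSupport using (inHex-bounds)
  open LatticeCounts using (inBox; <ᵇ-true; ≤ᵇ-true)

  ∣+m-+n∣≡∣m-n∣ : ∀ a b → ℤ.∣ + a ℤ.- + b ∣ ≡ ∣ a - b ∣
  ∣+m-+n∣≡∣m-n∣ a b with ≤-total a b
  ... | inj₁ a≤b = trans (cong ℤ.∣_∣ (ℤP.m-n≡m⊖n a b)) (trans (ℤP.∣⊖∣-≤ a≤b) (sym (m≤n⇒∣m-n∣≡n∸m a≤b)))
  ... | inj₂ b≤a = trans (cong ℤ.∣_∣ (trans (ℤP.m-n≡m⊖n a b) (ℤP.⊖-≥ b≤a))) (sym (m≤n⇒∣n-m∣≡n∸m b≤a))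

  ≤⇒<+pos : ∀ {a b c} → a ≤ b → 0 < c → a < b + c
  ≤⇒<+pos {a} {b} {c} a≤b 0<c = ≤-trans (s≤s a≤b) (subst (_≤ b + c) (+-comm b 1) (+-monoʳ-≤ b 0<c))

  ∣m-n∣<⇒ : ∀ a b c → ∣ a - b ∣ < c → (a < b + c) × (b < a + c)
  ∣m-n∣<⇒ a b c ∣a-b∣<c with ≤-total a b
  ... | inj₁ a≤b = let h′ = subst (_< c) (m≤n⇒∣m-n∣≡n∸m a≤b) ∣a-b∣<c in
      ≤⇒<+pos a≤b (≤-trans (s≤s z≤n) h′)
      , subst (_< a + c) (m∸n+n≡m a≤b) (subst (b ∸ a + a <_) (+-comm c a) (+-monoˡ-< a h′))
  ... | inj₂ b≤a = let h′ = subst (_< c) (m≤n⇒∣n-m∣≡n∸m b≤a) ∣a-b∣<c in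
      subst (_< b + c) (m∸n+n≡m b≤a) (subst (a ∸ b + b <_) (+-comm c b) (+-monoˡ-< b h′))
      , ≤⇒<+pos b≤a (≤-trans (s≤s z≤n) h′)

  ⇒∣m-n∣< : ∀ a b c → a < b + c → b < a + c → ∣ a - b ∣ < c
  ⇒∣m-n∣< a b c h1 h2 with ≤-total a b
  ... | inj₁ a≤b = subst (_< c) (sym (m≤n⇒∣m-n∣≡n∸m a≤b)) (+-cancelʳ-< a (b ∸ a) c (subst₂ _<_ (sym (m∸n+n≡m a≤b)) (+-comm a c) h2))
  ... | inj₂ b≤a = subst (_< c) (sym (m≤n⇒∣n-m∣≡n∸m b≤a)) (+-cancelʳ-< b (a ∸ b) c (subst₂ _<_ (sym (m∸n+n≡m b≤a)) (+-comm b c) h1))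

  hexAt : ℕ → ℕ → ℕ → Bool
  hexAt n k l = inHex n (+ k ℤ.- + n) (+ l ℤ.- + n)

  InBand : ℕ → ℕ → ℕ → ℕ → ℕ → ℕ → Set
  InBand A B C D k l = (1 ≤ k) × (k ≤ A) × (1 ≤ l) × (l ≤ B) × (C ≤ k + l) × (k + l ≤ D)

  ≤ᵇ-true⁻ : ∀ {m n} → (m ≤ᵇ n) ≡ true → m ≤ n
  ≤ᵇ-true⁻ {m} {n} e = ≤ᵇ⇒≤ m n (Equivalence.from T-≡ e)

  inBox⇒InBand : ∀ A B C D k l → inBox A B C D k l ≡ true → InBand A B C D k l
  inBox⇒InBand A B C D k l e =
    let (p , q) = ∧-true⁻ e
        (p1 , p2) = ∧-true⁻ {1 ≤ᵇ k} p
        (q1 , q2) = ∧-true⁻ q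
        (q11 , q12) = ∧-true⁻ {1 ≤ᵇ l} q1
        (q21 , q22) = ∧-true⁻ {C ≤ᵇ k + l} q2
    in ≤ᵇ-true⁻ p1 , ≤ᵇ-true⁻ p2 , ≤ᵇ-true⁻ q11 , ≤ᵇ-true⁻ q12 , ≤ᵇ-true⁻ q21 , ≤ᵇ-true⁻ q22

  InBand⇒inBox : ∀ A B C D k l → InBand A B C D k l → inBox A B C D k l ≡ true
  InBand⇒inBox A B C D k l (a , b , c , d , e , f) = ∧-true⁺ (∧-true⁺ (≤ᵇ-true a) (≤ᵇ-true b)) (∧-true⁺ (∧-true⁺ (≤ᵇ-true c) (≤ᵇ-true d)) (∧-true⁺ (≤ᵇ-true e) (≤ᵇ-true f)))

  inHex-complete : ∀ n x y → ℤ.∣ x ∣ < n → ℤ.∣ y ∣ < n → ℤ.∣ x ℤ.+ y ∣ < n → inHex n x y ≡ true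
  inHex-complete n x y a b c = <ᵇ-true (⊔-pres-<m (⊔-pres-<m a b) c)

  shifted-sum : ∀ k l n → (+ k ℤ.- + n) ℤ.+ (+ l ℤ.- + n) ≡ + (k + l) ℤ.- + (n + n)
  shifted-sum k l n = trans (l1 (+ k) (+ l) (+ n)) (sym (cong₂ (λ a b → a ℤ.- b) (ℤP.pos-+ k l) (ℤP.pos-+ n n)))
    where l1 : ∀ a b c → (a ℤ.- c) ℤ.+ (b ℤ.- c) ≡ (a ℤ.+ b) ℤ.- (c ℤ.+ c)
          l1 = solve-∀

  -- With k = a + n and l = b + n, the hexagons of HC(m + 1) are the points of the square [1, 2m + 1]²
  -- with m + 2 ≤ k + l ≤ 3m + 2.
  side : ℕ → ℕ
  side m = suc (m + m)
  lowDiag : ℕ → ℕ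
  lowDiag m = suc (suc m)
  highDiag : ℕ → ℕ
  highDiag m = suc (suc (m + m + m))

  double-suc : ∀ m → suc m + suc m ≡ suc (suc (m + m))
  double-suc = ℕ-Solver.solve-∀
  triple-suc : ∀ m → suc m + suc m + suc m ≡ suc (suc (suc (m + m + m)))
  triple-suc = ℕ-Solver.solve-∀

  hexAt⇒InBand : ∀ m k l → hexAt (suc m) k l ≡ true → InBand (side m) (side m) (lowDiag m) (highDiag m) k l
  hexAt⇒InBand m k l e =
    let n = suc m
        (bx , by , bxy) = inHex-bounds n (+ k ℤ.- + n) (+ l ℤ.- + n) e
        (kx1 , kx2) = ∣m-n∣<⇒ k n n (subst (_< n) (∣+m-+n∣≡∣m-n∣ k n) bx)
        (ly1 , ly2) = ∣m-n∣<⇒ l n n (subst (_< n) (∣+m-+n∣≡∣m-n∣ l n) by)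
        (s1 , s2) = ∣m-n∣<⇒ (k + l) (n + n) n (subst (_< n) (trans (cong ℤ.∣_∣ (shifted-sum k l n)) (∣+m-+n∣≡∣m-n∣ (k + l) (n + n))) bxy)
    in +-cancelʳ-< n 0 k kx2 , s≤s⁻¹ (subst (k <_) (double-suc m) kx1) ,
       +-cancelʳ-< n 0 l ly2 , s≤s⁻¹ (subst (l <_) (double-suc m) ly1) ,
       +-cancelʳ-< n n (k + l) (subst (_< k + l + n) (+-comm n n) s2) , s≤s⁻¹ (subst (k + l <_) (triple-suc m) s1)

  InBand⇒hexAt : ∀ m k l → InBand (side m) (side m) (lowDiag m) (highDiag m) k l → hexAt (suc m) k l ≡ true
  InBand⇒hexAt m k l (k1 , k2 , l1 , l2 , s1 , s2) =
    let n = suc m in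
    inHex-complete n (+ k ℤ.- + n) (+ l ℤ.- + n)
      (subst (_< n) (sym (∣+m-+n∣≡∣m-n∣ k n)) (⇒∣m-n∣< k n n (subst (k <_) (sym (double-suc m)) (s≤s k2)) (subst (n <_) (+-comm n k) (subst (_< n + k) (+-identityʳ n) (+-monoʳ-< n k1)))))
      (subst (_< n) (sym (∣+m-+n∣≡∣m-n∣ l n)) (⇒∣m-n∣< l n n (subst (l <_) (sym (double-suc m)) (s≤s l2)) (subst (n <_) (+-comm n l) (subst (_< n + l) (+-identityʳ n) (+-monoʳ-< n l1)))))
      (subst (_< n) (sym (trans (cong ℤ.∣_∣ (shifted-sum k l n)) (∣+m-+n∣≡∣m-n∣ (k + l) (n + n))))
         (⇒∣m-n∣< (k + l) (n + n) n (subst (k + l <_) (sym (triple-suc m)) (s≤s s2)) (subst (n + n <_) (+-comm n (k + l)) (+-monoʳ-< n s1))))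

  -- Two hexagons are adjacent iff their coordinates differ by (1, 0), (0, 1) or (1, -1).
  module Region (m : ℕ) where
    hexagon : ℕ → ℕ → Bool
    hexagon = hexAt (suc m)
    InHexagon : ℕ → ℕ → Set
    InHexagon = InBand (side m) (side m) (lowDiag m) (highDiag m)

    hexagon⇒InHexagon : ∀ k l → hexagon k l ≡ true → InHexagon k l
    hexagon⇒InHexagon = hexAt⇒InBand m
    InHexagon⇒hexagon : ∀ k l → InHexagon k l → hexagon k l ≡ true
    InHexagon⇒hexagon = InBand⇒hexAt m

    pairₖ : ℕ → ℕ → Bool
    pairₖ k l = hexagon k l ∧ hexagon (suc k) l
    pairₖ⇒ : ∀ k l → InHexagon k l → InHexagon (suc k) l → InBand (m + m) (side m) (lowDiag m) (suc (m + m + m)) k l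
    pairₖ⇒ k l (k1 , k2 , l1 , l2 , s1 , s2) (_ , k2′ , _ , _ , _ , s2′) = k1 , s≤s⁻¹ k2′ , l1 , l2 , s1 , s≤s⁻¹ s2′
    ⇒pairₖ : ∀ k l → InBand (m + m) (side m) (lowDiag m) (suc (m + m + m)) k l → InHexagon k l × InHexagon (suc k) l
    ⇒pairₖ k l (t1 , t2 , t3 , t4 , t5 , t6) = (t1 , m≤n⇒m≤1+n t2 , t3 , t4 , t5 , m≤n⇒m≤1+n t6) , (z<s , s≤s t2 , t3 , t4 , m≤n⇒m≤1+n t5 , s≤s t6)

    pairₗ : ℕ → ℕ → Bool
    pairₗ k l = hexagon k l ∧ hexagon k (suc l)
    pairₗ⇒ : ∀ k l → InHexagon k l → InHexagon k (suc l) → InBand (side m) (m + m) (lowDiag m) (suc (m + m + m)) k l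
    pairₗ⇒ k l (k1 , k2 , l1 , l2 , s1 , s2) (_ , _ , _ , l2′ , _ , s2′) = k1 , k2 , l1 , s≤s⁻¹ l2′ , s1 , s≤s⁻¹ (subst (_≤ (highDiag m)) (+-suc k l) s2′)
    ⇒pairₗ : ∀ k l → InBand (side m) (m + m) (lowDiag m) (suc (m + m + m)) k l → InHexagon k l × InHexagon k (suc l)
    ⇒pairₗ k l (t1 , t2 , t3 , t4 , t5 , t6) = (t1 , t2 , t3 , m≤n⇒m≤1+n t4 , t5 , m≤n⇒m≤1+n t6) , (t1 , t2 , z<s , s≤s t4 , subst ((lowDiag m) ≤_) (sym (+-suc k l)) (m≤n⇒m≤1+n t5) , subst (_≤ (highDiag m)) (sym (+-suc k l)) (s≤s t6))

    pairᵈ : ℕ → ℕ → Bool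
    pairᵈ k l = hexagon (suc k) l ∧ hexagon k (suc l)
    pairᵈ⇒ : ∀ k l → InHexagon (suc k) l → InHexagon k (suc l) → InBand (m + m) (m + m) (suc m) (suc (m + m + m)) k l
    pairᵈ⇒ k l (_ , k2 , l1 , _ , s1 , s2) (k1 , _ , _ , l2 , _ , _) = k1 , s≤s⁻¹ k2 , l1 , s≤s⁻¹ l2 , s≤s⁻¹ s1 , s≤s⁻¹ s2
    ⇒pairᵈ : ∀ k l → InBand (m + m) (m + m) (suc m) (suc (m + m + m)) k l → InHexagon (suc k) l × InHexagon k (suc l)
    ⇒pairᵈ k l (t1 , t2 , t3 , t4 , t5 , t6) = (z<s , s≤s t2 , t3 , m≤n⇒m≤1+n t4 , s≤s t5 , s≤s t6) ,
      (t1 , m≤n⇒m≤1+n t2 , z<s , s≤s t4 , subst ((lowDiag m) ≤_) (sym (+-suc k l)) (s≤s t5) , subst (_≤ (highDiag m)) (sym (+-suc k l)) (s≤s t6))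

    triangle₁ : ℕ → ℕ → Bool
    triangle₁ k l = hexagon k l ∧ hexagon (suc k) l ∧ hexagon k (suc l)
    triangle₁⇒ : ∀ k l → InHexagon k l → InHexagon (suc k) l → InHexagon k (suc l) → InBand (m + m) (m + m) (lowDiag m) (suc (m + m + m)) k l
    triangle₁⇒ k l (k1 , k2 , l1 , l2 , s1 , s2) (_ , k2′ , _ , _ , _ , s2′) (_ , _ , _ , l2″ , _ , _) = k1 , s≤s⁻¹ k2′ , l1 , s≤s⁻¹ l2″ , s1 , s≤s⁻¹ s2′
    ⇒triangle₁ : ∀ k l → InBand (m + m) (m + m) (lowDiag m) (suc (m + m + m)) k l → InHexagon k l × InHexagon (suc k) l × InHexagon k (suc l)
    ⇒triangle₁ k l (t1 , t2 , t3 , t4 , t5 , t6) = (t1 , m≤n⇒m≤1+n t2 , t3 , m≤n⇒m≤1+n t4 , t5 , m≤n⇒m≤1+n t6) , (z<s , s≤s t2 , t3 , m≤n⇒m≤1+n t4 , m≤n⇒m≤1+n t5 , s≤s t6) ,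
      (t1 , m≤n⇒m≤1+n t2 , z<s , s≤s t4 , subst ((lowDiag m) ≤_) (sym (+-suc k l)) (m≤n⇒m≤1+n t5) , subst (_≤ (highDiag m)) (sym (+-suc k l)) (s≤s t6))

    triangle₂ : ℕ → ℕ → Bool
    triangle₂ k l = hexagon (suc k) (suc l) ∧ hexagon k (suc l) ∧ hexagon (suc k) l
    triangle₂⇒ : ∀ k l → InHexagon (suc k) (suc l) → InHexagon k (suc l) → InHexagon (suc k) l → InBand (m + m) (m + m) (suc m) (m + m + m) k l
    triangle₂⇒ k l (_ , _ , _ , _ , _ , s2) (k1 , _ , _ , l2 , _ , _) (_ , k2 , l1 , _ , s1 , _) = k1 , s≤s⁻¹ k2 , l1 , s≤s⁻¹ l2 , s≤s⁻¹ s1 , s≤s⁻¹ (s≤s⁻¹ (subst (_≤ (highDiag m)) (cong suc (+-suc k l)) s2))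
    ⇒triangle₂ : ∀ k l → InBand (m + m) (m + m) (suc m) (m + m + m) k l → InHexagon (suc k) (suc l) × InHexagon k (suc l) × InHexagon (suc k) l
    ⇒triangle₂ k l (t1 , t2 , t3 , t4 , t5 , t6) =
      (z<s , s≤s t2 , z<s , s≤s t4 , subst ((lowDiag m) ≤_) (sym (cong suc (+-suc k l))) (s≤s (m≤n⇒m≤1+n t5)) , subst (_≤ (highDiag m)) (sym (cong suc (+-suc k l))) (s≤s (s≤s t6))) ,
      (t1 , m≤n⇒m≤1+n t2 , z<s , s≤s t4 , subst ((lowDiag m) ≤_) (sym (+-suc k l)) (s≤s t5) , subst (_≤ (highDiag m)) (sym (+-suc k l)) (s≤s (m≤n⇒m≤1+n t6))) ,
      (z<s , s≤s t2 , t3 , m≤n⇒m≤1+n t4 , s≤s t5 , s≤s (m≤n⇒m≤1+n t6))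

module HexagonCounts where

  open import Data.Bool using (Bool; true)
  open import Data.Nat as ℕ
  open import Data.Nat.Properties
  import Data.Nat.Tactic.RingSolver as ℕ-Solver
  open import Data.Product using (_,_)
  open import Function using (_∘_)
  open import Relation.Binary.PropositionalEquality
  open Sums using (𝟙; bool-ext; ∧-true⁻; ∧-true⁺)
  open LatticeCounts
  open HexagonRegion

  *2-cancel : ∀ x v a b → 2 * x + a ≡ b → 2 * v + a ≡ b → x ≡ v
  *2-cancel x v a b e₁ e₂ = *-cancelˡ-≡ x v 2 (+-cancelʳ-≡ a (2 * x) (2 * v) (trans e₁ (sym e₂)))

  m≤2m : ∀ m → m ≤ m + m
  m≤2m m = m≤m+n m m
  m≤3m : ∀ m → m ≤ m + m + m
  m≤3m m = ≤-trans (m≤2m m) (m≤m+n (m + m) m)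
  m∸1≤ : ∀ m → m ∸ 1 ≤ m + m
  m∸1≤ m = ≤-trans (m∸n≤m m 1) (m≤2m m)

  module Counts (m : ℕ) where
    open Region m
    N : ℕ
    N = suc (suc m + suc m)
    gridSum : (ℕ → ℕ → ℕ) → ℕ
    gridSum f = sumBelow (λ k → sumBelow (λ l → f k l) N) N

    side<N : (side m) < N
    side<N = s≤s (s≤s (+-monoʳ-≤ m (n≤1+n m)))
    2m<N : m + m < N
    2m<N = ≤-trans (n≤1+n _) side<N

    private
      ≡inBox : ∀ {A B C D} (P : ℕ → ℕ → Bool) → (∀ k l → P k l ≡ true → InBand A B C D k l) →
        (∀ k l → InBand A B C D k l → P k l ≡ true) → ∀ k l → P k l ≡ inBox A B C D k l
      ≡inBox P sound complete k l =
        bool-ext (InBand⇒inBox _ _ _ _ k l ∘ sound k l) (complete k l ∘ inBox⇒InBand _ _ _ _ k l)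
      ↑ = hexagon⇒InHexagon
      ↓ = InHexagon⇒hexagon

    hexagon≡inBox : ∀ k l → hexagon k l ≡ inBox (side m) (side m) (lowDiag m) (highDiag m) k l
    hexagon≡inBox = ≡inBox hexagon ↑ ↓

    pairₖ≡inBox : ∀ k l → pairₖ k l ≡ inBox (m + m) (side m) (lowDiag m) (suc (m + m + m)) k l
    pairₖ≡inBox = ≡inBox pairₖ
      (λ k l e → let a , b = ∧-true⁻ e in pairₖ⇒ k l (↑ k l a) (↑ (suc k) l b))
      (λ k l i → let a , b = ⇒pairₖ k l i in ∧-true⁺ (↓ k l a) (↓ (suc k) l b))

    pairₗ≡inBox : ∀ k l → pairₗ k l ≡ inBox (side m) (m + m) (lowDiag m) (suc (m + m + m)) k l
    pairₗ≡inBox = ≡inBox pairₗ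
      (λ k l e → let a , b = ∧-true⁻ e in pairₗ⇒ k l (↑ k l a) (↑ k (suc l) b))
      (λ k l i → let a , b = ⇒pairₗ k l i in ∧-true⁺ (↓ k l a) (↓ k (suc l) b))

    pairᵈ≡inBox : ∀ k l → pairᵈ k l ≡ inBox (m + m) (m + m) (suc m) (suc (m + m + m)) k l
    pairᵈ≡inBox = ≡inBox pairᵈ
      (λ k l e → let a , b = ∧-true⁻ e in pairᵈ⇒ k l (↑ (suc k) l a) (↑ k (suc l) b))
      (λ k l i → let a , b = ⇒pairᵈ k l i in ∧-true⁺ (↓ (suc k) l a) (↓ k (suc l) b))

    triangle₁≡inBox : ∀ k l → triangle₁ k l ≡ inBox (m + m) (m + m) (lowDiag m) (suc (m + m + m)) k l
    triangle₁≡inBox = ≡inBox triangle₁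
      (λ k l e → let a , bc = ∧-true⁻ e ; b , c = ∧-true⁻ bc in triangle₁⇒ k l (↑ k l a) (↑ (suc k) l b) (↑ k (suc l) c))
      (λ k l i → let a , b , c = ⇒triangle₁ k l i in ∧-true⁺ (↓ k l a) (∧-true⁺ (↓ (suc k) l b) (↓ k (suc l) c)))

    triangle₂≡inBox : ∀ k l → triangle₂ k l ≡ inBox (m + m) (m + m) (suc m) (m + m + m) k l
    triangle₂≡inBox = ≡inBox triangle₂
      (λ k l e → let a , bc = ∧-true⁻ e ; b , c = ∧-true⁻ bc in triangle₂⇒ k l (↑ (suc k) (suc l) a) (↑ k (suc l) b) (↑ (suc k) l c))
      (λ k l i → let a , b , c = ⇒triangle₂ k l i in ∧-true⁺ (↓ (suc k) (suc l) a) (∧-true⁺ (↓ k (suc l) b) (↓ (suc k) l c)))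

    count-hexagon : 2 * gridSum (λ k l → 𝟙 (hexagon k l)) + m * suc m + m * suc m ≡ 2 * ((side m) * (side m))
    count-hexagon = count-inBox N (side m) (side m) (lowDiag m) (highDiag m) (suc (suc m)) hexagon side<N side<N hexagon≡inBox (e m)
      (s≤s (s≤s (m≤n⇒m≤1+n (m≤3m m)))) (m≤n⇒m≤1+n (m≤2m m)) (m≤n⇒m≤1+n (m≤2m m)) (m≤n⇒m≤1+n (m≤2m m)) (m≤n⇒m≤1+n (m≤2m m))
      where e : ∀ m → suc (m + m) + suc (m + m) + 2 ≡ suc (suc (m + m + m)) + suc (suc m)
            e = ℕ-Solver.solve-∀

    count-pairₖ : 2 * gridSum (λ k l → 𝟙 (pairₖ k l)) + m * suc m + m * suc m ≡ 2 * ((m + m) * (side m))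
    count-pairₖ = count-inBox N (m + m) (side m) (lowDiag m) (suc (m + m + m)) (suc (suc m)) pairₖ 2m<N side<N pairₖ≡inBox (e m)
      (s≤s (s≤s (m≤3m m))) (m≤2m m) (m≤n⇒m≤1+n (m≤2m m)) (m≤2m m) (m≤n⇒m≤1+n (m≤2m m))
      where e : ∀ m → m + m + suc (m + m) + 2 ≡ suc (m + m + m) + suc (suc m)
            e = ℕ-Solver.solve-∀

    count-pairₗ : 2 * gridSum (λ k l → 𝟙 (pairₗ k l)) + m * suc m + m * suc m ≡ 2 * ((side m) * (m + m))
    count-pairₗ = count-inBox N (side m) (m + m) (lowDiag m) (suc (m + m + m)) (suc (suc m)) pairₗ side<N 2m<N pairₗ≡inBox (e m)
      (s≤s (s≤s (m≤3m m))) (m≤n⇒m≤1+n (m≤2m m)) (m≤2m m) (m≤n⇒m≤1+n (m≤2m m)) (m≤2m m)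
      where e : ∀ m → suc (m + m) + (m + m) + 2 ≡ suc (m + m + m) + suc (suc m)
            e = ℕ-Solver.solve-∀

    count-pairᵈ : 2 * gridSum (λ k l → 𝟙 (pairᵈ k l)) + (m ∸ 1) * m + (m ∸ 1) * m ≡ 2 * ((m + m) * (m + m))
    count-pairᵈ = count-inBox N (m + m) (m + m) (suc m) (suc (m + m + m)) (suc m) pairᵈ 2m<N 2m<N pairᵈ≡inBox (e m)
      (s≤s (m≤n⇒m≤1+n (m≤3m m))) (m∸1≤ m) (m∸1≤ m) (m∸1≤ m) (m∸1≤ m)
      where e : ∀ m → m + m + (m + m) + 2 ≡ suc (m + m + m) + suc m
            e = ℕ-Solver.solve-∀

    count-triangle₁ : 2 * gridSum (λ k l → 𝟙 (triangle₁ k l)) + m * suc m + (m ∸ 1) * m ≡ 2 * ((m + m) * (m + m))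
    count-triangle₁ = count-inBox N (m + m) (m + m) (lowDiag m) (suc (m + m + m)) (suc m) triangle₁ 2m<N 2m<N triangle₁≡inBox (e m)
      (s≤s (s≤s (m≤3m m))) (m≤2m m) (m≤2m m) (m∸1≤ m) (m∸1≤ m)
      where e : ∀ m → m + m + (m + m) + 2 ≡ suc (m + m + m) + suc m
            e = ℕ-Solver.solve-∀

    count-triangle₂ : 2 * gridSum (λ k l → 𝟙 (triangle₂ k l)) + (m ∸ 1) * m + m * suc m ≡ 2 * ((m + m) * (m + m))
    count-triangle₂ = count-inBox N (m + m) (m + m) (suc m) (m + m + m) (suc (suc m)) triangle₂ 2m<N 2m<N triangle₂≡inBox (e m)
      (s≤s (m≤3m m)) (m∸1≤ m) (m∸1≤ m) (m≤2m m) (m≤2m m)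
      where e : ∀ m → m + m + (m + m) + 2 ≡ m + m + m + suc (suc m)
            e = ℕ-Solver.solve-∀

module WeightSum where

  open import Data.Bool using (Bool; true; false; _∧_)
  open import Data.Bool.Properties using (∧-comm)
  open import Data.Nat as ℕ
  open import Data.Nat.Properties
  import Data.Nat.Tactic.RingSolver as ℕ-Solver
  open import Data.Integer as ℤ using (ℤ; +_)
  import Data.Integer.Properties as ℤP
  open import Data.Integer.Tactic.RingSolver using (solve-∀)
  open import Data.List using (upTo)
  open import Data.Product using (_,_)
  open import Data.Empty using (⊥; ⊥-elim)
  open import Relation.Binary.PropositionalEquality
  open Sums using (𝟙; ∑; ∑-map)
  open HexCoordinates using (inHex)
  open HexSupport using (vertexWeight; hexRange; cellWeight)
  open LatticeCounts
  open HexagonRegion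
  open HexagonCounts

  vertexWeight-incl-excl : ∀ x y z → vertexWeight x y z + 112 * (𝟙 (x ∧ y) + 𝟙 (x ∧ z) + 𝟙 (y ∧ z)) ≡ 128 * (𝟙 x + 𝟙 y + 𝟙 z) + 96 * 𝟙 (x ∧ y ∧ z)
  vertexWeight-incl-excl true true true = refl
  vertexWeight-incl-excl true true false = refl
  vertexWeight-incl-excl true false true = refl
  vertexWeight-incl-excl true false false = refl
  vertexWeight-incl-excl false true true = refl
  vertexWeight-incl-excl false true false = refl
  vertexWeight-incl-excl false false true = refl
  vertexWeight-incl-excl false false false = refl

  incl-excl-+ : ∀ w1 w2 p1 p2 s1 s2 t1 t2 → w1 + 112 * p1 ≡ 128 * s1 + 96 * t1 → w2 + 112 * p2 ≡ 128 * s2 + 96 * t2 →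
    (w1 + w2) + 112 * (p1 + p2) ≡ 128 * (s1 + s2) + 96 * (t1 + t2)
  incl-excl-+ w1 w2 p1 p2 s1 s2 t1 t2 e₁ e₂ = trans (l1 w1 w2 p1 p2) (trans (cong₂ _+_ e₁ e₂) (l2 s1 s2 t1 t2))
    where l1 : ∀ w1 w2 p1 p2 → (w1 + w2) + 112 * (p1 + p2) ≡ (w1 + 112 * p1) + (w2 + 112 * p2)
          l1 = ℕ-Solver.solve-∀
          l2 : ∀ s1 s2 t1 t2 → (128 * s1 + 96 * t1) + (128 * s2 + 96 * t2) ≡ 128 * (s1 + s2) + 96 * (t1 + t2)
          l2 = ℕ-Solver.solve-∀

  𝟙-∧-comm : ∀ a b → 𝟙 (a ∧ b) ≡ 𝟙 (b ∧ a)
  𝟙-∧-comm a b = cong 𝟙 (∧-comm a b)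

  sumBelow-≡0 : ∀ f N → (∀ k → f k ≡ 0) → sumBelow f N ≡ 0
  sumBelow-≡0 f zero    f≡0 = refl
  sumBelow-≡0 f (suc N) f≡0 rewrite sumBelow-≡0 f N f≡0 | f≡0 N = refl

  1≰0 : 1 ≤ 0 → ⊥
  1≰0 ()

  module Cells (m : ℕ) where
    open Region m
    open Counts m

    gridSum-cong : ∀ {f g} → (∀ k l → f k l ≡ g k l) → gridSum f ≡ gridSum g
    gridSum-cong f≗g = sumBelow-cong N (λ k _ → sumBelow-cong N (λ l _ → f≗g k l))

    gridSum-+ : ∀ f g → gridSum (λ k l → f k l + g k l) ≡ gridSum f + gridSum g
    gridSum-+ f g = trans (sumBelow-cong N (λ k _ → sumBelow-+ (f k) (g k) N)) (sumBelow-+ _ _ N)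

    gridSum-* : ∀ c f → gridSum (λ k l → c * f k l) ≡ c * gridSum f
    gridSum-* c f = trans (sumBelow-cong N (λ k _ → sumBelow-*ˡ c (f k) N)) (sumBelow-*ˡ c _ N)

    gridSum-shiftₖ : ∀ f → (∀ l → f 0 l ≡ 0) → (∀ l → f N l ≡ 0) → gridSum (λ k l → f (suc k) l) ≡ gridSum f
    gridSum-shiftₖ f z0 zN = sumBelow-shift (λ k → sumBelow (f k) N) N (sumBelow-≡0 (f 0) N z0) (sumBelow-≡0 (f N) N zN)

    gridSum-shiftₗ : ∀ f → (∀ k → f k 0 ≡ 0) → (∀ k → f k N ≡ 0) → gridSum (λ k l → f k (suc l)) ≡ gridSum f
    gridSum-shiftₗ f z0 zN = sumBelow-cong N (λ k _ → sumBelow-shift (f k) N (z0 k) (zN k))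

    ≢true⇒≡false : ∀ {b} → (b ≡ true → ⊥) → b ≡ false
    ≢true⇒≡false {true}  b≢true = ⊥-elim (b≢true refl)
    ≢true⇒≡false {false} _      = refl

    hex-0ₖ : ∀ l → hexagon 0 l ≡ false
    hex-0ₖ l = ≢true⇒≡false (λ e → let (k1 , _) = hexagon⇒InHexagon 0 l e in 1≰0 k1)
    hex-Nₖ : ∀ l → hexagon N l ≡ false
    hex-Nₖ l = ≢true⇒≡false (λ e → let (_ , k2 , _) = hexagon⇒InHexagon N l e in <⇒≱ side<N k2)
    hex-0ₗ : ∀ k → hexagon k 0 ≡ false
    hex-0ₗ k = ≢true⇒≡false (λ e → let (_ , _ , l1 , _) = hexagon⇒InHexagon k 0 e in 1≰0 l1)
    hex-Nₗ : ∀ k → hexagon k N ≡ false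
    hex-Nₗ k = ≢true⇒≡false (λ e → let (_ , _ , _ , l2 , _) = hexagon⇒InHexagon k N e in <⇒≱ side<N l2)

    x y z x′ : ℕ → ℕ → Bool
    x k l = hexagon k l
    y k l = hexagon (suc k) l
    z k l = hexagon k (suc l)
    x′ k l = hexagon (suc k) (suc l)

    cellWeightAt : ℕ → ℕ → ℕ
    cellWeightAt k l = vertexWeight (x k l) (y k l) (z k l) + vertexWeight (x′ k l) (z k l) (y k l)
    pairsAt singlesAt trianglesAt : ℕ → ℕ → ℕ
    pairsAt k l = (𝟙 (x k l ∧ y k l) + 𝟙 (x k l ∧ z k l) + 𝟙 (y k l ∧ z k l)) + (𝟙 (x′ k l ∧ z k l) + 𝟙 (x′ k l ∧ y k l) + 𝟙 (z k l ∧ y k l))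
    singlesAt k l = (𝟙 (x k l) + 𝟙 (y k l) + 𝟙 (z k l)) + (𝟙 (x′ k l) + 𝟙 (z k l) + 𝟙 (y k l))
    trianglesAt k l = 𝟙 (x k l ∧ y k l ∧ z k l) + 𝟙 (x′ k l ∧ z k l ∧ y k l)

    incl-excl-at : ∀ k l → cellWeightAt k l + 112 * pairsAt k l ≡ 128 * singlesAt k l + 96 * trianglesAt k l
    incl-excl-at k l = incl-excl-+ (vertexWeight (x k l) (y k l) (z k l)) (vertexWeight (x′ k l) (z k l) (y k l))
      (𝟙 (x k l ∧ y k l) + 𝟙 (x k l ∧ z k l) + 𝟙 (y k l ∧ z k l)) (𝟙 (x′ k l ∧ z k l) + 𝟙 (x′ k l ∧ y k l) + 𝟙 (z k l ∧ y k l))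
      (𝟙 (x k l) + 𝟙 (y k l) + 𝟙 (z k l)) (𝟙 (x′ k l) + 𝟙 (z k l) + 𝟙 (y k l))
      (𝟙 (x k l ∧ y k l ∧ z k l)) (𝟙 (x′ k l ∧ z k l ∧ y k l)) (vertexWeight-incl-excl (x k l) (y k l) (z k l)) (vertexWeight-incl-excl (x′ k l) (z k l) (y k l))

    incl-excl-sum : gridSum cellWeightAt + 112 * gridSum pairsAt ≡ 128 * gridSum singlesAt + 96 * gridSum trianglesAt
    incl-excl-sum = trans (cong (λ s → gridSum cellWeightAt + s) (sym (gridSum-* 112 pairsAt)))
      (trans (sym (gridSum-+ cellWeightAt (λ k l → 112 * pairsAt k l)))
      (trans (gridSum-cong incl-excl-at)
      (trans (gridSum-+ (λ k l → 128 * singlesAt k l) (λ k l → 96 * trianglesAt k l))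
        (cong₂ _+_ (gridSum-* 128 singlesAt) (gridSum-* 96 trianglesAt)))))

    #hexagons = gridSum (λ k l → 𝟙 (hexagon k l))
    #pairsₖ = gridSum (λ k l → 𝟙 (pairₖ k l))
    #pairsₗ = gridSum (λ k l → 𝟙 (pairₗ k l))
    #pairsᵈ = gridSum (λ k l → 𝟙 (pairᵈ k l))
    #triangles₁ = gridSum (λ k l → 𝟙 (triangle₁ k l))
    #triangles₂ = gridSum (λ k l → 𝟙 (triangle₂ k l))

    gridSum-+₃ : ∀ f g i → gridSum (λ k l → f k l + g k l + i k l) ≡ gridSum f + gridSum g + gridSum i
    gridSum-+₃ f g i = trans (gridSum-+ (λ k l → f k l + g k l) i) (cong (_+ gridSum i) (gridSum-+ f g))

    ∑singlesₖ : gridSum (λ k l → 𝟙 (y k l)) ≡ #hexagons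
    ∑singlesₖ = gridSum-shiftₖ (λ k l → 𝟙 (hexagon k l)) (λ l → cong 𝟙 (hex-0ₖ l)) (λ l → cong 𝟙 (hex-Nₖ l))
    ∑singlesₗ : gridSum (λ k l → 𝟙 (z k l)) ≡ #hexagons
    ∑singlesₗ = gridSum-shiftₗ (λ k l → 𝟙 (hexagon k l)) (λ k → cong 𝟙 (hex-0ₗ k)) (λ k → cong 𝟙 (hex-Nₗ k))
    ∑singlesₖₗ : gridSum (λ k l → 𝟙 (x′ k l)) ≡ #hexagons
    ∑singlesₖₗ = trans (gridSum-shiftₖ (λ k l → 𝟙 (hexagon k (suc l))) (λ l → cong 𝟙 (hex-0ₖ (suc l))) (λ l → cong 𝟙 (hex-Nₖ (suc l)))) ∑singlesₗ

    ∑singles : gridSum singlesAt ≡ 6 * #hexagons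
    ∑singles = trans (gridSum-+ (λ k l → 𝟙 (x k l) + 𝟙 (y k l) + 𝟙 (z k l)) (λ k l → 𝟙 (x′ k l) + 𝟙 (z k l) + 𝟙 (y k l)))
      (trans (cong₂ _+_ (gridSum-+₃ (λ k l → 𝟙 (x k l)) (λ k l → 𝟙 (y k l)) (λ k l → 𝟙 (z k l))) (gridSum-+₃ (λ k l → 𝟙 (x′ k l)) (λ k l → 𝟙 (z k l)) (λ k l → 𝟙 (y k l))))
      (trans (cong₂ _+_ (cong₂ _+_ (cong (λ s → #hexagons + s) ∑singlesₖ) ∑singlesₗ) (cong₂ _+_ (cong₂ _+_ ∑singlesₖₗ ∑singlesₗ) ∑singlesₖ)) (l #hexagons)))
      where l : ∀ s → s + s + s + (s + s + s) ≡ 6 * s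
            l = ℕ-Solver.solve-∀

    ∑pairsₖ : gridSum (λ k l → 𝟙 (x′ k l ∧ z k l)) ≡ #pairsₖ
    ∑pairsₖ = trans (gridSum-cong (λ k l → 𝟙-∧-comm (x′ k l) (z k l)))
      (gridSum-shiftₗ (λ k l → 𝟙 (pairₖ k l)) (λ k → cong (λ b → 𝟙 (b ∧ hexagon (suc k) 0)) (hex-0ₗ k)) (λ k → cong (λ b → 𝟙 (b ∧ hexagon (suc k) N)) (hex-Nₗ k)))
    ∑pairsₗ : gridSum (λ k l → 𝟙 (x′ k l ∧ y k l)) ≡ #pairsₗ
    ∑pairsₗ = trans (gridSum-cong (λ k l → 𝟙-∧-comm (x′ k l) (y k l)))
      (gridSum-shiftₖ (λ k l → 𝟙 (pairₗ k l)) (λ l → cong (λ b → 𝟙 (b ∧ hexagon 0 (suc l))) (hex-0ₖ l)) (λ l → cong (λ b → 𝟙 (b ∧ hexagon N (suc l))) (hex-Nₖ l)))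
    ∑pairsᵈ : gridSum (λ k l → 𝟙 (z k l ∧ y k l)) ≡ #pairsᵈ
    ∑pairsᵈ = gridSum-cong (λ k l → 𝟙-∧-comm (z k l) (y k l))

    ∑pairs : gridSum pairsAt ≡ 2 * (#pairsₖ + #pairsₗ + #pairsᵈ)
    ∑pairs = trans (gridSum-+ (λ k l → 𝟙 (x k l ∧ y k l) + 𝟙 (x k l ∧ z k l) + 𝟙 (y k l ∧ z k l)) (λ k l → 𝟙 (x′ k l ∧ z k l) + 𝟙 (x′ k l ∧ y k l) + 𝟙 (z k l ∧ y k l)))
      (trans (cong₂ _+_ (gridSum-+₃ (λ k l → 𝟙 (x k l ∧ y k l)) (λ k l → 𝟙 (x k l ∧ z k l)) (λ k l → 𝟙 (y k l ∧ z k l)))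
                        (gridSum-+₃ (λ k l → 𝟙 (x′ k l ∧ z k l)) (λ k l → 𝟙 (x′ k l ∧ y k l)) (λ k l → 𝟙 (z k l ∧ y k l))))
      (trans (cong (λ s → #pairsₖ + #pairsₗ + #pairsᵈ + s) (cong₂ _+_ (cong₂ _+_ ∑pairsₖ ∑pairsₗ) ∑pairsᵈ)) (l #pairsₖ #pairsₗ #pairsᵈ)))
      where l : ∀ a b c → a + b + c + (a + b + c) ≡ 2 * (a + b + c)
            l = ℕ-Solver.solve-∀

    ∑triangles : gridSum trianglesAt ≡ #triangles₁ + #triangles₂
    ∑triangles = gridSum-+ (λ k l → 𝟙 (x k l ∧ y k l ∧ z k l)) (λ k l → 𝟙 (x′ k l ∧ z k l ∧ y k l))

    -- Every hexagon has six vertices, two adjacent hexagons share two and three mutually adjacent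
    -- hexagons share one.
    incl-excl-total : gridSum cellWeightAt + 112 * (2 * (#pairsₖ + #pairsₗ + #pairsᵈ)) ≡ 128 * (6 * #hexagons) + 96 * (#triangles₁ + #triangles₂)
    incl-excl-total = trans (cong (λ q → gridSum cellWeightAt + 112 * q) (sym ∑pairs)) (trans incl-excl-sum (cong₂ (λ a b → 128 * a + 96 * b) ∑singles ∑triangles))

  *2-cancel′ : ∀ x v p q b → 2 * x + p + q ≡ b → 2 * v + p + q ≡ b → x ≡ v
  *2-cancel′ x v p q b e₁ e₂ = *2-cancel x v (p + q) b (trans (sym (+-assoc (2 * x) p q)) e₁) (trans (sym (+-assoc (2 * v) p q)) e₂)

  hexagonsOf pairsOf trianglesOf : ℕ → ℕ
  hexagonsOf m = suc (3 * m * m + 3 * m)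
  pairsOf m = 3 * m * m + m
  trianglesOf m = 3 * m * m

  hexagonsOf-count : ∀ m → 2 * suc (3 * m * m + 3 * m) + m * suc m + m * suc m ≡ 2 * (suc (m + m) * suc (m + m))
  hexagonsOf-count = ℕ-Solver.solve-∀
  pairsOf-countₖ : ∀ m → 2 * (3 * m * m + m) + m * suc m + m * suc m ≡ 2 * ((m + m) * suc (m + m))
  pairsOf-countₖ = ℕ-Solver.solve-∀
  pairsOf-countₗ : ∀ m → 2 * (3 * m * m + m) + m * suc m + m * suc m ≡ 2 * (suc (m + m) * (m + m))
  pairsOf-countₗ = ℕ-Solver.solve-∀
  pairsOf-countᵈ : ∀ m → 2 * (3 * m * m + m) + (m ∸ 1) * m + (m ∸ 1) * m ≡ 2 * ((m + m) * (m + m))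
  pairsOf-countᵈ zero = refl
  pairsOf-countᵈ (suc m) = l m
    where l : ∀ m → 2 * (3 * (suc m) * (suc m) + (suc m)) + m * suc m + m * suc m ≡ 2 * ((suc m + suc m) * (suc m + suc m))
          l = ℕ-Solver.solve-∀
  trianglesOf-count₁ : ∀ m → 2 * (3 * m * m) + m * suc m + (m ∸ 1) * m ≡ 2 * ((m + m) * (m + m))
  trianglesOf-count₁ zero = refl
  trianglesOf-count₁ (suc m) = l m
    where l : ∀ m → 2 * (3 * (suc m) * (suc m)) + suc m * suc (suc m) + m * suc m ≡ 2 * ((suc m + suc m) * (suc m + suc m))
          l = ℕ-Solver.solve-∀
  trianglesOf-count₂ : ∀ m → 2 * (3 * m * m) + (m ∸ 1) * m + m * suc m ≡ 2 * ((m + m) * (m + m))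
  trianglesOf-count₂ zero = refl
  trianglesOf-count₂ (suc m) = l m
    where l : ∀ m → 2 * (3 * (suc m) * (suc m)) + m * suc m + suc m * suc (suc m) ≡ 2 * ((suc m + suc m) * (suc m + suc m))
          l = ℕ-Solver.solve-∀

  9n∸1 : ∀ m → 9 * suc m ∸ 1 ≡ 8 + 9 * m
  9n∸1 m = cong (_∸ 1) (l m)
    where l : ∀ m → 9 * suc m ≡ suc (8 + 9 * m)
          l = ℕ-Solver.solve-∀

  module Total (m : ℕ) where
    open Region m
    open Counts m
    open Cells m

    #hexagons≡ : #hexagons ≡ hexagonsOf m
    #hexagons≡ = *2-cancel′ _ _ _ _ _ count-hexagon (hexagonsOf-count m)
    #pairsₖ≡ : #pairsₖ ≡ pairsOf m
    #pairsₖ≡ = *2-cancel′ _ _ _ _ _ count-pairₖ (pairsOf-countₖ m)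
    #pairsₗ≡ : #pairsₗ ≡ pairsOf m
    #pairsₗ≡ = *2-cancel′ _ _ _ _ _ count-pairₗ (pairsOf-countₗ m)
    #pairsᵈ≡ : #pairsᵈ ≡ pairsOf m
    #pairsᵈ≡ = *2-cancel′ _ _ _ _ _ count-pairᵈ (pairsOf-countᵈ m)
    #triangles₁≡ : #triangles₁ ≡ trianglesOf m
    #triangles₁≡ = *2-cancel′ _ _ _ _ _ count-triangle₁ (trianglesOf-count₁ m)
    #triangles₂≡ : #triangles₂ ≡ trianglesOf m
    #triangles₂≡ = *2-cancel′ _ _ _ _ _ count-triangle₂ (trianglesOf-count₂ m)

    gridSum-cellWeight : gridSum cellWeightAt ≡ 96 * suc m * (9 * suc m ∸ 1)
    gridSum-cellWeight = +-cancelʳ-≡ (112 * (2 * (pairsOf m + pairsOf m + pairsOf m))) _ _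
      (trans (subst₂ (λ a b → gridSum cellWeightAt + 112 * (2 * a) ≡ b) (cong₂ _+_ (cong₂ _+_ #pairsₖ≡ #pairsₗ≡) #pairsᵈ≡)
                     (cong₂ (λ a b → 128 * (6 * a) + 96 * b) #hexagons≡ (cong₂ _+_ #triangles₁≡ #triangles₂≡)) incl-excl-total)
        (sym (trans (cong (λ q → 96 * suc m * q + 112 * (2 * (pairsOf m + pairsOf m + pairsOf m))) (9n∸1 m)) (l m))))
      where l : ∀ m → 96 * suc m * (8 + 9 * m) + 112 * (2 * ((3 * m * m + m) + (3 * m * m + m) + (3 * m * m + m))) ≡ 128 * (6 * suc (3 * m * m + 3 * m)) + 96 * ((3 * m * m) + (3 * m * m))
            l = ℕ-Solver.solve-∀

    n = suc m

    shift-suc : ∀ k → (+ k ℤ.- + n) ℤ.+ + 1 ≡ + suc k ℤ.- + n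
    shift-suc k = trans (l (+ k) (+ n)) (cong (ℤ._- + n) (sym (ℤP.pos-+ 1 k)))
      where l : ∀ a b → (a ℤ.- b) ℤ.+ + 1 ≡ (+ 1 ℤ.+ a) ℤ.- b
            l = solve-∀

    cellWeight-shifted : ∀ a b a′ b′ → a ℤ.+ + 1 ≡ a′ → b ℤ.+ + 1 ≡ b′ →
      cellWeight n a b ≡ vertexWeight (inHex n a b) (inHex n a′ b) (inHex n a b′) + vertexWeight (inHex n a′ b′) (inHex n a b′) (inHex n a′ b)
    cellWeight-shifted a b _ _ refl refl = refl

    centred : ℕ → ℤ
    centred k = + k ℤ.- + n

    hexRange-sum : ∑ (λ a → ∑ (λ b → cellWeight n a b) (hexRange n)) (hexRange n) ≡ gridSum cellWeightAt
    hexRange-sum =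
      trans (∑-map (λ a → ∑ (λ b → cellWeight n a b) (hexRange n)) centred (upTo N))
      (trans (∑-applyUpTo (λ k → ∑ (λ b → cellWeight n (centred k) b) (hexRange n)) (λ x → x) N)
      (sumBelow-cong N (λ k _ → trans (∑-map (λ b → cellWeight n (centred k) b) centred (upTo N))
         (trans (∑-applyUpTo (λ l → cellWeight n (centred k) (centred l)) (λ x → x) N)
           (sumBelow-cong N (λ l _ → cellWeight-shifted (centred k) (centred l) _ _ (shift-suc k) (shift-suc l)))))))

    ∑cellWeight : ∑ (λ a → ∑ (λ b → cellWeight n a b) (hexRange n)) (hexRange n) ≡ 96 * n * (9 * n ∸ 1)
    ∑cellWeight = trans hexRange-sum gridSum-cellWeight

open import Data.Nat using (ℕ; suc; _*_; _∸_; _≤_; s≤s; z≤n)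
open import Function using (_∘_)
open import Relation.Binary.PropositionalEquality using (_≡_; module ≡-Reasoning)
open import Defs
open Sums using (∑)
open Octahedral using (M₁-POHof)
open HexSupport using (HC-isSimple; deg-HC-2-or-3; weight; ∑-HC; cellWeight; hexRange)
open WeightSum using (module Total)

mainTheorem2 : (n : ℕ) → 1 ≤ n → M₁ (POH n) ≡ 96 * n * (9 * n ∸ 1)
mainTheorem2 n@(suc m) (s≤s z≤n) = begin
  M₁ (POH n)                                            ≡⟨ M₁-POHof (HC n) (HC-isSimple n) (deg-HC-2-or-3 n) ⟩
  ∑ (weight ∘ deg (HC n)) (verts (HC n))                ≡⟨ ∑-HC n ⟩
  ∑ (λ a → ∑ (cellWeight n a) (hexRange n)) (hexRange n) ≡⟨ Total.∑cellWeight m ⟩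
  96 * n * (9 * n ∸ 1)                                  ∎
  where open ≡-Reasoning
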